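{- Let $q$ be a prime power and let $E,F$ be $\mathbb F_q$-subspaces of $\mathbb F_{q^n}$ with $E\cap F=\{0\}$. Let $v_1,\dots,v_k$ be an $\mathbb F_q$-basis of $E$ and $L_E(X)=\prod_{u\in E}(X+u)$. Then \[ \sum_{0\ne u\in E\oplus F}\frac 1{u^{q-1}}=\sum_{0\ne u\in E}\frac 1{u^{q-1}}+\Delta(v_1,\dots,v_k)^{(q-1)^2}\sum_{0\ne v\in L_E(F)}\frac 1{v^{q-1}}. \]
   Context: $\Delta(X_1,\dots,X_k)=\det\bigl(X_j^{q^i}\bigr)_{0\le i\le k-1,\,1\le j\le k}$ is the Moore determinant over $\mathbb F_q$. $L_E$ is an $\mathbb F_q$-linear map of $\mathbb F_{q^n}$ with kernel $E$. -}

module Defs where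

open import Level using (Level; _⊔_) renaming (suc to lsuc)
open import Algebra.Bundles using (CommutativeRing)
open import Data.Nat as ℕ using (ℕ; zero; suc)
open import Data.Nat.Primality using (Prime)
open import Data.Fin using (Fin; zero; suc; punchIn)
open import Data.List using (List; []; _∷_; length; filter)
open import Data.List.Relation.Unary.Any using (Any)
open import Data.List.Relation.Unary.Any as Any using ()
open import Data.List.Relation.Unary.AllPairs using (AllPairs)
open import Data.Product using (Σ; _×_; ∃)
open import Relation.Nullary using (¬_; Dec; yes; no)
open import Relation.Nullary.Decidable using (_×-dec_)
open import Data.Product using (_,_)
import Data.Fin
open import Relation.Unary using (Pred; Decidable)
import Relation.Binary as B
open import Relation.Binary.PropositionalEquality using (_≡_)

IsPrimePower : ℕ → Set
IsPrimePower q = Σ ℕ λ p → Σ ℕ λ m → Prime p × q ≡ p ℕ.^ suc m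

record FiniteField (c ℓ : Level) : Set (lsuc (c ⊔ ℓ)) where
  field
    commRing : CommutativeRing c ℓ
  open CommutativeRing commRing public
  field
    _≟_        : B.Decidable _≈_
    0≉1        : ¬ (0# ≈ 1#)
    _⁻¹        : Carrier → Carrier
    ⁻¹-inverse : ∀ x → ¬ (x ≈ 0#) → x * (x ⁻¹) ≈ 1#
    elements   : List Carrier
    complete   : ∀ x → Any (x ≈_) elements
    distinct   : AllPairs (λ x y → ¬ (x ≈ y)) elements

module _ {c ℓ : Level} (K : FiniteField c ℓ) where
  open FiniteField K hiding (zero)

  _^_ : Carrier → ℕ → Carrier
  x ^ zero  = 1#
  x ^ suc m = x * (x ^ m)

  card : ℕ
  card = length elements

  InFq : ℕ → Carrier → Set ℓ
  InFq q a = (a ^ q) ≈ a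

  record Subspace (q : ℕ) : Set (c ⊔ lsuc ℓ) where
    field
      mem      : Pred Carrier ℓ
      mem?     : Decidable mem
      resp     : ∀ {x y} → x ≈ y → mem x → mem y
      mem-0    : mem 0#
      mem-+    : ∀ {x y} → mem x → mem y → mem (x + y)
      mem-smul : ∀ {a x} → InFq q a → mem x → mem (a * x)
  open Subspace public

  -- sum of f over the elements of K satisfying a decidable predicate
  -- (each element of K is counted exactly once, as `elements` is duplicate-free)
  sumList : List Carrier → (Carrier → Carrier) → Carrier
  sumList []       f = 0#
  sumList (x ∷ xs) f = f x + sumList xs f

  prodList : List Carrier → (Carrier → Carrier) → Carrier
  prodList []       f = 1#
  prodList (x ∷ xs) f = f x * prodList xs f

  sumOver : {p : Level} {P : Pred Carrier p} → Decidable P → (Carrier → Carrier) → Carrier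
  sumOver P? f = sumList (filter P? elements) f

  prodOver : {p : Level} {P : Pred Carrier p} → Decidable P → (Carrier → Carrier) → Carrier
  prodOver P? f = prodList (filter P? elements) f

  NonzeroIn : {p : Level} → Pred Carrier p → Pred Carrier (ℓ ⊔ p)
  NonzeroIn P x = ¬ (x ≈ 0#) × P x

  nonzeroIn? : {p : Level} {P : Pred Carrier p} → Decidable P → Decidable (NonzeroIn P)
  nonzeroIn? P? x with x ≟ 0# | P? x
  ... | yes x≈0 | _     = no λ { (x≉0 , _) → x≉0 x≈0 }
  ... | no x≉0  | yes p = yes (x≉0 , p)
  ... | no _    | no ¬p = no λ { (_ , p) → ¬p p }

  invPowSum : (q : ℕ) {p : Level} {P : Pred Carrier p} → Decidable P → Carrier
  invPowSum q P? = sumOver (nonzeroIn? P?) (λ u → (u ^ (q ℕ.∸ 1)) ⁻¹)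

  InSum : {q : ℕ} → Subspace q → Subspace q → Pred Carrier (c ⊔ ℓ)
  InSum E F x = Any (λ e → mem E e × mem F (x - e)) elements

  inSum? : {q : ℕ} (E F : Subspace q) → Decidable (InSum E F)
  inSum? E F x = Any.any? (λ e → mem? E e ×-dec mem? F (x - e)) elements

  L : {q : ℕ} → Subspace q → Carrier → Carrier
  L E x = prodOver (mem? E) (λ u → x + u)

  InImage : {q : ℕ} → Subspace q → Subspace q → Pred Carrier (c ⊔ ℓ)
  InImage E F v = Any (λ f → mem F f × v ≈ L E f) elements

  inImage? : {q : ℕ} (E F : Subspace q) → Decidable (InImage E F)
  inImage? E F v = Any.any? (λ f → mem? F f ×-dec (v ≟ L E f)) elements

  Σ[<_]_ : (k : ℕ) → (Fin k → Carrier) → Carrier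
  Σ[< zero  ] f = 0#
  Σ[< suc k ] f = f zero + (Σ[< k ] λ i → f (suc i))

  det : (k : ℕ) → (Fin k → Fin k → Carrier) → Carrier
  det zero    M = 1#
  det (suc k) M = Σ[< suc k ] λ j → sign j * (M zero j * det k (λ i l → M (suc i) (punchIn j l)))
    where
      sign : {m : ℕ} → Fin m → Carrier
      sign zero    = 1#
      sign (suc j) = - sign j

  moore : (q k : ℕ) → (Fin k → Carrier) → Carrier
  moore q k v = det k (λ i j → v j ^ (q ℕ.^ Data.Fin.toℕ i))

  IsBasis : (q k : ℕ) → Subspace q → (Fin k → Carrier) → Set (c ⊔ ℓ)
  IsBasis q k E v =
    (∀ i → mem E (v i)) ×
    (∀ (a : Fin k → Carrier) → (∀ i → InFq q (a i)) →
        (Σ[< k ] λ i → a i * v i) ≈ 0# → ∀ i → a i ≈ 0#) ×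
    (∀ x → mem E x → ∃ λ (a : Fin k → Carrier) →
        (∀ i → InFq q (a i)) × x ≈ (Σ[< k ] λ i → a i * v i))

{-# OPTIONS --safe #-}
module Submission where

-- E ⊕ F minus E is the disjoint union of the cosets f + E, 0 ≠ f ∈ F, so everything reduces to
-- the coset sum ∑_{e ∈ E} 1/(f + e)^(q-1) = Δ(v)^((q-1)²) / L_E(f)^(q-1) for f ∉ E.  This is
-- proved by induction on the basis v₀, v′: the coset splits into the q cosets f + a v₀ + E′
-- (a ∈ 𝔽_q, E′ = span v′), and
--   ∑_{a ∈ 𝔽_q} 1/(Y + a c)^(q-1) = c^((q-1)²) / (Y^q - c^(q-1) Y)^(q-1)        (c ≠ 0)
-- matches the recursions L_E(X) = L_E′(X)^q - L_E′(v₀)^(q-1) L_E′(X), which comes from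
-- ∏_{a ∈ 𝔽_q} (Y + a c) = Y^q - c^(q-1) Y, and Δ(v) = ± Δ(v′) L_E′(v₀): expanded along its first
-- row, Δ(x, v′) is 𝔽_q-linear in x of degree q^k and vanishes on E′, so it is a multiple of L_E′.
-- Finally L_E is 𝔽_q-linear with kernel E, hence injective on F, and the sum over f ∈ F becomes
-- the sum over L_E(F).

open import Level using (Level; _⊔_; Lift; lift; lower)
open import Algebra.Bundles using (CommutativeRing; CommutativeMonoid)
open import Algebra.Solver.Ring.AlmostCommutativeRing using (fromCommutativeRing; _-Raw-AlmostCommutative⟶_)
open import Data.Empty using (⊥-elim)
open import Data.Fin using (Fin; zero; suc; punchIn; punchOut; toℕ; fromℕ)
open import Data.Fin.Properties using (punchIn-punchOut; toℕ-fromℕ) renaming (_≟_ to _≟ᶠ_)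
import Data.Integer as ℤ
import Data.Integer.Properties as ℤ
open import Data.List using (List; []; _∷_; length; filter; map; _++_; concatMap; replicate)
import Data.List.Properties as List
import Data.List.Membership.Setoid.Properties as ∈
open import Data.List.Relation.Unary.All using (All; []; _∷_; tabulateₛ; universal-U)
open import Data.List.Relation.Unary.All.Properties using (─⁺; ++⁻ʳ)
open import Data.List.Relation.Unary.AllPairs using ([]; _∷_)
open import Data.List.Relation.Unary.Any as Any using (Any; here; there; _─_)
import Data.List.Relation.Unary.Unique.Setoid.Properties as Unique
open import Data.Maybe using (Maybe; just; nothing)
open import Data.Nat as ℕ using (ℕ; zero; suc; _≤_; _<_; _∸_; z≤n; s≤s; _!) renaming (_^_ to _^ℕ_; _*_ to _*ℕ_)
import Data.Nat.Properties as ℕ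
open import Data.Nat.Combinatorics using (nCk≡n!/k![n-k]!; k![n∸k]!∣n!; nCn≡1) renaming (_C_ to _choose_)
open import Data.Nat.DivMod using (m/n*n≡m)
open import Data.Nat.Divisibility using (_∣_; ∣⇒≤; m∣m*n; divides)
open import Data.Nat.Primality using (Prime; euclidsLemma; prime⇒nonTrivial)
open import Data.Product using (Σ; _×_; _,_; proj₁; proj₂; uncurry)
open import Data.Sign as Sign using (Sign)
open import Data.Sum using (_⊎_; inj₁; inj₂)
open import Data.Unit using (tt)
open import Data.Vec.Functional using (head; tail; insertAt; removeAt) renaming (_∷_ to _∷ᵥ_)
open import Data.Vec.Functional.Properties using (insertAt-lookup; insertAt-punchIn)
open import Function using (_∘_; id)
open import Function.Definitions using (Congruent)
open import Relation.Binary.Definitions using (_Respects_)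
open import Relation.Binary.PropositionalEquality as ≡ using (_≡_)
open import Relation.Nullary using (¬_; yes; no)
open import Relation.Nullary.Decidable using (_×-dec_)
open import Relation.Unary using (Pred; Decidable; U; _⊆_; _≐_; ∁; _∩_)
open import Relation.Unary.Properties using (U?; _∩?_; ∁?)
import Defs
open Defs using (FiniteField; IsPrimePower; InFq; Subspace; mem; mem?; resp; mem-0; mem-+; mem-smul; IsBasis; NonzeroIn; nonzeroIn?; InSum; inSum?; InImage; inImage?; invPowSum)

-- Integer coefficients for Algebra.Solver.Ring, whose normaliser needs a coefficient ring
-- with computable equality.
module IntegerSemantics {r ℓr : Level} (R : CommutativeRing r ℓr) where

  open import Data.Integer using (ℤ; +_; -[1+_])
  open CommutativeRing R
  open import Algebra.Properties.Ring ring using (-‿involutive; -0#≈0#; -1*x≈-x; -‿+-comm)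
  open import Algebra.Properties.Semiring.Mult semiring using () renaming (_×_ to _·_; ×-homo-+ to ·-homo-+; ×1-homo-* to ·1-homo-*)
  open import Algebra.Properties.CommutativeSemigroup *-commutativeSemigroup using (interchange)
  open import Algebra.Properties.CommutativeSemigroup +-commutativeSemigroup
    using () renaming (x∙yz≈y∙xz to x+yz≈y+xz)
  open import Relation.Binary.Reasoning.Setoid setoid

  ⟦_⟧ˢ : Sign → Carrier
  ⟦ Sign.+ ⟧ˢ = 1#
  ⟦ Sign.- ⟧ˢ = - 1#

  ⟦_⟧ᶻ : ℤ → Carrier
  ⟦ + n ⟧ᶻ      = n · 1#
  ⟦ -[1+ n ] ⟧ᶻ = - (suc n · 1#)

  ⟦⟧ˢ-homo-* : ∀ s t → ⟦ s Sign.* t ⟧ˢ ≈ ⟦ s ⟧ˢ * ⟦ t ⟧ˢ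
  ⟦⟧ˢ-homo-* Sign.+ t      = sym (*-identityˡ _)
  ⟦⟧ˢ-homo-* Sign.- Sign.+ = sym (*-identityʳ _)
  ⟦⟧ˢ-homo-* Sign.- Sign.- = sym (trans (-1*x≈-x (- 1#)) (-‿involutive 1#))

  ◃-homo : ∀ s n → ⟦ s ℤ.◃ n ⟧ᶻ ≈ ⟦ s ⟧ˢ * (n · 1#)
  ◃-homo s      zero    = sym (zeroʳ _)
  ◃-homo Sign.+ (suc n) = sym (*-identityˡ _)
  ◃-homo Sign.- (suc n) = sym (-1*x≈-x _)

  sign-abs-homo : ∀ i → ⟦ i ⟧ᶻ ≈ ⟦ ℤ.sign i ⟧ˢ * (ℤ.∣ i ∣ · 1#)
  sign-abs-homo i = trans (reflexive (≡.cong ⟦_⟧ᶻ (≡.sym (ℤ.◃-inverse i)))) (◃-homo (ℤ.sign i) ℤ.∣ i ∣)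

  -‿homo : ∀ i → ⟦ ℤ.- i ⟧ᶻ ≈ - ⟦ i ⟧ᶻ
  -‿homo -[1+ n ]    = sym (-‿involutive _)
  -‿homo (+ zero)    = sym -0#≈0#
  -‿homo (+ (suc n)) = refl

  ⊖-homo : ∀ m n → ⟦ m ℤ.⊖ n ⟧ᶻ ≈ m · 1# - n · 1#
  ⊖-homo zero    zero    = sym (-‿inverseʳ 0#)
  ⊖-homo zero    (suc n) = sym (+-identityˡ _)
  ⊖-homo (suc m) zero    = sym (trans (+-congˡ -0#≈0#) (+-identityʳ _))
  ⊖-homo (suc m) (suc n) = begin
    ⟦ suc m ℤ.⊖ suc n ⟧ᶻ                     ≡⟨ ≡.cong ⟦_⟧ᶻ (ℤ.[1+m]⊖[1+n]≡m⊖n m n) ⟩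
    ⟦ m ℤ.⊖ n ⟧ᶻ                             ≈⟨ ⊖-homo m n ⟩
    m · 1# - n · 1#                          ≈⟨ sym (+-identityˡ _) ⟩
    0# + (m · 1# - n · 1#)                   ≈⟨ +-congʳ (sym (-‿inverseʳ 1#)) ⟩
    (1# + - 1#) + (m · 1# + - (n · 1#))      ≈⟨ +-assoc _ _ _ ⟩
    1# + (- 1# + (m · 1# + - (n · 1#)))      ≈⟨ +-congˡ (x+yz≈y+xz _ _ _) ⟩
    1# + (m · 1# + (- 1# + - (n · 1#)))      ≈⟨ sym (+-assoc _ _ _) ⟩
    (1# + m · 1#) + (- 1# + - (n · 1#))      ≈⟨ +-congˡ (-‿+-comm 1# (n · 1#)) ⟩
    suc m · 1# - suc n · 1#                  ∎

  +-homo : ∀ i j → ⟦ i ℤ.+ j ⟧ᶻ ≈ ⟦ i ⟧ᶻ + ⟦ j ⟧ᶻ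
  +-homo -[1+ m ] -[1+ n ] = begin
    - (suc (suc (m ℕ.+ n)) · 1#)              ≡⟨ ≡.cong (λ k → - (suc k · 1#)) (≡.sym (ℕ.+-suc m n)) ⟩
    - ((suc m ℕ.+ suc n) · 1#)                ≈⟨ -‿cong (·-homo-+ 1# (suc m) (suc n)) ⟩
    - (suc m · 1# + suc n · 1#)               ≈⟨ sym (-‿+-comm _ _) ⟩
    - (suc m · 1#) + - (suc n · 1#)           ∎
  +-homo -[1+ m ] (+ n)    = trans (⊖-homo n (suc m)) (+-comm _ _)
  +-homo (+ m)    -[1+ n ] = ⊖-homo m (suc n)
  +-homo (+ m)    (+ n)    = ·-homo-+ 1# m n

  *-homo : ∀ i j → ⟦ i ℤ.* j ⟧ᶻ ≈ ⟦ i ⟧ᶻ * ⟦ j ⟧ᶻ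
  *-homo i j = begin
    ⟦ i ℤ.* j ⟧ᶻ                                                 ≈⟨ ◃-homo (ℤ.sign i Sign.* ℤ.sign j) (ℤ.∣ i ∣ ℕ.* ℤ.∣ j ∣) ⟩
    ⟦ ℤ.sign i Sign.* ℤ.sign j ⟧ˢ * ((ℤ.∣ i ∣ ℕ.* ℤ.∣ j ∣) · 1#)  ≈⟨ *-cong (⟦⟧ˢ-homo-* (ℤ.sign i) (ℤ.sign j)) (·1-homo-* ℤ.∣ i ∣ ℤ.∣ j ∣) ⟩
    (⟦ ℤ.sign i ⟧ˢ * ⟦ ℤ.sign j ⟧ˢ) * (ℤ.∣ i ∣ · 1# * ℤ.∣ j ∣ · 1#) ≈⟨ interchange _ _ _ _ ⟩
    (⟦ ℤ.sign i ⟧ˢ * ℤ.∣ i ∣ · 1#) * (⟦ ℤ.sign j ⟧ˢ * ℤ.∣ j ∣ · 1#) ≈⟨ sym (*-cong (sign-abs-homo i) (sign-abs-homo j)) ⟩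
    ⟦ i ⟧ᶻ * ⟦ j ⟧ᶻ                                               ∎

  ℤ⟶R : ℤ.+-*-rawRing -Raw-AlmostCommutative⟶ fromCommutativeRing R
  ℤ⟶R = record
    { ⟦_⟧    = ⟦_⟧ᶻ
    ; +-homo = +-homo
    ; *-homo = *-homo
    ; -‿homo = -‿homo
    ; 0-homo = refl
    ; 1-homo = +-identityʳ 1#
    }

  ⟦⟧ᶻ-≟ : ∀ i j → Maybe (⟦ i ⟧ᶻ ≈ ⟦ j ⟧ᶻ)
  ⟦⟧ᶻ-≟ i j with i ℤ.≟ j
  ... | yes i≡j = just (reflexive (≡.cong ⟦_⟧ᶻ i≡j))
  ... | no _    = nothing

module FieldArithmetic {c ℓ : Level} (K : FiniteField c ℓ) where

  open FiniteField K public hiding (zero)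
  open import Algebra.Properties.Ring ring public
    using (-‿involutive; -‿injective; -0#≈0#; -‿distribˡ-*; -‿distribʳ-*; -1*x≈-x; +-cancelˡ; +-cancelʳ)
    renaming (x≈y⇒x∙y⁻¹≈ε to x≈y⇒x-y≈0)
  open import Algebra.Properties.Ring ring using (x∙y⁻¹≈ε⇒x≈y)
  open import Algebra.Properties.Semiring.Mult semiring public
    using () renaming (_×_ to _·_; ×-homo-+ to ·-homo-+; ×1-homo-* to ·1-homo-*)
  open IntegerSemantics commRing using (ℤ⟶R; ⟦⟧ᶻ-≟)
  open import Algebra.Solver.Ring ℤ.+-*-rawRing (fromCommutativeRing commRing) ℤ⟶R ⟦⟧ᶻ-≟ public
    using (solve; _:=_; _:+_; _:*_; :-_; _:-_)
  open import Relation.Binary.Reasoning.Setoid setoid public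
  open import Algebra.Properties.CommutativeSemiring.Exp commutativeSemiring as Exp
    using () renaming (_^_ to _^ˢ_)

  x-y≈0⇒x≈y : ∀ {x y} → x - y ≈ 0# → x ≈ y
  x-y≈0⇒x≈y = x∙y⁻¹≈ε⇒x≈y _ _

  -x*-y≈x*y : ∀ x y → - x * - y ≈ x * y
  -x*-y≈x*y x y = trans (sym (-‿distribˡ-* x (- y))) (trans (-‿cong (sym (-‿distribʳ-* x y))) (-‿involutive (x * y)))

  1≉0 : 1# ≉ 0#
  1≉0 1≈0 = 0≉1 (sym 1≈0)

  -1≉0 : - 1# ≉ 0#
  -1≉0 -1≈0 = 1≉0 (trans (sym (-‿involutive 1#)) (trans (-‿cong -1≈0) -0#≈0#))

  ⁻¹-inverseˡ : ∀ {x} → x ≉ 0# → x ⁻¹ * x ≈ 1#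
  ⁻¹-inverseˡ {x} x≉0 = trans (*-comm _ _) (⁻¹-inverse x x≉0)

  *-cancelˡ : ∀ {x y z} → x ≉ 0# → x * y ≈ x * z → y ≈ z
  *-cancelˡ {x} {y} {z} x≉0 xy≈xz = begin
    y               ≈⟨ sym (*-identityˡ y) ⟩
    1# * y          ≈⟨ *-congʳ (sym (⁻¹-inverseˡ x≉0)) ⟩
    (x ⁻¹ * x) * y  ≈⟨ *-assoc _ _ _ ⟩
    x ⁻¹ * (x * y)  ≈⟨ *-congˡ xy≈xz ⟩
    x ⁻¹ * (x * z)  ≈⟨ sym (*-assoc _ _ _) ⟩
    (x ⁻¹ * x) * z  ≈⟨ *-congʳ (⁻¹-inverseˡ x≉0) ⟩
    1# * z          ≈⟨ *-identityˡ z ⟩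
    z               ∎

  ⁻¹-unique : ∀ {x z} → x ≉ 0# → x * z ≈ 1# → z ≈ x ⁻¹
  ⁻¹-unique {x} x≉0 xz≈1 = *-cancelˡ x≉0 (trans xz≈1 (sym (⁻¹-inverse x x≉0)))

  x*y≈0⇒x≈0⊎y≈0 : ∀ {x y} → x * y ≈ 0# → x ≈ 0# ⊎ y ≈ 0#
  x*y≈0⇒x≈0⊎y≈0 {x} xy≈0 with x ≟ 0#
  ... | yes x≈0 = inj₁ x≈0
  ... | no x≉0  = inj₂ (*-cancelˡ x≉0 (trans xy≈0 (sym (zeroʳ x))))

  *-≉0 : ∀ {x y} → x ≉ 0# → y ≉ 0# → x * y ≉ 0#
  *-≉0 x≉0 y≉0 xy≈0 with x*y≈0⇒x≈0⊎y≈0 xy≈0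
  ... | inj₁ x≈0 = x≉0 x≈0
  ... | inj₂ y≈0 = y≉0 y≈0

  ⁻¹-≉0 : ∀ {x} → x ≉ 0# → x ⁻¹ ≉ 0#
  ⁻¹-≉0 {x} x≉0 x⁻¹≈0 = 1≉0 (trans (sym (⁻¹-inverse x x≉0)) (trans (*-congˡ x⁻¹≈0) (zeroʳ x)))

  ⁻¹-cong : ∀ {x y} → x ≉ 0# → x ≈ y → x ⁻¹ ≈ y ⁻¹
  ⁻¹-cong {x} x≉0 x≈y = ⁻¹-unique (λ y≈0 → x≉0 (trans x≈y y≈0)) (trans (*-congʳ (sym x≈y)) (⁻¹-inverse x x≉0))

  ⁻¹-distrib-* : ∀ {x y} → x ≉ 0# → y ≉ 0# → (x * y) ⁻¹ ≈ x ⁻¹ * y ⁻¹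
  ⁻¹-distrib-* {x} {y} x≉0 y≉0 = sym (⁻¹-unique (*-≉0 x≉0 y≉0) (begin
    (x * y) * (x ⁻¹ * y ⁻¹)    ≈⟨ solve 4 (λ x y x' y' → (x :* y) :* (x' :* y') := (x :* x') :* (y :* y')) refl x y (x ⁻¹) (y ⁻¹) ⟩
    (x * x ⁻¹) * (y * y ⁻¹)    ≈⟨ *-cong (⁻¹-inverse x x≉0) (⁻¹-inverse y y≉0) ⟩
    1# * 1#                    ≈⟨ *-identityˡ 1# ⟩
    1#                         ∎))

  infixr 8 _^_
  _^_ : Carrier → ℕ → Carrier
  _^_ = Defs._^_ K

  ^≡^ˢ : ∀ x n → x ^ n ≡ x ^ˢ n
  ^≡^ˢ x zero    = ≡.refl
  ^≡^ˢ x (suc n) = ≡.cong (x *_) (^≡^ˢ x n)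

  private
    via^ˢ : ∀ {a b a' b'} → a ≡ a' → b ≡ b' → a' ≈ b' → a ≈ b
    via^ˢ ≡.refl ≡.refl a'≈b' = a'≈b'

  ^-congˡ : ∀ n {x y} → x ≈ y → x ^ n ≈ y ^ n
  ^-congˡ n {x} {y} x≈y = via^ˢ (^≡^ˢ x n) (^≡^ˢ y n) (Exp.^-congˡ n x≈y)

  ^-congʳ : ∀ x {m n} → m ≡ n → x ^ m ≈ x ^ n
  ^-congʳ x ≡.refl = refl

  ^-homo-* : ∀ x m n → x ^ (m ℕ.+ n) ≈ x ^ m * x ^ n
  ^-homo-* x m n = via^ˢ (^≡^ˢ x (m ℕ.+ n)) (≡.cong₂ _*_ (^≡^ˢ x m) (^≡^ˢ x n)) (Exp.^-homo-* x m n)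

  ^-assocʳ : ∀ x m n → (x ^ m) ^ n ≈ x ^ (m ℕ.* n)
  ^-assocʳ x m n = via^ˢ (≡.trans (^≡^ˢ (x ^ m) n) (≡.cong (_^ˢ n) (^≡^ˢ x m))) (^≡^ˢ x (m ℕ.* n)) (Exp.^-assocʳ x m n)

  ^-distrib-* : ∀ x y n → (x * y) ^ n ≈ x ^ n * y ^ n
  ^-distrib-* x y n = via^ˢ (^≡^ˢ (x * y) n) (≡.cong₂ _*_ (^≡^ˢ x n) (^≡^ˢ y n)) (Exp.^-distrib-* x y n)

  1^n≈1 : ∀ n → 1# ^ n ≈ 1#
  1^n≈1 zero    = refl
  1^n≈1 (suc n) = trans (*-identityˡ _) (1^n≈1 n)

  x^1≈x : ∀ x → x ^ 1 ≈ x
  x^1≈x = *-identityʳ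

  ^-≉0 : ∀ {x} n → x ≉ 0# → x ^ n ≉ 0#
  ^-≉0 zero    x≉0 = 1≉0
  ^-≉0 (suc n) x≉0 = *-≉0 x≉0 (^-≉0 n x≉0)

  x^n≈0⇒x≈0 : ∀ {x} n → x ^ n ≈ 0# → x ≈ 0#
  x^n≈0⇒x≈0 {x} n xⁿ≈0 with x ≟ 0#
  ... | yes x≈0 = x≈0
  ... | no x≉0  = ⊥-elim (^-≉0 n x≉0 xⁿ≈0)

  ·1-homo-^ : ∀ p N → (p ℕ.^ N) · 1# ≈ (p · 1#) ^ N
  ·1-homo-^ p zero    = +-identityʳ 1#
  ·1-homo-^ p (suc N) = trans (·1-homo-* p (p ℕ.^ N)) (*-congˡ (·1-homo-^ p N))

module Enumeration {c ℓ : Level} (K : FiniteField c ℓ) where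

  open FieldArithmetic K
  open import Data.List.Membership.Setoid setoid public using (_∈_; find)
  open import Data.List.Relation.Unary.Unique.Setoid setoid public using (Unique)

  private
    variable
      p p′ p″ : Level
      P : Pred Carrier p
      Q : Pred Carrier p′
      R : Pred Carrier p″

  enum : Decidable P → List Carrier
  enum P? = filter P? elements

  ∈-enum⁺ : (P? : Decidable P) → P Respects _≈_ → ∀ {x} → P x → x ∈ enum P?
  ∈-enum⁺ P? P-resp = ∈.∈-filter⁺ setoid P? P-resp (complete _)

  ∈-enum⁻ : (P? : Decidable P) → P Respects _≈_ → ∀ {x} → x ∈ enum P? → P x
  ∈-enum⁻ P? P-resp x∈ = proj₂ (∈.∈-filter⁻ setoid P? P-resp {xs = elements} x∈)

  enum-unique : (P? : Decidable P) → Unique (enum P?)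
  enum-unique P? = Unique.filter⁺ setoid P? distinct

  enum-≐ : (P? : Decidable P) (Q? : Decidable Q) → P ⊆ Q → Q ⊆ P → enum P? ≡ enum Q?
  enum-≐ P? Q? P⊆Q Q⊆P = List.filter-≐ P? Q? (P⊆Q , Q⊆P) elements

  infixl 6 _∖_
  _∖_ : Decidable P → (a : Carrier) → Decidable (P ∩ ∁ (_≈ a))
  (P? ∖ a) = P? ∩? ∁? (_≟ a)

  ∖-resp : P Respects _≈_ → ∀ {a} → (P ∩ ∁ (_≈ a)) Respects _≈_
  ∖-resp P-resp x≈y (Px , x≉a) = P-resp x≈y Px , λ y≈a → x≉a (trans x≈y y≈a)

  ∈-─⁻ : ∀ {z w ys} (z∈ys : z ∈ ys) → w ∈ (ys ─ z∈ys) → w ∈ ys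
  ∈-─⁻ (here _)   w∈         = there w∈
  ∈-─⁻ (there _)  (here w≈y) = here w≈y
  ∈-─⁻ (there z∈) (there w∈) = there (∈-─⁻ z∈ w∈)

  ∈-─⁺ : ∀ {z w ys} (z∈ys : z ∈ ys) → w ∈ ys → w ≉ z → w ∈ (ys ─ z∈ys)
  ∈-─⁺ (here z≈y) (here w≈y) w≉z = ⊥-elim (w≉z (trans w≈y (sym z≈y)))
  ∈-─⁺ (here _)   (there w∈) _   = w∈
  ∈-─⁺ (there _)  (here w≈y) _   = here w≈y
  ∈-─⁺ (there z∈) (there w∈) w≉z = there (∈-─⁺ z∈ w∈ w≉z)

  ─-unique : ∀ {z ys} (z∈ys : z ∈ ys) → Unique ys → Unique (ys ─ z∈ys)
  ─-unique (here _)   (_ ∷ u)   = u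
  ─-unique (there z∈) (≉s ∷ u) = ─⁺ z∈ ≉s ∷ ─-unique z∈ u

  ∈-─⇒≉ : ∀ {z w ys} (z∈ys : z ∈ ys) → Unique ys → w ∈ (ys ─ z∈ys) → w ≉ z
  ∈-─⇒≉ (here z≈y) (≉s ∷ _) w∈         w≈z = ∈.All[≉]⇒∉ setoid ≉s (∈.∈-resp-≈ setoid (trans w≈z z≈y) w∈)
  ∈-─⇒≉ (there z∈) (≉s ∷ _) (here w≈y) w≈z = ∈.All[≉]⇒∉ setoid ≉s (∈.∈-resp-≈ setoid (trans (sym w≈z) w≈y) z∈)
  ∈-─⇒≉ (there z∈) (_ ∷ u)  (there w∈) w≈z = ∈-─⇒≉ z∈ u w∈ w≈z

  map-unique : ∀ (g : Carrier → Carrier) {xs} → Unique xs →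
               (∀ {x y} → x ∈ xs → y ∈ xs → g x ≈ g y → x ≈ y) → Unique (map g xs)
  map-unique g {[]}     []       _   = []
  map-unique g {x ∷ xs} (≉s ∷ u) inj = heads xs ≉s (λ y∈ → inj (here refl) (there y∈)) ∷ map-unique g u (λ x∈ y∈ → inj (there x∈) (there y∈))
    where
    heads : ∀ ys → All (x ≉_) ys → (∀ {y} → y ∈ ys → g x ≈ g y → x ≈ y) → All (g x ≉_) (map g ys)
    heads []       []         _    = []
    heads (y ∷ ys) (x≉y ∷ ≉s) inj′ = (λ gx≈gy → x≉y (inj′ (here refl) gx≈gy)) ∷ heads ys ≉s (inj′ ∘ there)

  record BijectionOn (P : Pred Carrier p) (Q : Pred Carrier p′) (g : Carrier → Carrier) : Set (c ⊔ ℓ ⊔ p ⊔ p′) where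
    field
      cong       : Congruent _≈_ _≈_ g
      maps       : ∀ {x} → P x → Q (g x)
      injective  : ∀ {x y} → P x → P y → g x ≈ g y → x ≈ y
      surjective : ∀ {y} → Q y → Σ Carrier λ x → P x × y ≈ g x

  record ProductDecomposition (A : Pred Carrier p) (B : Pred Carrier p′) (C : Pred Carrier p″)
                              (φ : Carrier → Carrier → Carrier) : Set (c ⊔ ℓ ⊔ p ⊔ p′ ⊔ p″) where
    field
      cong       : ∀ {a a′ b b′} → a ≈ a′ → b ≈ b′ → φ a b ≈ φ a′ b′
      maps       : ∀ {a b} → A a → B b → C (φ a b)
      injective  : ∀ {a b a′ b′} → A a → B b → A a′ → B b′ → φ a b ≈ φ a′ b′ → a ≈ a′ × b ≈ b′
      surjective : ∀ {z} → C z → Σ Carrier λ a → Σ Carrier λ b → A a × B b × z ≈ φ a b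

  module _ {A : Pred Carrier p} {B : Pred Carrier p′} (A? : Decidable A) (B? : Decidable B) where

    productList : (Carrier → Carrier → Carrier) → List Carrier
    productList φ = concatMap (λ b → map (λ a → φ a b) (enum A?)) (enum B?)

    module _ (A-resp : A Respects _≈_) (B-resp : B Respects _≈_) {C : Pred Carrier p″} {φ} (dec : ProductDecomposition A B C φ) where

      open ProductDecomposition dec

      private
        row : Carrier → List Carrier
        row b = map (λ a → φ a b) (enum A?)
        ∈row⁻ : ∀ {z b} → z ∈ row b → Σ Carrier λ a → A a × z ≈ φ a b
        ∈row⁻ z∈ with a , a∈ , z≈φab ← ∈.∈-map⁻ setoid setoid z∈ = a , ∈-enum⁻ A? A-resp a∈ , z≈φab
        ∈rows⁻ : ∀ {z} bs → z ∈ concatMap row bs → Σ Carrier λ b → b ∈ bs × z ∈ row b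
        ∈rows⁻ bs z∈ = find (∈.∈-concatMap⁻ setoid setoid {xs = bs} z∈)

        rows-unique : ∀ bs → Unique bs → (∀ {b} → b ∈ bs → B b) → Unique (concatMap row bs)
        rows-unique []       _        _   = []
        rows-unique (b ∷ bs) (≉s ∷ u) bs⊆B = Unique.++⁺ setoid row-unique (rows-unique bs u (bs⊆B ∘ there)) disjoint
          where
          Bb : B b
          Bb = bs⊆B (here refl)
          row-unique : Unique (row b)
          row-unique = map-unique _ (enum-unique A?) λ a∈ a′∈ φab≈φa′b →
            proj₁ (injective (∈-enum⁻ A? A-resp a∈) Bb (∈-enum⁻ A? A-resp a′∈) Bb φab≈φa′b)
          disjoint : ∀ {z} → ¬ (z ∈ row b × z ∈ concatMap row bs)
          disjoint (z∈ , z∈′) =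
            let a , Aa , z≈φab       = ∈row⁻ z∈
                b′ , b′∈ , z∈″       = ∈rows⁻ bs z∈′
                a′ , Aa′ , z≈φa′b′   = ∈row⁻ z∈″
                _ , b≈b′ = injective Aa Bb Aa′ (bs⊆B (there b′∈)) (trans (sym z≈φab) z≈φa′b′)
            in ∈.All[≉]⇒∉ setoid ≉s (∈.∈-resp-≈ setoid (sym b≈b′) b′∈)

      productList-unique : Unique (productList φ)
      productList-unique = rows-unique (enum B?) (enum-unique B?) (∈-enum⁻ B? B-resp)

      productList-≐ : (C? : Decidable C) → C Respects _≈_ → (_∈ enum C?) ≐ (_∈ productList φ)
      productList-≐ C? C-resp = ⊇ , ⊆
        where
        ⊆ : ∀ {z} → z ∈ productList φ → z ∈ enum C?
        ⊆ z∈ = let b , b∈ , z∈row = ∈rows⁻ (enum B?) z∈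
                   a , Aa , z≈φab = ∈row⁻ z∈row
               in ∈-enum⁺ C? C-resp (C-resp (sym z≈φab) (maps Aa (∈-enum⁻ B? B-resp b∈)))
        ⊇ : ∀ {z} → z ∈ enum C? → z ∈ productList φ
        ⊇ z∈ with a , b , Aa , Bb , z≈φab ← surjective (∈-enum⁻ C? C-resp z∈) =
          ∈.∈-concatMap⁺ setoid setoid (Any.map (λ b≈b′ → ∈.∈-resp-≈ setoid (sym (trans z≈φab (cong refl b≈b′)))
            (∈.∈-map⁺ setoid setoid (λ a≈a′ → cong a≈a′ refl) (∈-enum⁺ A? A-resp Aa))) (∈-enum⁺ B? B-resp Bb))

  module Fold {a b : Level} (M : CommutativeMonoid a b) where

    private module M = CommutativeMonoid M
    open M using (_∙_; ε) renaming (_≈_ to _≈ᴹ_)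
    open import Algebra.Properties.CommutativeSemigroup M.commutativeSemigroup using (interchange; x∙yz≈y∙xz)

    fold : List Carrier → (Carrier → M.Carrier) → M.Carrier
    fold []       h = ε
    fold (x ∷ xs) h = h x ∙ fold xs h

    fold-cong : ∀ xs {h g} → (∀ x → h x ≈ᴹ g x) → fold xs h ≈ᴹ fold xs g
    fold-cong []       h≈g = M.refl
    fold-cong (x ∷ xs) h≈g = M.∙-cong (h≈g x) (fold-cong xs h≈g)

    fold-cong-∈ : ∀ xs {h g} → (∀ {x} → x ∈ xs → h x ≈ᴹ g x) → fold xs h ≈ᴹ fold xs g
    fold-cong-∈ []       h≈g = M.refl
    fold-cong-∈ (x ∷ xs) h≈g = M.∙-cong (h≈g (here refl)) (fold-cong-∈ xs (h≈g ∘ there))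

    fold-++ : ∀ xs ys h → fold (xs ++ ys) h ≈ᴹ fold xs h ∙ fold ys h
    fold-++ []       ys h = M.sym (M.identityˡ _)
    fold-++ (x ∷ xs) ys h = M.trans (M.∙-congˡ (fold-++ xs ys h)) (M.sym (M.assoc _ _ _))

    fold-map : ∀ xs (g : Carrier → Carrier) h → fold (map g xs) h ≡ fold xs (h ∘ g)
    fold-map []       g h = ≡.refl
    fold-map (x ∷ xs) g h = ≡.cong (h (g x) ∙_) (fold-map xs g h)

    fold-∙ : ∀ xs h g → fold xs (λ x → h x ∙ g x) ≈ᴹ fold xs h ∙ fold xs g
    fold-∙ []       h g = M.sym (M.identityˡ ε)
    fold-∙ (x ∷ xs) h g = M.trans (M.∙-congˡ (fold-∙ xs h g)) (interchange _ _ _ _)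

    fold-ε : ∀ xs → fold xs (λ _ → ε) ≈ᴹ ε
    fold-ε []       = M.refl
    fold-ε (x ∷ xs) = M.trans (M.identityˡ _) (fold-ε xs)

    fold-─ : ∀ {z ys} (z∈ys : z ∈ ys) h → Congruent _≈_ _≈ᴹ_ h → fold ys h ≈ᴹ h z ∙ fold (ys ─ z∈ys) h
    fold-─ (here z≈y)  h h-cong = M.∙-congʳ (h-cong (sym z≈y))
    fold-─ (there z∈) h h-cong = M.trans (M.∙-congˡ (fold-─ z∈ h h-cong)) (x∙yz≈y∙xz _ _ _)

    fold-≐ : ∀ {xs ys} h → Congruent _≈_ _≈ᴹ_ h → Unique xs → Unique ys →
             (_∈ xs) ≐ (_∈ ys) → fold xs h ≈ᴹ fold ys h
    fold-≐ {[]}     {[]}     h h-cong _          _     _              = M.refl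
    fold-≐ {[]}     {y ∷ ys} h h-cong _          _     (_ , ys⊆[]) with () ← ys⊆[] (here refl)
    fold-≐ {x ∷ xs} {ys}     h h-cong (≉s ∷ uxs) uys   (xs⊆ys , ys⊆xs) =
      M.trans (M.∙-congˡ (fold-≐ h h-cong uxs (─-unique x∈ys uys) (xs⊆ys─x , ys─x⊆xs)))
              (M.sym (fold-─ x∈ys h h-cong))
      where
      x∈ys : x ∈ ys
      x∈ys = xs⊆ys (here refl)
      xs⊆ys─x : ∀ {z} → z ∈ xs → z ∈ (ys ─ x∈ys)
      xs⊆ys─x z∈ = ∈-─⁺ x∈ys (xs⊆ys (there z∈)) (λ z≈x → ∈.All[≉]⇒∉ setoid ≉s (∈.∈-resp-≈ setoid z≈x z∈))
      ys─x⊆xs : ∀ {z} → z ∈ (ys ─ x∈ys) → z ∈ xs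
      ys─x⊆xs z∈ with ys⊆xs (∈-─⁻ x∈ys z∈)
      ... | here z≈x = ⊥-elim (∈-─⇒≉ x∈ys uys z∈ z≈x)
      ... | there z∈xs = z∈xs

    fold-enum-≈ : ∀ x₀ h → Congruent _≈_ _≈ᴹ_ h → fold (enum (_≟ x₀)) h ≈ᴹ h x₀
    fold-enum-≈ x₀ h h-cong = M.trans (fold-≐ h h-cong (enum-unique (_≟ x₀)) ([] ∷ []) (⊆ , ⊇)) (M.identityʳ _)
      where
      ≈x₀-resp : (_≈ x₀) Respects _≈_
      ≈x₀-resp x≈y x≈x₀ = trans (sym x≈y) x≈x₀
      ⊆ : ∀ {z} → z ∈ enum (_≟ x₀) → z ∈ x₀ ∷ []
      ⊆ z∈ = here (∈-enum⁻ (_≟ x₀) ≈x₀-resp z∈)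
      ⊇ : ∀ {z} → z ∈ x₀ ∷ [] → z ∈ enum (_≟ x₀)
      ⊇ (here z≈x₀) = ∈-enum⁺ (_≟ x₀) ≈x₀-resp z≈x₀

    fold-enum-≐ : (P? : Decidable P) (Q? : Decidable Q) → P ⊆ Q → Q ⊆ P → ∀ h → fold (enum P?) h ≈ᴹ fold (enum Q?) h
    fold-enum-≐ P? Q? P⊆Q Q⊆P h = M.reflexive (≡.cong (λ xs → fold xs h) (enum-≐ P? Q? P⊆Q Q⊆P))

    fold-split : (P? : Decidable P) (Q? : Decidable Q) → ∀ xs h →
      fold (filter P? xs) h ≈ᴹ fold (filter (P? ∩? Q?) xs) h ∙ fold (filter (P? ∩? ∁? Q?) xs) h
    fold-split P? Q? []       h = M.sym (M.identityˡ ε)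
    fold-split P? Q? (x ∷ xs) h with P? x | Q? x
    ... | yes _ | yes _ = M.trans (M.∙-congˡ (fold-split P? Q? xs h)) (M.sym (M.assoc _ _ _))
    ... | yes _ | no _  = M.trans (M.∙-congˡ (fold-split P? Q? xs h)) (x∙yz≈y∙xz _ _ _)
    ... | no _  | yes _ = fold-split P? Q? xs h
    ... | no _  | no _  = fold-split P? Q? xs h

    fold-enum-∖ : (P? : Decidable P) → P Respects _≈_ → ∀ {a} → P a → ∀ h → Congruent _≈_ _≈ᴹ_ h →
                  fold (enum P?) h ≈ᴹ h a ∙ fold (enum (P? ∖ a)) h
    fold-enum-∖ P? P-resp {a} Pa h h-cong =
      M.trans (fold-split P? (_≟ a) elements h)
        (M.∙-congʳ (M.trans (fold-enum-≐ (P? ∩? (_≟ a)) (_≟ a) proj₂ (λ x≈a → P-resp (sym x≈a) Pa , x≈a) h) (fold-enum-≈ a h h-cong)))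

    fold-bijection : (P? : Decidable P) (Q? : Decidable Q) → P Respects _≈_ → Q Respects _≈_ →
                     ∀ {g} → BijectionOn P Q g → ∀ h → Congruent _≈_ _≈ᴹ_ h →
                     fold (enum P?) (h ∘ g) ≈ᴹ fold (enum Q?) h
    fold-bijection {P = P} P? Q? P-resp Q-resp {g} bij h h-cong =
      M.trans (M.reflexive (≡.sym (fold-map (enum P?) g h)))
        (fold-≐ h h-cong (map-unique g (enum-unique P?) λ x∈ y∈ → injective (∈P x∈) (∈P y∈)) (enum-unique Q?) (⊆ , ⊇))
      where
      open BijectionOn bij
      ∈P : ∀ {x} → x ∈ enum P? → P x
      ∈P = ∈-enum⁻ P? P-resp
      ⊆ : ∀ {z} → z ∈ map g (enum P?) → z ∈ enum Q?
      ⊆ z∈ with x , x∈ , z≈gx ← ∈.∈-map⁻ setoid setoid z∈ =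
        ∈.∈-resp-≈ setoid (sym z≈gx) (∈-enum⁺ Q? Q-resp (maps (∈P x∈)))
      ⊇ : ∀ {z} → z ∈ enum Q? → z ∈ map g (enum P?)
      ⊇ z∈ with x , Px , z≈gx ← surjective (∈-enum⁻ Q? Q-resp z∈) =
        ∈.∈-resp-≈ setoid (sym z≈gx) (∈.∈-map⁺ setoid setoid cong (∈-enum⁺ P? P-resp Px))

    fold-concatMap : ∀ xs (f : Carrier → List Carrier) h → fold (concatMap f xs) h ≈ᴹ fold xs (λ x → fold (f x) h)
    fold-concatMap []       f h = M.refl
    fold-concatMap (x ∷ xs) f h = M.trans (fold-++ (f x) (concatMap f xs) h) (M.∙-congˡ (fold-concatMap xs f h))

    fold-decomposition : {A : Pred Carrier p} {B : Pred Carrier p′} {C : Pred Carrier p″} →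
                         (A? : Decidable A) (B? : Decidable B) (C? : Decidable C) →
                         A Respects _≈_ → B Respects _≈_ → C Respects _≈_ →
                         ∀ {φ} → ProductDecomposition A B C φ → ∀ h → Congruent _≈_ _≈ᴹ_ h →
                         fold (enum C?) h ≈ᴹ fold (enum B?) (λ b → fold (enum A?) (λ a → h (φ a b)))
    fold-decomposition A? B? C? A-resp B-resp C-resp {φ} dec h h-cong =
      M.trans (fold-≐ h h-cong (enum-unique C?) (productList-unique A? B? A-resp B-resp dec) (productList-≐ A? B? A-resp B-resp dec C? C-resp))
        (M.trans (fold-concatMap (enum B?) (λ b → map (λ a → φ a b) (enum A?)) h)
                 (fold-cong (enum B?) λ b → M.reflexive (fold-map (enum A?) (λ a → φ a b) h)))

module PolynomialFunctions {c ℓ : Level} (K : FiniteField c ℓ) where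

  open FieldArithmetic K
  open Enumeration K using (_∈_; Unique)

  eval : List Carrier → Carrier → Carrier
  eval []       x = 0#
  eval (a ∷ as) x = a + x * eval as x

  infixl 6 _+ᶜ_
  _+ᶜ_ : List Carrier → List Carrier → List Carrier
  []       +ᶜ bs       = bs
  (a ∷ as) +ᶜ []       = a ∷ as
  (a ∷ as) +ᶜ (b ∷ bs) = (a + b) ∷ (as +ᶜ bs)

  infixl 7 _*ᶜ_
  _*ᶜ_ : List Carrier → List Carrier → List Carrier
  []       *ᶜ bs = []
  (a ∷ as) *ᶜ bs = map (a *_) bs +ᶜ (0# ∷ as *ᶜ bs)

  shift : ℕ → List Carrier → List Carrier
  shift zero    as = as
  shift (suc n) as = 0# ∷ shift n as

  eval-+ᶜ : ∀ as bs x → eval (as +ᶜ bs) x ≈ eval as x + eval bs x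
  eval-+ᶜ []       bs       x = sym (+-identityˡ _)
  eval-+ᶜ (a ∷ as) []       x = sym (+-identityʳ _)
  eval-+ᶜ (a ∷ as) (b ∷ bs) x = begin
    (a + b) + x * eval (as +ᶜ bs) x            ≈⟨ +-congˡ (*-congˡ (eval-+ᶜ as bs x)) ⟩
    (a + b) + x * (eval as x + eval bs x)      ≈⟨ solve 5 (λ a b x u v → (a :+ b) :+ x :* (u :+ v) := (a :+ x :* u) :+ (b :+ x :* v)) refl a b x (eval as x) (eval bs x) ⟩
    (a + x * eval as x) + (b + x * eval bs x)  ∎

  eval-scale : ∀ b as x → eval (map (b *_) as) x ≈ b * eval as x
  eval-scale b []       x = sym (zeroʳ b)
  eval-scale b (a ∷ as) x = begin
    b * a + x * eval (map (b *_) as) x  ≈⟨ +-congˡ (*-congˡ (eval-scale b as x)) ⟩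
    b * a + x * (b * eval as x)         ≈⟨ solve 4 (λ a b x u → b :* a :+ x :* (b :* u) := b :* (a :+ x :* u)) refl a b x (eval as x) ⟩
    b * (a + x * eval as x)             ∎

  eval-*ᶜ : ∀ as bs x → eval (as *ᶜ bs) x ≈ eval as x * eval bs x
  eval-*ᶜ []       bs x = sym (zeroˡ _)
  eval-*ᶜ (a ∷ as) bs x = begin
    eval (map (a *_) bs +ᶜ (0# ∷ as *ᶜ bs)) x                    ≈⟨ eval-+ᶜ (map (a *_) bs) (0# ∷ as *ᶜ bs) x ⟩
    eval (map (a *_) bs) x + (0# + x * eval (as *ᶜ bs) x)         ≈⟨ +-cong (eval-scale a bs x) (trans (+-identityˡ _) (*-congˡ (eval-*ᶜ as bs x))) ⟩
    a * eval bs x + x * (eval as x * eval bs x)                   ≈⟨ solve 4 (λ a x u v → a :* v :+ x :* (u :* v) := (a :+ x :* u) :* v) refl a x (eval as x) (eval bs x) ⟩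
    (a + x * eval as x) * eval bs x                               ∎

  eval-shift : ∀ n as x → eval (shift n as) x ≈ x ^ n * eval as x
  eval-shift zero    as x = sym (*-identityˡ _)
  eval-shift (suc n) as x = begin
    0# + x * eval (shift n as) x  ≈⟨ +-identityˡ _ ⟩
    x * eval (shift n as) x       ≈⟨ *-congˡ (eval-shift n as x) ⟩
    x * (x ^ n * eval as x)       ≈⟨ sym (*-assoc _ _ _) ⟩
    (x * x ^ n) * eval as x       ∎

  eval-++ : ∀ as bs x → eval (as ++ bs) x ≈ eval as x + x ^ length as * eval bs x
  eval-++ []       bs x = sym (trans (+-identityˡ _) (*-identityˡ _))
  eval-++ (a ∷ as) bs x = begin
    a + x * eval (as ++ bs) x                             ≈⟨ +-congˡ (*-congˡ (eval-++ as bs x)) ⟩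
    a + x * (eval as x + x ^ length as * eval bs x)
      ≈⟨ solve 5 (λ a x u w v → a :+ x :* (u :+ w :* v) := (a :+ x :* u) :+ (x :* w) :* v) refl a x (eval as x) (x ^ length as) (eval bs x) ⟩
    (a + x * eval as x) + (x * x ^ length as) * eval bs x ∎

  length-+ᶜ : ∀ {d} as bs → length as ≤ d → length bs ≤ d → length (as +ᶜ bs) ≤ d
  length-+ᶜ []       bs       _         ∣bs∣≤d    = ∣bs∣≤d
  length-+ᶜ (a ∷ as) []       ∣as∣≤d    _         = ∣as∣≤d
  length-+ᶜ (a ∷ as) (b ∷ bs) (s≤s ∣as∣≤d) (s≤s ∣bs∣≤d) = s≤s (length-+ᶜ as bs ∣as∣≤d ∣bs∣≤d)

  length-*ᶜ : ∀ as bs → length (as *ᶜ bs) ≤ length as ℕ.+ length bs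
  length-*ᶜ []       bs = z≤n
  length-*ᶜ (a ∷ as) bs = length-+ᶜ (map (a *_) bs) (0# ∷ as *ᶜ bs)
    (ℕ.≤-trans (ℕ.≤-reflexive (List.length-map (a *_) bs)) (ℕ.m≤n+m _ (suc (length as))))
    (s≤s (length-*ᶜ as bs))

  length-shift : ∀ n as → length (shift n as) ≡ n ℕ.+ length as
  length-shift zero    as = ≡.refl
  length-shift (suc n) as = ≡.cong suc (length-shift n as)

  DegreeBelow : ℕ → (Carrier → Carrier) → Set (c ⊔ ℓ)
  DegreeBelow d f = Σ (List Carrier) λ as → length as ≤ d × (∀ x → f x ≈ eval as x)

  LeadingTerm : Carrier → ℕ → (Carrier → Carrier) → Set (c ⊔ ℓ)
  LeadingTerm a d f = Σ (List Carrier) λ as → length as ≤ d × (∀ x → f x ≈ a * x ^ d + eval as x)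

  degreeBelow-mono : ∀ {d e f} → d ≤ e → DegreeBelow d f → DegreeBelow e f
  degreeBelow-mono d≤e (as , ∣as∣≤d , f≈) = as , ℕ.≤-trans ∣as∣≤d d≤e , f≈

  degreeBelow-cong : ∀ {d f g} → (∀ x → f x ≈ g x) → DegreeBelow d f → DegreeBelow d g
  degreeBelow-cong f≈g (as , ∣as∣≤d , f≈) = as , ∣as∣≤d , λ x → trans (sym (f≈g x)) (f≈ x)

  degreeBelow-0# : ∀ {d} → DegreeBelow d (λ _ → 0#)
  degreeBelow-0# = [] , z≤n , λ _ → refl

  degreeBelow-const : ∀ {d} a → 1 ≤ d → DegreeBelow d (λ _ → a)
  degreeBelow-const a 1≤d = a ∷ [] , 1≤d , λ x → sym (trans (+-congˡ (zeroʳ x)) (+-identityʳ a))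

  degreeBelow-+ : ∀ {d f g} → DegreeBelow d f → DegreeBelow d g → DegreeBelow d (λ x → f x + g x)
  degreeBelow-+ (as , ∣as∣≤d , f≈) (bs , ∣bs∣≤d , g≈) =
    as +ᶜ bs , length-+ᶜ as bs ∣as∣≤d ∣bs∣≤d , λ x → trans (+-cong (f≈ x) (g≈ x)) (sym (eval-+ᶜ as bs x))

  degreeBelow-scale : ∀ {d f} b → DegreeBelow d f → DegreeBelow d (λ x → b * f x)
  degreeBelow-scale b (as , ∣as∣≤d , f≈) =
    map (b *_) as , ℕ.≤-trans (ℕ.≤-reflexive (List.length-map (b *_) as)) ∣as∣≤d ,
    λ x → trans (*-congˡ (f≈ x)) (sym (eval-scale b as x))

  degreeBelow-neg : ∀ {d f} → DegreeBelow d f → DegreeBelow d (λ x → - f x)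
  degreeBelow-neg f<d = degreeBelow-cong (λ x → -1*x≈-x _) (degreeBelow-scale (- 1#) f<d)

  degreeBelow-* : ∀ {d e f g} → DegreeBelow d f → DegreeBelow e g → DegreeBelow (d ℕ.+ e) (λ x → f x * g x)
  degreeBelow-* (as , ∣as∣≤d , f≈) (bs , ∣bs∣≤e , g≈) =
    as *ᶜ bs , ℕ.≤-trans (length-*ᶜ as bs) (ℕ.+-mono-≤ ∣as∣≤d ∣bs∣≤e) ,
    λ x → trans (*-cong (f≈ x) (g≈ x)) (sym (eval-*ᶜ as bs x))

  degreeBelow-X^* : ∀ {d f} n → DegreeBelow d f → DegreeBelow (n ℕ.+ d) (λ x → x ^ n * f x)
  degreeBelow-X^* n (as , ∣as∣≤d , f≈) =
    shift n as , ℕ.≤-trans (ℕ.≤-reflexive (length-shift n as)) (ℕ.+-monoʳ-≤ n ∣as∣≤d) ,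
    λ x → trans (*-congˡ (f≈ x)) (sym (eval-shift n as x))

  degreeBelow-X^ : ∀ n → DegreeBelow (suc n) (λ x → x ^ n)
  degreeBelow-X^ n = degreeBelow-cong (λ x → *-identityʳ _)
    (degreeBelow-mono (ℕ.≤-reflexive (ℕ.+-comm n 1)) (degreeBelow-X^* n (degreeBelow-const 1# (s≤s z≤n))))

  leadingTerm-cong : ∀ {d a b f g} → a ≈ b → (∀ x → f x ≈ g x) → LeadingTerm a d f → LeadingTerm b d g
  leadingTerm-cong a≈b f≈g (as , ∣as∣≤d , f≈) =
    as , ∣as∣≤d , λ x → trans (sym (f≈g x)) (trans (f≈ x) (+-congʳ (*-congʳ a≈b)))

  leadingTerm-≡ : ∀ {d e a f} → d ≡ e → LeadingTerm a d f → LeadingTerm a e f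
  leadingTerm-≡ ≡.refl f~ = f~

  leadingTerm⇒degreeBelow : ∀ {d a f} → LeadingTerm a d f → DegreeBelow (suc d) f
  leadingTerm⇒degreeBelow {d} {a} (as , ∣as∣≤d , f≈) =
    degreeBelow-cong (λ x → sym (f≈ x)) (degreeBelow-+ (degreeBelow-scale a (degreeBelow-X^ d)) (as , ℕ.m≤n⇒m≤1+n ∣as∣≤d , λ _ → refl))

  leadingTerm-0#⇒degreeBelow : ∀ {d f} → LeadingTerm 0# d f → DegreeBelow d f
  leadingTerm-0#⇒degreeBelow (as , ∣as∣≤d , f≈) = as , ∣as∣≤d , λ x → trans (f≈ x) (trans (+-congʳ (zeroˡ _)) (+-identityˡ _))

  degreeBelow⇒leadingTerm-0# : ∀ {d f} → DegreeBelow d f → LeadingTerm 0# d f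
  degreeBelow⇒leadingTerm-0# (as , ∣as∣≤d , f≈) = as , ∣as∣≤d , λ x → trans (f≈ x) (sym (trans (+-congʳ (zeroˡ _)) (+-identityˡ _)))

  leadingTerm-X^ : ∀ d → LeadingTerm 1# d (λ x → x ^ d)
  leadingTerm-X^ d = [] , z≤n , λ x → sym (trans (+-identityʳ _) (*-identityˡ _))

  leadingTerm-const : ∀ a → LeadingTerm a 0 (λ _ → a)
  leadingTerm-const a = [] , z≤n , λ x → sym (trans (+-identityʳ _) (*-identityʳ a))

  leadingTerm-X+ : ∀ u → LeadingTerm 1# 1 (λ x → x + u)
  leadingTerm-X+ u = u ∷ [] , s≤s z≤n ,
    λ x → sym (+-cong (trans (*-identityˡ _) (*-identityʳ x)) (trans (+-congˡ (zeroʳ x)) (+-identityʳ u)))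

  leadingTerm-+ : ∀ {d a b f g} → LeadingTerm a d f → LeadingTerm b d g → LeadingTerm (a + b) d (λ x → f x + g x)
  leadingTerm-+ {d} {a} {b} (as , ∣as∣≤d , f≈) (bs , ∣bs∣≤d , g≈) = as +ᶜ bs , length-+ᶜ as bs ∣as∣≤d ∣bs∣≤d , λ x → begin
    _                                                ≈⟨ +-cong (f≈ x) (g≈ x) ⟩
    (a * x ^ d + eval as x) + (b * x ^ d + eval bs x) ≈⟨ solve 5 (λ a b y u v → (a :* y :+ u) :+ (b :* y :+ v) := (a :+ b) :* y :+ (u :+ v)) refl a b (x ^ d) (eval as x) (eval bs x) ⟩
    (a + b) * x ^ d + (eval as x + eval bs x)         ≈⟨ +-congˡ (sym (eval-+ᶜ as bs x)) ⟩
    (a + b) * x ^ d + eval (as +ᶜ bs) x               ∎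

  leadingTerm-+degreeBelow : ∀ {d a f g} → LeadingTerm a d f → DegreeBelow d g → LeadingTerm a d (λ x → f x + g x)
  leadingTerm-+degreeBelow f~ g<d = leadingTerm-cong (+-identityʳ _) (λ _ → refl) (leadingTerm-+ f~ (degreeBelow⇒leadingTerm-0# g<d))

  leadingTerm-scale : ∀ {d a f} b → LeadingTerm a d f → LeadingTerm (b * a) d (λ x → b * f x)
  leadingTerm-scale {d} {a} b (as , ∣as∣≤d , f≈) =
    map (b *_) as , ℕ.≤-trans (ℕ.≤-reflexive (List.length-map (b *_) as)) ∣as∣≤d , λ x → begin
      b * _                               ≈⟨ *-congˡ (f≈ x) ⟩
      b * (a * x ^ d + eval as x)         ≈⟨ solve 4 (λ a b y u → b :* (a :* y :+ u) := b :* a :* y :+ b :* u) refl a b (x ^ d) (eval as x) ⟩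
      b * a * x ^ d + b * eval as x       ≈⟨ +-congˡ (sym (eval-scale b as x)) ⟩
      b * a * x ^ d + eval (map (b *_) as) x ∎

  leadingTerm-neg : ∀ {d a f} → LeadingTerm a d f → LeadingTerm (- a) d (λ x → - f x)
  leadingTerm-neg f~ = leadingTerm-cong (-1*x≈-x _) (λ x → -1*x≈-x _) (leadingTerm-scale (- 1#) f~)

  leadingTerm-* : ∀ {d e a b f g} → LeadingTerm a d f → LeadingTerm b e g → LeadingTerm (a * b) (d ℕ.+ e) (λ x → f x * g x)
  leadingTerm-* {d} {e} {a} {b} {f} {g} f~@(as , ∣as∣≤d , f≈) g~@(bs , ∣bs∣≤e , g≈) =
    leadingTerm-cong refl (λ x → sym (f*g≈ x))
      (leadingTerm-+degreeBelow ([] , z≤n , λ x → sym (+-identityʳ _))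
        (degreeBelow-+ (degreeBelow-+ a·Xᵈ·bs b·Xᵉ·as) (degreeBelow-* as<d bs<e)))
    where
    as<d : DegreeBelow d (eval as)
    as<d = as , ∣as∣≤d , λ _ → refl
    bs<e : DegreeBelow e (eval bs)
    bs<e = bs , ∣bs∣≤e , λ _ → refl
    a·Xᵈ·bs : DegreeBelow (d ℕ.+ e) (λ x → a * (x ^ d * eval bs x))
    a·Xᵈ·bs = degreeBelow-scale a (degreeBelow-X^* d bs<e)
    b·Xᵉ·as : DegreeBelow (d ℕ.+ e) (λ x → b * (x ^ e * eval as x))
    b·Xᵉ·as = degreeBelow-scale b (degreeBelow-mono (ℕ.≤-reflexive (ℕ.+-comm e d)) (degreeBelow-X^* e as<d))
    f*g≈ : ∀ x → f x * g x ≈ (a * b) * x ^ (d ℕ.+ e) + ((a * (x ^ d * eval bs x) + b * (x ^ e * eval as x)) + eval as x * eval bs x)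
    f*g≈ x = begin
      f x * g x                                            ≈⟨ *-cong (f≈ x) (g≈ x) ⟩
      (a * x ^ d + eval as x) * (b * x ^ e + eval bs x)
        ≈⟨ solve 6 (λ a b xd xe u v → (a :* xd :+ u) :* (b :* xe :+ v) := (a :* b) :* (xd :* xe) :+ ((a :* (xd :* v) :+ b :* (xe :* u)) :+ u :* v)) refl a b (x ^ d) (x ^ e) (eval as x) (eval bs x) ⟩
      (a * b) * (x ^ d * x ^ e) + _                        ≈⟨ +-congʳ (*-congˡ (sym (^-homo-* x d e))) ⟩
      (a * b) * x ^ (d ℕ.+ e) + _                          ∎

  leadingTerm-^ : ∀ {d a f} → LeadingTerm a d f → ∀ n → LeadingTerm (a ^ n) (d ℕ.* n) (λ x → f x ^ n)
  leadingTerm-^ {d} f~ zero    = leadingTerm-≡ (≡.sym (ℕ.*-zeroʳ d)) (leadingTerm-const 1#)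
  leadingTerm-^ {d} f~ (suc n) = leadingTerm-≡ (≡.sym (ℕ.*-suc d n)) (leadingTerm-* f~ (leadingTerm-^ f~ n))

  leadingTerm-∏ : ∀ rs (g : Carrier → Carrier) → LeadingTerm 1# (length rs) (λ x → Defs.prodList K rs (λ r → x + g r))
  leadingTerm-∏ []       g = leadingTerm-const 1#
  leadingTerm-∏ (r ∷ rs) g = leadingTerm-cong (*-identityˡ 1#) (λ _ → refl) (leadingTerm-* (leadingTerm-X+ (g r)) (leadingTerm-∏ rs g))

  divide : Carrier → List Carrier → List Carrier
  divide r []           = []
  divide r (a ∷ [])     = []
  divide r (a ∷ b ∷ as) = eval (b ∷ as) r ∷ divide r (b ∷ as)

  eval-divide : ∀ r as x → eval as x ≈ (x - r) * eval (divide r as) x + eval as r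
  eval-divide r []           x = sym (trans (+-congʳ (zeroʳ _)) (+-identityˡ _))
  eval-divide r (a ∷ [])     x = begin
    a + x * 0#                ≈⟨ +-congˡ (zeroʳ x) ⟩
    a + 0#                    ≈⟨ sym (+-congˡ (zeroʳ r)) ⟩
    a + r * 0#                ≈⟨ sym (+-identityˡ _) ⟩
    0# + (a + r * 0#)         ≈⟨ sym (+-congʳ (zeroʳ _)) ⟩
    (x - r) * 0# + (a + r * 0#) ∎
  eval-divide r (a ∷ b ∷ as) x = begin
    a + x * eval (b ∷ as) x                                      ≈⟨ +-congˡ (*-congˡ (eval-divide r (b ∷ as) x)) ⟩
    a + x * ((x - r) * eval (divide r (b ∷ as)) x + eval (b ∷ as) r)
      ≈⟨ solve 5 (λ a x r q t → a :+ x :* ((x :- r) :* q :+ t) := (x :- r) :* (t :+ x :* q) :+ (a :+ r :* t)) refl a x r (eval (divide r (b ∷ as)) x) (eval (b ∷ as) r) ⟩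
    (x - r) * (eval (b ∷ as) r + x * eval (divide r (b ∷ as)) x) + (a + r * eval (b ∷ as) r) ∎

  length-divide : ∀ r a as → length (divide r (a ∷ as)) ≡ length as
  length-divide r a []       = ≡.refl
  length-divide r a (b ∷ as) = ≡.cong suc (length-divide r b as)

  AllZero : List Carrier → Set (c ⊔ ℓ)
  AllZero = All (_≈ 0#)

  eval-allZero : ∀ {as} → AllZero as → ∀ x → eval as x ≈ 0#
  eval-allZero []           x = refl
  eval-allZero (a≈0 ∷ as≈0) x = trans (+-cong a≈0 (trans (*-congˡ (eval-allZero as≈0 x)) (zeroʳ x))) (+-identityˡ 0#)

  divide-allZero : ∀ r as → eval as r ≈ 0# → AllZero (divide r as) → AllZero as
  divide-allZero r []           _    _            = []
  divide-allZero r (a ∷ [])     a≈0′ _            = trans (sym (trans (+-congˡ (zeroʳ r)) (+-identityʳ a))) a≈0′ ∷ []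
  divide-allZero r (a ∷ b ∷ as) root (t≈0 ∷ q≈0) = a≈0 ∷ divide-allZero r (b ∷ as) t≈0 q≈0
    where
    a≈0 : a ≈ 0#
    a≈0 = trans (sym (trans (+-congˡ (trans (*-congˡ t≈0) (zeroʳ r))) (+-identityʳ a))) root

  -- Dividing out one root leaves the remaining roots as roots of the quotient.
  coefficients-vanish : ∀ rs as → length as ≤ length rs → Unique rs → All (λ r → eval as r ≈ 0#) rs → AllZero as
  coefficients-vanish []       []       _             _          _             = []
  coefficients-vanish (r ∷ rs) []       _             _          _             = []
  coefficients-vanish (r ∷ rs) (a ∷ as) (s≤s ∣as∣≤∣rs∣) (r≉rs ∷ urs) (r-root ∷ rs-roots) =
    divide-allZero r (a ∷ as) r-root
      (coefficients-vanish rs (divide r (a ∷ as)) (ℕ.≤-trans (ℕ.≤-reflexive (length-divide r a as)) ∣as∣≤∣rs∣) urs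
        (quotient-roots rs r≉rs rs-roots))
    where
    quotient-roots : ∀ rs′ → All (r ≉_) rs′ → All (λ r′ → eval (a ∷ as) r′ ≈ 0#) rs′ →
                     All (λ r′ → eval (divide r (a ∷ as)) r′ ≈ 0#) rs′
    quotient-roots []         _              _               = []
    quotient-roots (r′ ∷ rs′) (r≉r′ ∷ r≉rs′) (r′-root ∷ roots) = q≈0 ∷ quotient-roots rs′ r≉rs′ roots
      where
      [r′-r]q≈0 : (r′ - r) * eval (divide r (a ∷ as)) r′ ≈ 0#
      [r′-r]q≈0 = trans (sym (trans (+-congˡ r-root) (+-identityʳ _))) (trans (sym (eval-divide r (a ∷ as) r′)) r′-root)
      q≈0 : eval (divide r (a ∷ as)) r′ ≈ 0#
      q≈0 with x*y≈0⇒x≈0⊎y≈0 [r′-r]q≈0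
      ... | inj₁ r′-r≈0 = ⊥-elim (r≉r′ (sym (x-y≈0⇒x≈y r′-r≈0)))
      ... | inj₂ q≈0′   = q≈0′

  degreeBelow-vanishes : ∀ {d f} → DegreeBelow d f → ∀ rs → d ≤ length rs → Unique rs →
                         (∀ {r} → r ∈ rs → f r ≈ 0#) → ∀ x → f x ≈ 0#
  degreeBelow-vanishes (as , ∣as∣≤d , f≈) rs d≤∣rs∣ urs roots x =
    trans (f≈ x) (eval-allZero (coefficients-vanish rs as (ℕ.≤-trans ∣as∣≤d d≤∣rs∣) urs
      (tabulateₛ setoid λ r∈ → trans (sym (f≈ _)) (roots r∈))) x)

  leadingTerm-coefficients : ∀ {a d f} → LeadingTerm a d f →
                             Σ (List Carrier) λ as → length as ≡ d × (∀ x → f x ≈ eval (as ++ a ∷ []) x)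
  leadingTerm-coefficients {a} {d} {f} (as , ∣as∣≤d , f≈) = padded , ∣padded∣≡d , λ x → begin
    f x                                                     ≈⟨ f≈ x ⟩
    a * x ^ d + eval as x                                   ≈⟨ +-comm _ _ ⟩
    eval as x + a * x ^ d                                   ≈⟨ +-cong (sym (eval-padded x)) (leading x) ⟩
    eval padded x + x ^ length padded * eval (a ∷ []) x     ≈⟨ sym (eval-++ padded (a ∷ []) x) ⟩
    eval (padded ++ a ∷ []) x                               ∎
    where
    padded : List Carrier
    padded = as ++ replicate (d ℕ.∸ length as) 0#
    ∣padded∣≡d : length padded ≡ d
    ∣padded∣≡d = ≡.trans (List.length-++ as) (≡.trans (≡.cong (length as ℕ.+_) (List.length-replicate (d ℕ.∸ length as))) (ℕ.m+[n∸m]≡n ∣as∣≤d))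
    eval-replicate-0# : ∀ n x → eval (replicate n 0#) x ≈ 0#
    eval-replicate-0# zero    x = refl
    eval-replicate-0# (suc n) x = trans (+-identityˡ _) (trans (*-congˡ (eval-replicate-0# n x)) (zeroʳ x))
    eval-padded : ∀ x → eval padded x ≈ eval as x
    eval-padded x = trans (eval-++ as _ x) (trans (+-congˡ (trans (*-congˡ (eval-replicate-0# (d ℕ.∸ length as) x)) (zeroʳ _))) (+-identityʳ _))
    leading : ∀ x → a * x ^ d ≈ x ^ length padded * eval (a ∷ []) x
    leading x = trans (*-comm _ _) (*-cong (^-congʳ x (≡.sym ∣padded∣≡d)) (sym (trans (+-congˡ (zeroʳ x)) (+-identityʳ a))))

  monic-roots-≤ : ∀ {d f} → LeadingTerm 1# d f → ∀ rs → Unique rs → (∀ {r} → r ∈ rs → f r ≈ 0#) → length rs ≤ d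
  monic-roots-≤ {d} {f} f~ rs urs roots with length rs ℕ.≤? d
  ... | yes ∣rs∣≤d = ∣rs∣≤d
  ... | no ∣rs∣≰d  = ⊥-elim (1≉0 (leading-vanishes (leadingTerm-coefficients f~)))
    where
    leading-vanishes : (Σ (List Carrier) λ as → length as ≡ d × (∀ x → f x ≈ eval (as ++ 1# ∷ []) x)) → 1# ≈ 0#
    leading-vanishes (as , ∣as∣≡d , f≈) =
      last-vanishes (coefficients-vanish rs (as ++ 1# ∷ []) ∣as1∣≤∣rs∣ urs (tabulateₛ setoid λ r∈ → trans (sym (f≈ _)) (roots r∈)))
      where
      ∣as1∣≤∣rs∣ : length (as ++ 1# ∷ []) ≤ length rs
      ∣as1∣≤∣rs∣ = ℕ.≤-trans (ℕ.≤-reflexive (≡.trans (List.length-++ as) (≡.trans (ℕ.+-comm (length as) 1) (≡.cong suc ∣as∣≡d))))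
                             (ℕ.≰⇒> ∣rs∣≰d)
      last-vanishes : AllZero (as ++ 1# ∷ []) → 1# ≈ 0#
      last-vanishes as1≈0 with 1≈0 ∷ [] ← ++⁻ʳ as as1≈0 = 1≈0

  monic-factorisation : ∀ {d f} → LeadingTerm 1# d f → ∀ rs → length rs ≡ d → Unique rs →
                        (∀ {r} → r ∈ rs → f r ≈ 0#) → ∀ x → f x ≈ Defs.prodList K rs (λ r → x - r)
  monic-factorisation {d} {f} f~ rs ∣rs∣≡d urs roots x =
    x-y≈0⇒x≈y (degreeBelow-vanishes f-∏<d rs (ℕ.≤-reflexive (≡.sym ∣rs∣≡d)) urs f-∏-roots x)
    where
    ∏ : Carrier → Carrier
    ∏ x = Defs.prodList K rs (λ r → x - r)
    f-∏<d : DegreeBelow d (λ x → f x - ∏ x)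
    f-∏<d = leadingTerm-0#⇒degreeBelow (leadingTerm-cong (-‿inverseʳ 1#) (λ _ → refl)
              (leadingTerm-+ f~ (leadingTerm-neg (leadingTerm-≡ ∣rs∣≡d (leadingTerm-∏ rs (λ r → - r))))))
    ∏-root : ∀ {r} rs′ → r ∈ rs′ → Defs.prodList K rs′ (λ r′ → r - r′) ≈ 0#
    ∏-root (r′ ∷ rs′) (here r≈r′) = trans (*-congʳ (x≈y⇒x-y≈0 r≈r′)) (zeroˡ _)
    ∏-root (r′ ∷ rs′) (there r∈)  = trans (*-congˡ (∏-root rs′ r∈)) (zeroʳ _)
    f-∏-roots : ∀ {r} → r ∈ rs → f r - ∏ r ≈ 0#
    f-∏-roots r∈ = trans (+-cong (roots r∈) (-‿cong (∏-root rs r∈))) (trans (+-identityˡ _) -0#≈0#)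

prime∤! : ∀ {p} → Prime p → ∀ m → m < p → ¬ (p ∣ m !)
prime∤! {p} p-prime zero    _   p∣1 = ℕ.<⇒≱ (ℕ.nonTrivial⇒n>1 p {{prime⇒nonTrivial p-prime}}) (∣⇒≤ p∣1)
prime∤! {p} p-prime (suc m) m<p p∣m! with euclidsLemma (suc m) (m !) p-prime p∣m!
... | inj₁ p∣1+m = ℕ.<⇒≱ m<p (∣⇒≤ p∣1+m)
... | inj₂ p∣m!  = prime∤! p-prime m (ℕ.<-trans (ℕ.n<1+n m) m<p) p∣m!

prime∣choose : ∀ {p k} → Prime p → 0 < k → k < p → p ∣ (p choose k)
prime∣choose {p} {k} p-prime 0<k k<p with euclidsLemma (p choose k) (k ! ℕ.* (p ℕ.∸ k) !) p-prime p∣choose·k!·[p-k]!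
  where
  k≤p : k ℕ.≤ p
  k≤p = ℕ.<⇒≤ k<p
  choose·k!·[p-k]!≡p! : (p choose k) ℕ.* (k ! ℕ.* (p ℕ.∸ k) !) ≡ p !
  choose·k!·[p-k]!≡p! = ≡.trans (≡.cong (ℕ._* (k ! ℕ.* (p ℕ.∸ k) !)) (nCk≡n!/k![n-k]! k≤p))
                           (m/n*n≡m {{ℕ._!*_!≢0 k (p ℕ.∸ k)}} (k![n∸k]!∣n! k≤p))
  n∣n! : ∀ n → 0 < n → n ∣ n !
  n∣n! (suc n) _ = m∣m*n (n !)
  p∣choose·k!·[p-k]! : p ∣ ((p choose k) ℕ.* (k ! ℕ.* (p ℕ.∸ k) !))
  p∣choose·k!·[p-k]! = ≡.subst (p ∣_) (≡.sym choose·k!·[p-k]!≡p!) (n∣n! p (ℕ.<-trans 0<k k<p))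
... | inj₁ p∣C = p∣C
... | inj₂ p∣k!·[p-k]! with euclidsLemma (k !) ((p ℕ.∸ k) !) p-prime p∣k!·[p-k]!
...   | inj₁ p∣k!     = ⊥-elim (prime∤! p-prime k k<p p∣k!)
...   | inj₂ p∣[p-k]! = ⊥-elim (prime∤! p-prime (p ℕ.∸ k) (ℕ.∸-monoʳ-< 0<k (ℕ.<⇒≤ k<p)) p∣[p-k]!)

module Sums {c ℓ : Level} (K : FiniteField c ℓ) where

  open FieldArithmetic K
  open Enumeration K
  module ∑ = Fold +-commutativeMonoid
  module ∏ = Fold *-commutativeMonoid
  module # = Fold ℕ.+-0-commutativeMonoid

  ∑ : List Carrier → (Carrier → Carrier) → Carrier
  ∑ = ∑.fold

  ∏ : List Carrier → (Carrier → Carrier) → Carrier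
  ∏ = ∏.fold

  # : List Carrier → ℕ
  # xs = #.fold xs (λ _ → 1)

  #≡length : ∀ xs → # xs ≡ length xs
  #≡length []       = ≡.refl
  #≡length (x ∷ xs) = ≡.cong suc (#≡length xs)

  sumList≡∑ : ∀ xs f → Defs.sumList K xs f ≡ ∑ xs f
  sumList≡∑ []       f = ≡.refl
  sumList≡∑ (x ∷ xs) f = ≡.cong (f x +_) (sumList≡∑ xs f)

  prodList≡∏ : ∀ xs f → Defs.prodList K xs f ≡ ∏ xs f
  prodList≡∏ []       f = ≡.refl
  prodList≡∏ (x ∷ xs) f = ≡.cong (f x *_) (prodList≡∏ xs f)

  ∑-const : ∀ xs a → ∑ xs (λ _ → a) ≈ (length xs · 1#) * a
  ∑-const []       a = sym (zeroˡ a)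
  ∑-const (x ∷ xs) a = trans (+-cong (sym (*-identityˡ a)) (∑-const xs a)) (sym (distribʳ a 1# _))

  ∏-const : ∀ xs a → ∏ xs (λ _ → a) ≈ a ^ length xs
  ∏-const []       a = refl
  ∏-const (x ∷ xs) a = *-congˡ (∏-const xs a)

  *-distribˡ-∑ : ∀ xs a h → a * ∑ xs h ≈ ∑ xs (λ x → a * h x)
  *-distribˡ-∑ []       a h = zeroʳ a
  *-distribˡ-∑ (x ∷ xs) a h = trans (distribˡ a _ _) (+-congˡ (*-distribˡ-∑ xs a h))

  -‿distrib-∑ : ∀ xs h → - ∑ xs h ≈ ∑ xs (λ x → - h x)
  -‿distrib-∑ xs h = trans (sym (-1*x≈-x _)) (trans (*-distribˡ-∑ xs (- 1#) h) (∑.fold-cong xs λ x → -1*x≈-x (h x)))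

  ∏-≉0 : ∀ xs h → (∀ {x} → x ∈ xs → h x ≉ 0#) → ∏ xs h ≉ 0#
  ∏-≉0 []       h h≉0 = 1≉0
  ∏-≉0 (x ∷ xs) h h≉0 = *-≉0 (h≉0 (here refl)) (∏-≉0 xs h (h≉0 ∘ there))

  ∏-≈0 : ∀ xs h → Congruent _≈_ _≈_ h → ∀ {z} → z ∈ xs → h z ≈ 0# → ∏ xs h ≈ 0#
  ∏-≈0 (x ∷ xs) h h-cong (here z≈x) hz≈0 = trans (*-congʳ (trans (h-cong (sym z≈x)) hz≈0)) (zeroˡ _)
  ∏-≈0 (x ∷ xs) h h-cong (there z∈) hz≈0 = trans (*-congˡ (∏-≈0 xs h h-cong z∈ hz≈0)) (zeroʳ _)

  length-enum-∖ : ∀ {p} {P : Pred Carrier p} (P? : Decidable P) → P Respects _≈_ → ∀ {a} → P a →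
                  length (enum P?) ≡ suc (length (enum (P? ∖ a)))
  length-enum-∖ P? P-resp {a} Pa =
    ≡.trans (≡.sym (#≡length (enum P?)))
      (≡.trans (#.fold-enum-∖ P? P-resp Pa (λ _ → 1) (λ _ → ≡.refl)) (≡.cong suc (#≡length (enum (P? ∖ a)))))

  ∑-enum-single : ∀ {p} {P : Pred Carrier p} (P? : Decidable P) → P Respects _≈_ → ∀ {a} → P a →
                  ∀ g → Congruent _≈_ _≈_ g → (∀ {x} → P x → x ≉ a → g x ≈ 0#) → ∑ (enum P?) g ≈ g a
  ∑-enum-single P? P-resp {a} Pa g g-cong g≈0 = begin
    ∑ (enum P?) g                         ≈⟨ ∑.fold-enum-∖ P? P-resp Pa g g-cong ⟩
    g a + ∑ (enum (P? ∖ a)) g             ≈⟨ +-congˡ (∑.fold-cong-∈ (enum (P? ∖ a)) λ x∈ → uncurry g≈0 (∈-enum⁻ (P? ∖ a) (∖-resp P-resp) x∈)) ⟩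
    g a + ∑ (enum (P? ∖ a)) (λ _ → 0#)    ≈⟨ +-congˡ (∑.fold-ε (enum (P? ∖ a))) ⟩
    g a + 0#                              ≈⟨ +-identityʳ _ ⟩
    g a                                   ∎

  enum-U : enum U? ≡ elements
  enum-U = List.filter-all U? (universal-U elements)

  ∑-translate : ∀ a h → Congruent _≈_ _≈_ h → ∑ elements (λ x → h (x + a)) ≈ ∑ elements h
  ∑-translate a h h-cong = begin
    ∑ elements (λ x → h (x + a))  ≡⟨ ≡.cong (λ xs → ∑ xs (λ x → h (x + a))) (≡.sym enum-U) ⟩
    ∑ (enum U?) (λ x → h (x + a)) ≈⟨ ∑.fold-bijection U? U? (λ _ _ → tt) (λ _ _ → tt) translation h h-cong ⟩
    ∑ (enum U?) h                 ≡⟨ ≡.cong (λ xs → ∑ xs h) enum-U ⟩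
    ∑ elements h                  ∎
    where
    translation : BijectionOn U U (_+ a)
    translation = record
      { cong       = +-congʳ
      ; maps       = λ _ → tt
      ; injective  = λ _ _ x+a≈y+a → +-cancelʳ _ _ _ x+a≈y+a
      ; surjective = λ {y} _ → y - a , tt , solve 2 (λ y a → y := (y :- a) :+ a) refl y a
      }

  length-nonzero : length elements ≡ suc (length (enum (U? ∖ 0#)))
  length-nonzero = ≡.trans (≡.cong length (≡.sym enum-U)) (length-enum-∖ U? (λ _ _ → tt) tt)

module PrimeCharacteristic {c ℓ : Level} (K : FiniteField c ℓ) where

  open FieldArithmetic K
  open Enumeration K
  open Sums K

  -- Summing x + 1 over K is a reindexing of summing x, so |K| · 1 = ∑ 1 vanishes.
  card·1≈0 : length elements · 1# ≈ 0#
  card·1≈0 = +-cancelˡ S _ _ (begin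
    S + length elements · 1#      ≈⟨ +-congˡ (sym (trans (∑-const elements 1#) (*-identityʳ _))) ⟩
    S + ∑ elements (λ _ → 1#)     ≈⟨ sym (∑.fold-∙ elements id (λ _ → 1#)) ⟩
    ∑ elements (λ x → x + 1#)     ≈⟨ ∑-translate 1# id id ⟩
    S                             ≈⟨ sym (+-identityʳ S) ⟩
    S + 0#                        ∎)
    where
    S : Carrier
    S = ∑ elements id

  p·1≈0 : ∀ p N → length elements ≡ p ℕ.^ N → p · 1# ≈ 0#
  p·1≈0 p N ∣K∣≡pᴺ = x^n≈0⇒x≈0 N (trans (sym (·1-homo-^ p N)) (trans (reflexive (≡.cong (_· 1#) (≡.sym ∣K∣≡pᴺ))) card·1≈0))

  fermat : ∀ x → x ^ length elements ≈ x
  fermat x with x ≟ 0#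
  ... | yes x≈0 = trans (^-congˡ (length elements) x≈0) (trans (reflexive (≡.cong (0# ^_) length-nonzero)) (trans (zeroˡ _) (sym x≈0)))
  ... | no x≉0  = begin
    x ^ length elements  ≡⟨ ≡.cong (x ^_) length-nonzero ⟩
    x * x ^ N            ≈⟨ *-congˡ xᴺ≈1 ⟩
    x * 1#               ≈⟨ *-identityʳ x ⟩
    x                    ∎
    where
    nonzero : List Carrier
    nonzero = enum (U? ∖ 0#)
    N : ℕ
    N = length nonzero
    nonzero-resp : (U ∩ ∁ (_≈ 0#)) Respects _≈_
    nonzero-resp = ∖-resp (λ _ _ → tt)
    Π : Carrier
    Π = ∏ nonzero id
    Π≉0 : Π ≉ 0#
    Π≉0 = ∏-≉0 nonzero id (λ y∈ → proj₂ (∈-enum⁻ (U? ∖ 0#) nonzero-resp y∈))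
    multiplication : BijectionOn (U ∩ ∁ (_≈ 0#)) (U ∩ ∁ (_≈ 0#)) (x *_)
    multiplication = record
      { cong       = *-congˡ
      ; maps       = λ (_ , y≉0) → tt , *-≉0 x≉0 y≉0
      ; injective  = λ _ _ → *-cancelˡ x≉0
      ; surjective = λ {y} (_ , y≉0) → x ⁻¹ * y , (tt , *-≉0 (⁻¹-≉0 x≉0) y≉0) ,
                       sym (trans (sym (*-assoc _ _ _)) (trans (*-congʳ (⁻¹-inverse x x≉0)) (*-identityˡ y)))
      }
    xᴺΠ≈Π : x ^ N * Π ≈ Π
    xᴺΠ≈Π = begin
      x ^ N * Π                              ≈⟨ *-congʳ (sym (∏-const nonzero x)) ⟩
      ∏ nonzero (λ _ → x) * ∏ nonzero id     ≈⟨ sym (∏.fold-∙ nonzero (λ _ → x) id) ⟩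
      ∏ nonzero (x *_)                       ≈⟨ ∏.fold-bijection (U? ∖ 0#) (U? ∖ 0#) nonzero-resp nonzero-resp multiplication id id ⟩
      Π                                      ∎
    xᴺ≈1 : x ^ N ≈ 1#
    xᴺ≈1 = *-cancelˡ Π≉0 (trans (*-comm _ _) (trans xᴺΠ≈Π (sym (*-identityʳ Π))))

  module _ (p : ℕ) (p-prime : Prime p) (p·1≈0′ : p · 1# ≈ 0#) where

    open import Algebra.Properties.CommutativeSemiring.Binomial commutativeSemiring as Binomial using ()
    open import Algebra.Properties.Monoid.Sum +-monoid using (sum)
    open import Algebra.Properties.Semiring.Mult semiring using (×-assoc-*) renaming (×-congʳ to ·-congʳ)
    open import Algebra.Properties.CommutativeSemiring.Exp commutativeSemiring using () renaming (_^_ to _^ˢ_)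

    private
      sum-top : ∀ m (h : Fin (suc m) → Carrier) → (∀ k → toℕ k < m → h k ≈ 0#) → sum h ≈ h (fromℕ m)
      sum-top zero    h _   = +-identityʳ _
      sum-top (suc m) h h≈0 = trans (+-congʳ (h≈0 zero (s≤s z≤n))) (trans (+-identityˡ _) (sum-top m (h ∘ suc) λ k k<m → h≈0 (suc k) (s≤s k<m)))

      multiple-of-p : ∀ n t → p ∣ n → n · t ≈ 0#
      multiple-of-p n t (divides d ≡.refl) = begin
        (d ℕ.* p) · t               ≈⟨ ·-congʳ (d ℕ.* p) (sym (*-identityˡ t)) ⟩
        (d ℕ.* p) · (1# * t)        ≈⟨ sym (×-assoc-* (d ℕ.* p) 1# t) ⟩
        ((d ℕ.* p) · 1#) * t        ≈⟨ *-congʳ (·1-homo-* d p) ⟩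
        ((d · 1#) * (p · 1#)) * t   ≈⟨ *-congʳ (*-congˡ p·1≈0′) ⟩
        ((d · 1#) * 0#) * t         ≈⟨ *-congʳ (zeroʳ _) ⟩
        0# * t                      ≈⟨ zeroˡ t ⟩
        0#                          ∎

      freshmans-dream : ∀ n x y → (∀ k → toℕ k < n → p ∣ (suc n choose suc (toℕ k))) → (x + y) ^ suc n ≈ x ^ suc n + y ^ suc n
      freshmans-dream n x y p∣middle = begin
        (x + y) ^ suc n                                       ≡⟨ ^≡^ˢ (x + y) (suc n) ⟩
        (x + y) ^ˢ suc n                                      ≈⟨ Binomial.theorem (suc n) x y ⟩
        term zero + sum (λ k → term (suc k))                  ≈⟨ +-congˡ (sum-top n (term ∘ suc) λ k k<n → multiple-of-p _ _ (p∣middle k k<n)) ⟩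
        term zero + term (suc (fromℕ n))                      ≈⟨ +-cong first last ⟩
        y ^ suc n + x ^ suc n                                 ≈⟨ +-comm _ _ ⟩
        x ^ suc n + y ^ suc n                                 ∎
        where
        term : Fin (suc (suc n)) → Carrier
        term = Binomial.binomialTerm x y (suc n)
        first : term zero ≈ y ^ suc n
        first = trans (+-identityʳ _) (trans (*-identityˡ _) (reflexive (≡.sym (^≡^ˢ y (suc n)))))
        last : term (suc (fromℕ n)) ≈ x ^ suc n
        last = begin
          (suc n choose suc (toℕ (fromℕ n))) · (x ^ˢ suc (toℕ (fromℕ n)) * y ^ˢ (n ℕ.∸ toℕ (fromℕ n)))
            ≡⟨ ≡.cong (λ m → (suc n choose suc m) · (x ^ˢ suc m * y ^ˢ (n ℕ.∸ m))) (toℕ-fromℕ n) ⟩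
          (suc n choose suc n) · (x ^ˢ suc n * y ^ˢ (n ℕ.∸ n))     ≡⟨ ≡.cong₂ (λ a b → a · (x ^ˢ suc n * y ^ˢ b)) (nCn≡1 (suc n)) (ℕ.n∸n≡0 n) ⟩
          x ^ˢ suc n * 1# + 0#                                ≈⟨ trans (+-identityʳ _) (*-identityʳ _) ⟩
          x ^ˢ suc n                                          ≡⟨ ≡.sym (^≡^ˢ x (suc n)) ⟩
          x ^ suc n                                           ∎

    frobenius : ∀ x y → (x + y) ^ p ≈ x ^ p + y ^ p
    frobenius x y = ≡.subst (λ m → (x + y) ^ m ≈ x ^ m + y ^ m) (≡.sym p≡1+p′) (freshmans-dream p′ x y p∣middle)
      where
      p′ : ℕ
      p′ = ℕ.pred p
      p≡1+p′ : p ≡ suc p′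
      p≡1+p′ = ≡.sym (ℕ.suc-pred p {{ℕ.nonTrivial⇒nonZero p {{prime⇒nonTrivial p-prime}}}})
      p∣middle : ∀ k → toℕ k < p′ → p ∣ (suc p′ choose suc (toℕ k))
      p∣middle k k<p′ = ≡.subst (λ m → p ∣ (m choose suc (toℕ k))) p≡1+p′
        (prime∣choose p-prime (s≤s z≤n) (≡.subst (suc (toℕ k) <_) (≡.sym p≡1+p′) (s≤s k<p′)))

    frobenius-^ : ∀ k x y → (x + y) ^ (p ℕ.^ k) ≈ x ^ (p ℕ.^ k) + y ^ (p ℕ.^ k)
    frobenius-^ zero    x y = trans (x^1≈x _) (sym (+-cong (x^1≈x x) (x^1≈x y)))
    frobenius-^ (suc k) x y = begin
      (x + y) ^ (p ℕ.* p ℕ.^ k)                  ≈⟨ sym (^-assocʳ (x + y) p (p ℕ.^ k)) ⟩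
      ((x + y) ^ p) ^ (p ℕ.^ k)                  ≈⟨ ^-congˡ (p ℕ.^ k) (frobenius x y) ⟩
      (x ^ p + y ^ p) ^ (p ℕ.^ k)                ≈⟨ frobenius-^ k (x ^ p) (y ^ p) ⟩
      (x ^ p) ^ (p ℕ.^ k) + (y ^ p) ^ (p ℕ.^ k)  ≈⟨ +-cong (^-assocʳ x p (p ℕ.^ k)) (^-assocʳ y p (p ℕ.^ k)) ⟩
      x ^ (p ℕ.* p ℕ.^ k) + y ^ (p ℕ.* p ℕ.^ k)  ∎

module FibreCounting {c ℓ : Level} (K : FiniteField c ℓ) (f : FiniteField.Carrier K → FiniteField.Carrier K) where

  open FieldArithmetic K
  open Enumeration K
  open Sums K

  fibre : Carrier → List Carrier → List Carrier
  fibre y = filter (λ x → f x ≟ y)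

  length≤∑fibres : ∀ ys xs → (∀ {x} → x ∈ xs → Any (f x ≈_) ys) → length xs ≤ #.fold ys (λ y → length (fibre y xs))
  length≤∑fibres ys []       _      = z≤n
  length≤∑fibres ys (x ∷ xs) landed = ℕ.≤-trans (ℕ.+-mono-≤ (x-counted ys (landed (here refl))) (length≤∑fibres ys xs (landed ∘ there)))
    (ℕ.≤-reflexive (≡.sym (≡.trans (#.fold-cong ys λ y → fibre-∷ y) (#.fold-∙ ys _ _))))
    where
    fibre-∷ : ∀ y → length (fibre y (x ∷ xs)) ≡ length (fibre y (x ∷ [])) ℕ.+ length (fibre y xs)
    fibre-∷ y with f x ≟ y
    ... | yes _ = ≡.refl
    ... | no _  = ≡.refl
    x-counted : ∀ ys → Any (f x ≈_) ys → 1 ≤ #.fold ys (λ y → length (fibre y (x ∷ [])))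
    x-counted (y ∷ ys) (here fx≈y) with f x ≟ y
    ... | yes _    = s≤s z≤n
    ... | no fx≉y  = ⊥-elim (fx≉y fx≈y)
    x-counted (y ∷ ys) (there fx∈ys) = ℕ.≤-trans (x-counted ys fx∈ys) (ℕ.m≤n+m _ _)

  ∑-bounded : ∀ ys (F : Carrier → ℕ) B → (∀ y → F y ≤ B) → #.fold ys F ≤ length ys ℕ.* B
  ∑-bounded []       F B F≤B = z≤n
  ∑-bounded (y ∷ ys) F B F≤B = ℕ.+-mono-≤ (F≤B y) (∑-bounded ys F B F≤B)

module Subfield {c ℓ : Level} (K : FiniteField c ℓ) (q n : ℕ)
                (q-primePower : IsPrimePower q) (card≡qⁿ : Defs.card K ≡ q ℕ.^ n) where

  open FieldArithmetic K
  open Enumeration K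
  open Sums K
  open PolynomialFunctions K
  open PrimeCharacteristic K using (p·1≈0; fermat; frobenius-^)

  private
    p : ℕ
    p = proj₁ q-primePower
    m : ℕ
    m = proj₁ (proj₂ q-primePower)
    p-prime : Prime p
    p-prime = proj₁ (proj₂ (proj₂ q-primePower))
    q≡p^[1+m] : q ≡ p ℕ.^ suc m
    q≡p^[1+m] = proj₂ (proj₂ (proj₂ q-primePower))
    instance
      p≢0 : ℕ.NonZero p
      p≢0 = ℕ.nonTrivial⇒nonZero p {{prime⇒nonTrivial p-prime}}
    p·1≈0′ : p · 1# ≈ 0#
    p·1≈0′ = p·1≈0 p (suc m ℕ.* n) (≡.trans card≡qⁿ (≡.trans (≡.cong (ℕ._^ n) q≡p^[1+m]) (ℕ.^-*-assoc p (suc m) n)))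

  q≥2 : 2 ≤ q
  q≥2 = ≡.subst (2 ≤_) (≡.sym q≡p^[1+m])
          (ℕ.≤-trans (ℕ.nonTrivial⇒n>1 p {{prime⇒nonTrivial p-prime}}) (ℕ.m≤m*n p (p ℕ.^ m) {{ℕ.m^n≢0 p m}}))

  q≡1+[q∸1] : q ≡ suc (q ∸ 1)
  q≡1+[q∸1] = ≡.sym (ℕ.m+[n∸m]≡n (ℕ.≤-trans (s≤s z≤n) q≥2))

  qᵏ≥1 : ∀ k → 1 ≤ q ℕ.^ k
  qᵏ≥1 k = ℕ.m^n>0 q {{ℕ.>-nonZero (ℕ.≤-trans (s≤s z≤n) q≥2)}} k

  q·1≈0 : q · 1# ≈ 0#
  q·1≈0 = begin
    q · 1#                      ≡⟨ ≡.cong (_· 1#) q≡p^[1+m] ⟩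
    (p ℕ.* p ℕ.^ m) · 1#        ≈⟨ ·1-homo-* p (p ℕ.^ m) ⟩
    (p · 1#) * (p ℕ.^ m) · 1#   ≈⟨ *-congʳ p·1≈0′ ⟩
    0# * (p ℕ.^ m) · 1#         ≈⟨ zeroˡ _ ⟩
    0#                          ∎

  x^q≈x*x^[q∸1] : ∀ x → x ^ q ≈ x * x ^ (q ∸ 1)
  x^q≈x*x^[q∸1] x = ^-congʳ x q≡1+[q∸1]

  0^q≈0 : 0# ^ q ≈ 0#
  0^q≈0 = trans (x^q≈x*x^[q∸1] 0#) (zeroˡ _)

  frobenius : ∀ x y → (x + y) ^ q ≈ x ^ q + y ^ q
  frobenius x y = ≡.subst (λ e → (x + y) ^ e ≈ x ^ e + y ^ e) (≡.sym q≡p^[1+m])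
                    (frobenius-^ p p-prime p·1≈0′ (suc m) x y)

  frobenius-neg : ∀ x → (- x) ^ q ≈ - x ^ q
  frobenius-neg x = begin
    (- x) ^ q                      ≈⟨ solve 2 (λ a b → a := (b :+ a) :- b) refl _ _ ⟩
    (x ^ q + (- x) ^ q) - x ^ q    ≈⟨ +-congʳ (sym (frobenius x (- x))) ⟩
    (x - x) ^ q - x ^ q            ≈⟨ +-congʳ (trans (^-congˡ q (-‿inverseʳ x)) 0^q≈0) ⟩
    0# - x ^ q                     ≈⟨ +-identityˡ _ ⟩
    - x ^ q                        ∎

  fermat-qⁿ : ∀ x → x ^ (q ℕ.^ n) ≈ x
  fermat-qⁿ x = ≡.subst (λ e → x ^ e ≈ x) card≡qⁿ (fermat x)

  𝔽 : Pred Carrier ℓ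
  𝔽 = InFq K q

  𝔽? : Decidable 𝔽
  𝔽? a = (a ^ q) ≟ a

  𝔽-resp : 𝔽 Respects _≈_
  𝔽-resp a≈b aᵠ≈a = trans (^-congˡ q (sym a≈b)) (trans aᵠ≈a a≈b)

  𝔽-0# : 𝔽 0#
  𝔽-0# = 0^q≈0

  𝔽-1# : 𝔽 1#
  𝔽-1# = 1^n≈1 q

  𝔽-+ : ∀ {a b} → 𝔽 a → 𝔽 b → 𝔽 (a + b)
  𝔽-+ 𝔽a 𝔽b = trans (frobenius _ _) (+-cong 𝔽a 𝔽b)

  𝔽-neg : ∀ {a} → 𝔽 a → 𝔽 (- a)
  𝔽-neg 𝔽a = trans (frobenius-neg _) (-‿cong 𝔽a)

  𝔽-* : ∀ {a b} → 𝔽 a → 𝔽 b → 𝔽 (a * b)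
  𝔽-* 𝔽a 𝔽b = trans (^-distrib-* _ _ q) (*-cong 𝔽a 𝔽b)

  𝔽-⁻¹ : ∀ {a} → a ≉ 0# → 𝔽 a → 𝔽 (a ⁻¹)
  𝔽-⁻¹ {a} a≉0 𝔽a = ⁻¹-unique a≉0 (begin
    a * (a ⁻¹) ^ q      ≈⟨ *-congʳ (sym 𝔽a) ⟩
    a ^ q * (a ⁻¹) ^ q  ≈⟨ sym (^-distrib-* _ _ q) ⟩
    (a * a ⁻¹) ^ q      ≈⟨ ^-congˡ q (⁻¹-inverse a a≉0) ⟩
    1# ^ q              ≈⟨ 1^n≈1 q ⟩
    1#                  ∎)

  𝔽-^[q∸1] : ∀ {a} → a ≉ 0# → 𝔽 a → a ^ (q ∸ 1) ≈ 1#
  𝔽-^[q∸1] {a} a≉0 𝔽a = *-cancelˡ a≉0 (begin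
    a * a ^ (q ∸ 1)   ≈⟨ sym (x^q≈x*x^[q∸1] a) ⟩
    a ^ q             ≈⟨ 𝔽a ⟩
    a                 ≈⟨ sym (*-identityʳ a) ⟩
    a * 1#            ∎)

  𝔽-elements : List Carrier
  𝔽-elements = enum 𝔽?

  X^q-X : LeadingTerm 1# q (λ x → x ^ q - x)
  X^q-X = leadingTerm-+degreeBelow (leadingTerm-X^ q) (degreeBelow-neg (degreeBelow-mono q≥2 (degreeBelow-cong x^1≈x (degreeBelow-X^ 1))))

  |𝔽|≤q : length 𝔽-elements ≤ q
  |𝔽|≤q = monic-roots-≤ X^q-X 𝔽-elements (enum-unique 𝔽?) (λ a∈ → x≈y⇒x-y≈0 (∈-enum⁻ 𝔽? 𝔽-resp a∈))

  trace : ℕ → Carrier → Carrier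
  trace zero    x = 0#
  trace (suc k) x = x ^ (q ℕ.^ k) + trace k x

  trace-cong : ∀ k {x y} → x ≈ y → trace k x ≈ trace k y
  trace-cong zero    x≈y = refl
  trace-cong (suc k) x≈y = +-cong (^-congˡ (q ℕ.^ k) x≈y) (trace-cong k x≈y)

  trace-^q : ∀ k x → trace k x ^ q ≈ (trace k x - x) + x ^ (q ℕ.^ k)
  trace-^q zero    x = trans 0^q≈0 (sym (trans (+-cong (+-identityˡ _) (x^1≈x x)) (-‿inverseˡ x)))
  trace-^q (suc k) x = begin
    (x ^ (q ℕ.^ k) + trace k x) ^ q                            ≈⟨ frobenius _ _ ⟩
    (x ^ (q ℕ.^ k)) ^ q + trace k x ^ q                        ≈⟨ +-cong (trans (^-assocʳ x (q ℕ.^ k) q) (^-congʳ x (ℕ.*-comm (q ℕ.^ k) q))) (trace-^q k x) ⟩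
    x ^ (q ℕ.^ suc k) + ((trace k x - x) + x ^ (q ℕ.^ k))      ≈⟨ solve 4 (λ C B X A → C :+ ((B :- X) :+ A) := ((A :+ B) :- X) :+ C) refl _ _ _ _ ⟩
    ((x ^ (q ℕ.^ k) + trace k x) - x) + x ^ (q ℕ.^ suc k)      ∎

  trace-𝔽 : ∀ x → 𝔽 (trace n x)
  trace-𝔽 x = trans (trace-^q n x) (trans (+-congˡ (fermat-qⁿ x)) (solve 2 (λ a b → (a :- b) :+ b := a) refl _ _))

  private
    qᵏ<qᵏ⁺¹ : ∀ k → q ℕ.^ k < q ℕ.^ suc k
    qᵏ<qᵏ⁺¹ k = ℕ.^-monoʳ-< q q≥2 (ℕ.n<1+n k)

  trace-degreeBelow : ∀ k → DegreeBelow (q ℕ.^ k) (trace k)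
  trace-degreeBelow zero    = degreeBelow-0#
  trace-degreeBelow (suc k) = degreeBelow-+ (degreeBelow-mono (qᵏ<qᵏ⁺¹ k) (degreeBelow-X^ (q ℕ.^ k)))
                                            (degreeBelow-mono (ℕ.<⇒≤ (qᵏ<qᵏ⁺¹ k)) (trace-degreeBelow k))

  |K|≥2 : 2 ≤ length elements
  |K|≥2 = ≡.subst (2 ≤_) (≡.sym length-nonzero) (s≤s (∈.∈-length setoid 1∈nonzero))
    where
    1∈nonzero : 1# ∈ enum (U? ∖ 0#)
    1∈nonzero = ∈-enum⁺ (U? ∖ 0#) (∖-resp (λ _ _ → _)) (_ , 1≉0)

  n≡1+[n∸1] : n ≡ suc (n ∸ 1)
  n≡1+[n∸1] = exponent-positive n (≡.subst (2 ≤_) card≡qⁿ |K|≥2)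
    where
    exponent-positive : ∀ k → 2 ≤ q ℕ.^ k → k ≡ suc (k ∸ 1)
    exponent-positive zero    (s≤s ())
    exponent-positive (suc k) _ = ≡.refl

  -- The trace K → 𝔽 has fibres of size at most q ^ (n - 1) (the roots of a monic polynomial
  -- of that degree), so |K| = q ^ n forces at least q values.
  q≤|𝔽| : q ≤ length 𝔽-elements
  q≤|𝔽| = ℕ.*-cancelʳ-≤ q (length 𝔽-elements) (q ℕ.^ n′) {{ℕ.>-nonZero (qᵏ≥1 n′)}}
            (ℕ.≤-trans |K|≤∑fibres (∑-bounded 𝔽-elements _ (q ℕ.^ n′) fibre-bound))
    where
    n′ : ℕ
    n′ = n ∸ 1
    open FibreCounting K (trace n)
    fibre-bound : ∀ y → length (fibre y elements) ≤ q ℕ.^ n′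
    fibre-bound y = monic-roots-≤ Tr-y (fibre y elements) (Unique.filter⁺ setoid (λ x → trace n x ≟ y) distinct)
      (λ x∈ → x≈y⇒x-y≈0 (proj₂ (∈.∈-filter⁻ setoid (λ x → trace n x ≟ y) (λ x≈x′ Trx≈y → trans (trace-cong n (sym x≈x′)) Trx≈y) {xs = elements} x∈)))
      where
      Tr-y : LeadingTerm 1# (q ℕ.^ n′) (λ x → trace n x - y)
      Tr-y = ≡.subst (λ k → LeadingTerm 1# (q ℕ.^ n′) (λ x → trace k x - y)) (≡.sym n≡1+[n∸1])
               (leadingTerm-cong refl (λ x → sym (+-assoc _ _ _))
                 (leadingTerm-+degreeBelow (leadingTerm-X^ (q ℕ.^ n′)) (degreeBelow-+ (trace-degreeBelow n′) (degreeBelow-const (- y) (qᵏ≥1 n′)))))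
    |K|≤∑fibres : q ℕ.* q ℕ.^ n′ ≤ #.fold 𝔽-elements (λ y → length (fibre y elements))
    |K|≤∑fibres = ≡.subst (_≤ #.fold 𝔽-elements (λ y → length (fibre y elements))) (≡.trans card≡qⁿ (≡.cong (q ℕ.^_) n≡1+[n∸1]))
                    (length≤∑fibres 𝔽-elements elements (λ {x} _ → ∈-enum⁺ 𝔽? 𝔽-resp (trace-𝔽 x)))

  |𝔽|≡q : length 𝔽-elements ≡ q
  |𝔽|≡q = ℕ.≤-antisym |𝔽|≤q q≤|𝔽|

module SubfieldSums {c ℓ : Level} (K : FiniteField c ℓ) (q n : ℕ)
                    (q-primePower : IsPrimePower q) (card≡qⁿ : Defs.card K ≡ q ℕ.^ n) where

  open FieldArithmetic K
  open Enumeration K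
  open Sums K
  open PolynomialFunctions K
  open Subfield K q n q-primePower card≡qⁿ

  𝔽∖-resp : ∀ {a} → (𝔽 ∩ ∁ (_≈ a)) Respects _≈_
  𝔽∖-resp = ∖-resp 𝔽-resp

  |𝔽∖a|≡q∸1 : ∀ {a} → 𝔽 a → length (enum (𝔽? ∖ a)) ≡ q ∸ 1
  |𝔽∖a|≡q∸1 𝔽a = ℕ.suc-injective (≡.trans (≡.sym (length-enum-∖ 𝔽? 𝔽-resp 𝔽a)) (≡.trans |𝔽|≡q q≡1+[q∸1]))

  ∏-𝔽-line : ∀ {c} → c ≉ 0# → ∀ Y → ∏ 𝔽-elements (λ a → Y + a * c) ≈ Y ^ q - c ^ (q ∸ 1) * Y
  ∏-𝔽-line {c} c≉0 Y = sym (begin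
    f Y                                          ≈⟨ monic-factorisation f-monic roots |roots|≡q roots-unique roots-vanish Y ⟩
    Defs.prodList K roots (λ r → Y - r)          ≡⟨ prodList≡∏ roots _ ⟩
    ∏ roots (λ r → Y - r)                        ≡⟨ ∏.fold-map 𝔽-elements (λ a → - (a * c)) (λ r → Y - r) ⟩
    ∏ 𝔽-elements (λ a → Y - - (a * c))           ≈⟨ ∏.fold-cong 𝔽-elements (λ a → +-congˡ (-‿involutive _)) ⟩
    ∏ 𝔽-elements (λ a → Y + a * c)               ∎)
    where
    f : Carrier → Carrier
    f Y = Y ^ q - c ^ (q ∸ 1) * Y
    f-monic : LeadingTerm 1# q f
    f-monic = leadingTerm-+degreeBelow (leadingTerm-X^ q)
      (degreeBelow-neg (degreeBelow-scale (c ^ (q ∸ 1)) (degreeBelow-mono q≥2 (degreeBelow-cong x^1≈x (degreeBelow-X^ 1)))))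
    roots : List Carrier
    roots = map (λ a → - (a * c)) 𝔽-elements
    |roots|≡q : length roots ≡ q
    |roots|≡q = ≡.trans (List.length-map _ 𝔽-elements) |𝔽|≡q
    roots-unique : Unique roots
    roots-unique = map-unique _ (enum-unique 𝔽?) λ _ _ -ac≈-bc → *-cancelˡ c≉0 (trans (*-comm _ _) (trans (-‿injective -ac≈-bc) (*-comm _ _)))
    roots-vanish : ∀ {r} → r ∈ roots → f r ≈ 0#
    roots-vanish {r} r∈ with a , a∈ , r≈-ac ← ∈.∈-map⁻ setoid setoid r∈ = begin
      f r                                              ≈⟨ +-cong (^-congˡ q r≈-ac) (-‿cong (*-congˡ r≈-ac)) ⟩
      (- (a * c)) ^ q - c ^ (q ∸ 1) * - (a * c)        ≈⟨ +-congʳ (trans (frobenius-neg _) (-‿cong (trans (^-distrib-* a c q) (*-congʳ (∈-enum⁻ 𝔽? 𝔽-resp a∈))))) ⟩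
      - (a * c ^ q) - c ^ (q ∸ 1) * - (a * c)          ≈⟨ +-congʳ (-‿cong (*-congˡ (x^q≈x*x^[q∸1] c))) ⟩
      - (a * (c * c ^ (q ∸ 1))) - c ^ (q ∸ 1) * - (a * c) ≈⟨ solve 3 (λ a c d → :- (a :* (c :* d)) :- d :* :- (a :* c) := (a :* c :* d) :- (a :* c :* d)) refl a c (c ^ (q ∸ 1)) ⟩
      (a * c * c ^ (q ∸ 1)) - (a * c * c ^ (q ∸ 1))    ≈⟨ -‿inverseʳ _ ⟩
      0#                                                ∎

  -- Wilson's theorem for 𝔽: the nonzero elements are the roots of X ^ (q - 1) - 1, so their
  -- product is (-1) ^ (q - 1) times that polynomial's value at 0.
  wilson : ∏ (enum (𝔽? ∖ 0#)) id ≈ - 1#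
  wilson = begin
    ∏ 𝔽* id                               ≈⟨ sym (trans (*-congʳ (𝔽-^[q∸1] -1≉0 (𝔽-neg 𝔽-1#))) (*-identityˡ _)) ⟩
    (- 1#) ^ (q ∸ 1) * ∏ 𝔽* id            ≈⟨ *-congʳ (sym (trans (∏-const 𝔽* (- 1#)) (^-congʳ (- 1#) (|𝔽∖a|≡q∸1 𝔽-0#)))) ⟩
    ∏ 𝔽* (λ _ → - 1#) * ∏ 𝔽* id           ≈⟨ sym (∏.fold-∙ 𝔽* (λ _ → - 1#) id) ⟩
    ∏ 𝔽* (λ r → - 1# * r)                 ≈⟨ ∏.fold-cong 𝔽* (λ r → trans (-1*x≈-x r) (sym (+-identityˡ _))) ⟩
    ∏ 𝔽* (λ r → 0# - r)                   ≡⟨ ≡.sym (prodList≡∏ 𝔽* _) ⟩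
    Defs.prodList K 𝔽* (λ r → 0# - r)     ≈⟨ sym (monic-factorisation X^[q∸1]-1 𝔽* (|𝔽∖a|≡q∸1 𝔽-0#) (enum-unique (𝔽? ∖ 0#)) roots-vanish 0#) ⟩
    0# ^ (q ∸ 1) - 1#                     ≈⟨ trans (+-congʳ 0^[q∸1]≈0) (+-identityˡ _) ⟩
    - 1#                                  ∎
    where
    𝔽* : List Carrier
    𝔽* = enum (𝔽? ∖ 0#)
    q∸1≥1 : 1 ≤ q ∸ 1
    q∸1≥1 = ℕ.≤-pred (≡.subst (2 ≤_) q≡1+[q∸1] q≥2)
    0^[q∸1]≈0 : 0# ^ (q ∸ 1) ≈ 0#
    0^[q∸1]≈0 = trans (^-congʳ 0# (≡.sym (ℕ.m+[n∸m]≡n q∸1≥1))) (zeroˡ _)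
    X^[q∸1]-1 : LeadingTerm 1# (q ∸ 1) (λ Y → Y ^ (q ∸ 1) - 1#)
    X^[q∸1]-1 = leadingTerm-+degreeBelow (leadingTerm-X^ (q ∸ 1)) (degreeBelow-const (- 1#) q∸1≥1)
    roots-vanish : ∀ {r} → r ∈ 𝔽* → r ^ (q ∸ 1) - 1# ≈ 0#
    roots-vanish r∈ with 𝔽r , r≉0 ← ∈-enum⁻ (𝔽? ∖ 0#) 𝔽∖-resp r∈ = x≈y⇒x-y≈0 (𝔽-^[q∸1] r≉0 𝔽r)

  ∏𝔽∖ : Carrier → Carrier → Carrier
  ∏𝔽∖ a y = ∏ (enum (𝔽? ∖ a)) (λ b → y + b)

  ∏𝔽∖-cong : ∀ {a a′ y y′} → a ≈ a′ → y ≈ y′ → ∏𝔽∖ a y ≈ ∏𝔽∖ a′ y′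
  ∏𝔽∖-cong {a} {a′} {y} {y′} a≈a′ y≈y′ =
    trans (∏.fold-enum-≐ (𝔽? ∖ a) (𝔽? ∖ a′) (λ (𝔽b , b≉a) → 𝔽b , λ b≈a′ → b≉a (trans b≈a′ (sym a≈a′)))
                                              (λ (𝔽b , b≉a′) → 𝔽b , λ b≈a → b≉a′ (trans b≈a a≈a′)) (λ b → y + b))
          (∏.fold-cong (enum (𝔽? ∖ a′)) (λ b → +-congʳ y≈y′))

  ∏-𝔽 : ∀ y → ∏ 𝔽-elements (λ b → y + b) ≈ y ^ q - y
  ∏-𝔽 y = begin
    ∏ 𝔽-elements (λ b → y + b)          ≈⟨ ∏.fold-cong 𝔽-elements (λ b → +-congˡ (sym (*-identityʳ b))) ⟩
    ∏ 𝔽-elements (λ b → y + b * 1#)     ≈⟨ ∏-𝔽-line 1≉0 y ⟩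
    y ^ q - 1# ^ (q ∸ 1) * y            ≈⟨ +-congˡ (-‿cong (trans (*-congʳ (1^n≈1 (q ∸ 1))) (*-identityˡ y))) ⟩
    y ^ q - y                           ∎

  -- ∑ₐ ∏_{b ≠ a} (y + b) is the derivative of y ^ q - y, namely -1: it has degree < q and
  -- equals -1 at the q points y = -a by Wilson's theorem.
  ∑∏𝔽∖≈-1 : ∀ y → ∑ 𝔽-elements (λ a → ∏𝔽∖ a y) ≈ - 1#
  ∑∏𝔽∖≈-1 y = x-y≈0⇒x≈y (trans (+-congˡ (-‿involutive 1#))
    (degreeBelow-vanishes S+1<q roots (ℕ.≤-reflexive (≡.sym |roots|≡q)) roots-unique roots-vanish y))
    where
    S : Carrier → Carrier
    S y = ∑ 𝔽-elements (λ a → ∏𝔽∖ a y)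
    S-cong : ∀ {y y′} → y ≈ y′ → S y ≈ S y′
    S-cong y≈y′ = ∑.fold-cong 𝔽-elements (λ a → ∏𝔽∖-cong refl y≈y′)
    ∑-degreeBelow : ∀ {d} xs (F : Carrier → Carrier → Carrier) → (∀ {a} → a ∈ xs → DegreeBelow d (F a)) →
                    DegreeBelow d (λ y → ∑ xs (λ a → F a y))
    ∑-degreeBelow []       F F<d = degreeBelow-0#
    ∑-degreeBelow (a ∷ xs) F F<d = degreeBelow-+ (F<d (here refl)) (∑-degreeBelow xs F (F<d ∘ there))
    ∏𝔽∖<q : ∀ {a} → 𝔽 a → DegreeBelow q (∏𝔽∖ a)
    ∏𝔽∖<q {a} 𝔽a = degreeBelow-mono (ℕ.≤-reflexive (≡.sym q≡1+[q∸1])) (leadingTerm⇒degreeBelow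
      (leadingTerm-≡ (|𝔽∖a|≡q∸1 𝔽a) (leadingTerm-cong refl (λ y → reflexive (prodList≡∏ (enum (𝔽? ∖ a)) (λ b → y + b)))
        (leadingTerm-∏ (enum (𝔽? ∖ a)) id))))
    S+1<q : DegreeBelow q (λ y → S y + 1#)
    S+1<q = degreeBelow-+ (∑-degreeBelow 𝔽-elements ∏𝔽∖ (λ a∈ → ∏𝔽∖<q (∈-enum⁻ 𝔽? 𝔽-resp a∈))) (degreeBelow-const 1# (ℕ.≤-trans (s≤s z≤n) q≥2))
    S[-a]≈-1 : ∀ {a} → 𝔽 a → S (- a) ≈ - 1#
    S[-a]≈-1 {a} 𝔽a = begin
      S (- a)               ≈⟨ ∑-enum-single 𝔽? 𝔽-resp 𝔽a (λ a′ → ∏𝔽∖ a′ (- a)) (λ a≈a′ → ∏𝔽∖-cong a≈a′ refl) other-terms-vanish ⟩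
      ∏𝔽∖ a (- a)           ≈⟨ ∏.fold-bijection (𝔽? ∖ a) (𝔽? ∖ 0#) 𝔽∖-resp 𝔽∖-resp translation id id ⟩
      ∏ (enum (𝔽? ∖ 0#)) id ≈⟨ wilson ⟩
      - 1#                  ∎
      where
      other-terms-vanish : ∀ {a′} → 𝔽 a′ → a′ ≉ a → ∏𝔽∖ a′ (- a) ≈ 0#
      other-terms-vanish 𝔽a′ a′≉a = ∏-≈0 (enum (𝔽? ∖ _)) (λ b → - a + b) +-congˡ
        (∈-enum⁺ (𝔽? ∖ _) 𝔽∖-resp (𝔽a , λ a≈a′ → a′≉a (sym a≈a′))) (-‿inverseˡ a)
      translation : BijectionOn (𝔽 ∩ ∁ (_≈ a)) (𝔽 ∩ ∁ (_≈ 0#)) (- a +_)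
      translation = record
        { cong       = +-congˡ
        ; maps       = λ {b} (𝔽b , b≉a) → 𝔽-+ (𝔽-neg 𝔽a) 𝔽b , λ -a+b≈0 →
                         b≉a (trans (solve 2 (λ b a → b := (:- a :+ b) :+ a) refl b a) (trans (+-congʳ -a+b≈0) (+-identityˡ a)))
        ; injective  = λ _ _ e → +-cancelˡ (- a) _ _ e
        ; surjective = λ {y} (𝔽y , y≉0) → y + a , (𝔽-+ 𝔽y 𝔽a , λ y+a≈a → y≉0 (+-cancelʳ a y 0# (trans y+a≈a (sym (+-identityˡ a))))) ,
                         solve 2 (λ y a → y := :- a :+ (y :+ a)) refl y a
        }
    roots : List Carrier
    roots = map -_ 𝔽-elements
    |roots|≡q : length roots ≡ q
    |roots|≡q = ≡.trans (List.length-map _ 𝔽-elements) |𝔽|≡q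
    roots-unique : Unique roots
    roots-unique = map-unique -_ (enum-unique 𝔽?) λ _ _ → -‿injective
    roots-vanish : ∀ {r} → r ∈ roots → S r + 1# ≈ 0#
    roots-vanish r∈ with a , a∈ , r≈-a ← ∈.∈-map⁻ setoid setoid r∈ =
      trans (+-congʳ (trans (S-cong r≈-a) (S[-a]≈-1 (∈-enum⁻ 𝔽? 𝔽-resp a∈)))) (-‿inverseˡ 1#)

  ∑-𝔽-inverse : ∀ y → y ^ q - y ≉ 0# → ∑ 𝔽-elements (λ a → (y + a) ⁻¹) ≈ - (y ^ q - y) ⁻¹
  ∑-𝔽-inverse y P≉0 = *-cancelˡ P≉0 (begin
    P * ∑ 𝔽-elements (λ a → (y + a) ⁻¹)    ≈⟨ *-distribˡ-∑ 𝔽-elements P _ ⟩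
    ∑ 𝔽-elements (λ a → P * (y + a) ⁻¹)    ≈⟨ ∑.fold-cong-∈ 𝔽-elements (λ a∈ → P/[y+a]≈∏𝔽∖ (∈-enum⁻ 𝔽? 𝔽-resp a∈)) ⟩
    ∑ 𝔽-elements (λ a → ∏𝔽∖ a y)            ≈⟨ ∑∏𝔽∖≈-1 y ⟩
    - 1#                                    ≈⟨ -‿cong (sym (⁻¹-inverse P P≉0)) ⟩
    - (P * P ⁻¹)                            ≈⟨ -‿distribʳ-* P (P ⁻¹) ⟩
    P * - P ⁻¹                              ∎)
    where
    P : Carrier
    P = y ^ q - y
    y+a≉0 : ∀ {a} → 𝔽 a → y + a ≉ 0#
    y+a≉0 {a} 𝔽a y+a≈0 = P≉0 (x≈y⇒x-y≈0 (𝔽-resp (sym y≈-a) (𝔽-neg 𝔽a)))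
      where
      y≈-a : y ≈ - a
      y≈-a = trans (solve 2 (λ y a → y := (y :+ a) :- a) refl y a) (trans (+-congʳ y+a≈0) (+-identityˡ _))
    P/[y+a]≈∏𝔽∖ : ∀ {a} → 𝔽 a → P * (y + a) ⁻¹ ≈ ∏𝔽∖ a y
    P/[y+a]≈∏𝔽∖ {a} 𝔽a = begin
      P * (y + a) ⁻¹                                ≈⟨ *-congʳ (sym (∏-𝔽 y)) ⟩
      ∏ 𝔽-elements (λ b → y + b) * (y + a) ⁻¹       ≈⟨ *-congʳ (∏.fold-enum-∖ 𝔽? 𝔽-resp 𝔽a (λ b → y + b) +-congˡ) ⟩
      ((y + a) * ∏𝔽∖ a y) * (y + a) ⁻¹              ≈⟨ solve 3 (λ u v w → (u :* v) :* w := (u :* w) :* v) refl _ _ _ ⟩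
      ((y + a) * (y + a) ⁻¹) * ∏𝔽∖ a y              ≈⟨ trans (*-congʳ (⁻¹-inverse _ (y+a≉0 𝔽a))) (*-identityˡ _) ⟩
      ∏𝔽∖ a y                                       ∎

  invPow : Carrier → Carrier
  invPow x = (x ^ (q ∸ 1)) ⁻¹

  invPow-cong : ∀ {x y} → x ≉ 0# → x ≈ y → invPow x ≈ invPow y
  invPow-cong x≉0 x≈y = ⁻¹-cong (^-≉0 (q ∸ 1) x≉0) (^-congˡ (q ∸ 1) x≈y)

  invPow-distrib-* : ∀ {x y} → x ≉ 0# → y ≉ 0# → invPow (x * y) ≈ invPow x * invPow y
  invPow-distrib-* {x} {y} x≉0 y≉0 =
    trans (⁻¹-cong (^-≉0 (q ∸ 1) (*-≉0 x≉0 y≉0)) (^-distrib-* x y (q ∸ 1))) (⁻¹-distrib-* (^-≉0 (q ∸ 1) x≉0) (^-≉0 (q ∸ 1) y≉0))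

  -- With P = z ^ q - z, each t = z + a satisfies t ^ q = t + P, so invPow t = 1 - P / (t + P);
  -- summing over a ∈ 𝔽 and using ∑-𝔽-inverse at y = z + P (where y ^ q - y = P ^ q) gives P / P ^ q.
  ∑-𝔽-invPow : ∀ z → z ^ q - z ≉ 0# → ∑ 𝔽-elements (λ a → invPow (z + a)) ≈ invPow (z ^ q - z)
  ∑-𝔽-invPow z P≉0 = begin
    ∑ 𝔽-elements (λ a → invPow (z + a))                                    ≈⟨ ∑.fold-cong-∈ 𝔽-elements (λ a∈ → invPow[t]≈ (∈-enum⁻ 𝔽? 𝔽-resp a∈)) ⟩
    ∑ 𝔽-elements (λ a → 1# + - (P * (y + a) ⁻¹))                          ≈⟨ ∑.fold-∙ 𝔽-elements (λ _ → 1#) (λ a → - (P * (y + a) ⁻¹)) ⟩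
    ∑ 𝔽-elements (λ _ → 1#) + ∑ 𝔽-elements (λ a → - (P * (y + a) ⁻¹))     ≈⟨ +-cong ∑1≈0 (sym (-‿distrib-∑ 𝔽-elements _)) ⟩
    0# + - ∑ 𝔽-elements (λ a → P * (y + a) ⁻¹)                            ≈⟨ +-identityˡ _ ⟩
    - ∑ 𝔽-elements (λ a → P * (y + a) ⁻¹)                                 ≈⟨ -‿cong (sym (*-distribˡ-∑ 𝔽-elements P _)) ⟩
    - (P * ∑ 𝔽-elements (λ a → (y + a) ⁻¹))                               ≈⟨ -‿cong (*-congˡ (∑-𝔽-inverse y Py≉0)) ⟩
    - (P * - (y ^ q - y) ⁻¹)                                              ≈⟨ trans (-‿cong (sym (-‿distribʳ-* _ _))) (-‿involutive _) ⟩
    P * (y ^ q - y) ⁻¹                                                    ≈⟨ *-congˡ (⁻¹-cong Py≉0 y^q-y≈P^q) ⟩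
    P * (P ^ q) ⁻¹                                                        ≈⟨ *-congˡ (trans (⁻¹-cong (^-≉0 q P≉0) (x^q≈x*x^[q∸1] P)) (⁻¹-distrib-* P≉0 (^-≉0 (q ∸ 1) P≉0))) ⟩
    P * (P ⁻¹ * invPow P)                                                 ≈⟨ trans (sym (*-assoc _ _ _)) (trans (*-congʳ (⁻¹-inverse P P≉0)) (*-identityˡ _)) ⟩
    invPow P                                                              ∎
    where
    P : Carrier
    P = z ^ q - z
    y : Carrier
    y = z + P
    ∑1≈0 : ∑ 𝔽-elements (λ _ → 1#) ≈ 0#
    ∑1≈0 = trans (∑-const 𝔽-elements 1#) (trans (*-congʳ (trans (reflexive (≡.cong (_· 1#) |𝔽|≡q)) q·1≈0)) (zeroˡ _))
    y^q-y≈P^q : y ^ q - y ≈ P ^ q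
    y^q-y≈P^q = trans (+-congʳ (frobenius z P)) (solve 3 (λ A B z → (A :+ B) :- (z :+ (A :- z)) := B) refl (z ^ q) (P ^ q) z)
    Py≉0 : y ^ q - y ≉ 0#
    Py≉0 e = ^-≉0 q P≉0 (trans (sym y^q-y≈P^q) e)
    invPow[t]≈ : ∀ {a} → 𝔽 a → invPow (z + a) ≈ 1# + - (P * (y + a) ⁻¹)
    invPow[t]≈ {a} 𝔽a = begin
      invPow t                                  ≈⟨ sym (⁻¹-unique (^-≉0 (q ∸ 1) t≉0) tᵠ⁻¹·t/[t+P]≈1) ⟩
      t * (t + P) ⁻¹                            ≈⟨ solve 3 (λ t P w → t :* w := (t :+ P) :* w :- P :* w) refl t P ((t + P) ⁻¹) ⟩
      (t + P) * (t + P) ⁻¹ - P * (t + P) ⁻¹     ≈⟨ +-cong (⁻¹-inverse _ t+P≉0) (-‿cong (*-congˡ (⁻¹-cong t+P≉0 t+P≈y+a))) ⟩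
      1# + - (P * (y + a) ⁻¹)                   ∎
      where
      t : Carrier
      t = z + a
      tᵠ≈t+P : t ^ q ≈ t + P
      tᵠ≈t+P = trans (frobenius z a) (trans (+-congˡ 𝔽a) (solve 3 (λ A z a → A :+ a := (z :+ a) :+ (A :- z)) refl (z ^ q) z a))
      t≉0 : t ≉ 0#
      t≉0 t≈0 = P≉0 (x≈y⇒x-y≈0 (𝔽-resp (sym z≈-a) (𝔽-neg 𝔽a)))
        where
        z≈-a : z ≈ - a
        z≈-a = trans (solve 2 (λ z a → z := (z :+ a) :- a) refl z a) (trans (+-congʳ t≈0) (+-identityˡ _))
      t+P≉0 : t + P ≉ 0#
      t+P≉0 e = ^-≉0 q t≉0 (trans tᵠ≈t+P e)
      t+P≈y+a : t + P ≈ y + a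
      t+P≈y+a = solve 3 (λ z a P → (z :+ a) :+ P := (z :+ P) :+ a) refl z a P
      tᵠ⁻¹·t/[t+P]≈1 : t ^ (q ∸ 1) * (t * (t + P) ⁻¹) ≈ 1#
      tᵠ⁻¹·t/[t+P]≈1 = begin
        t ^ (q ∸ 1) * (t * (t + P) ⁻¹)   ≈⟨ solve 3 (λ u t w → u :* (t :* w) := (t :* u) :* w) refl _ t _ ⟩
        (t * t ^ (q ∸ 1)) * (t + P) ⁻¹   ≈⟨ *-congʳ (trans (sym (x^q≈x*x^[q∸1] t)) tᵠ≈t+P) ⟩
        (t + P) * (t + P) ⁻¹             ≈⟨ ⁻¹-inverse _ t+P≉0 ⟩
        1#                               ∎

  ∑-𝔽-line-invPow : ∀ {c} Y → c ≉ 0# → Y ^ q - c ^ (q ∸ 1) * Y ≉ 0# →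
                    ∑ 𝔽-elements (λ a → invPow (Y + a * c)) ≈ c ^ ((q ∸ 1) ℕ.* (q ∸ 1)) * invPow (Y ^ q - c ^ (q ∸ 1) * Y)
  ∑-𝔽-line-invPow {c} Y c≉0 Q≉0 = begin
    ∑ 𝔽-elements (λ a → invPow (Y + a * c))                  ≈⟨ ∑.fold-cong-∈ 𝔽-elements (λ a∈ → rescale (∈-enum⁻ 𝔽? 𝔽-resp a∈)) ⟩
    ∑ 𝔽-elements (λ a → u ⁻¹ * invPow (z + a))               ≈⟨ sym (*-distribˡ-∑ 𝔽-elements (u ⁻¹) _) ⟩
    u ⁻¹ * ∑ 𝔽-elements (λ a → invPow (z + a))               ≈⟨ *-congˡ (∑-𝔽-invPow z zᵠ-z≉0) ⟩
    u ⁻¹ * invPow (z ^ q - z)                                ≈⟨ *-congʳ (sym cᴺ·invPow[cᵠ]≈u⁻¹) ⟩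
    (c ^ N * invPow (c ^ q)) * invPow (z ^ q - z)            ≈⟨ *-assoc _ _ _ ⟩
    c ^ N * (invPow (c ^ q) * invPow (z ^ q - z))            ≈⟨ *-congˡ (sym (trans (invPow-cong Q≉0 Q≈cᵠ[zᵠ-z]) (invPow-distrib-* (^-≉0 q c≉0) zᵠ-z≉0))) ⟩
    c ^ N * invPow (Y ^ q - c ^ (q ∸ 1) * Y)                 ∎
    where
    N : ℕ
    N = (q ∸ 1) ℕ.* (q ∸ 1)
    u : Carrier
    u = c ^ (q ∸ 1)
    u≉0 : u ≉ 0#
    u≉0 = ^-≉0 (q ∸ 1) c≉0
    z : Carrier
    z = Y * c ⁻¹
    cz≈Y : c * z ≈ Y
    cz≈Y = trans (solve 3 (λ c Y i → c :* (Y :* i) := Y :* (c :* i)) refl c Y (c ⁻¹)) (trans (*-congˡ (⁻¹-inverse c c≉0)) (*-identityʳ Y))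
    Q≈cᵠ[zᵠ-z] : Y ^ q - u * Y ≈ c ^ q * (z ^ q - z)
    Q≈cᵠ[zᵠ-z] = begin
      Y ^ q - u * Y                 ≈⟨ +-cong (^-congˡ q (sym cz≈Y)) (-‿cong (*-congˡ (sym cz≈Y))) ⟩
      (c * z) ^ q - u * (c * z)     ≈⟨ +-cong (^-distrib-* c z q) (-‿cong (trans (solve 3 (λ u c z → u :* (c :* z) := (c :* u) :* z) refl u c z) (*-congʳ (sym (x^q≈x*x^[q∸1] c))))) ⟩
      c ^ q * z ^ q - c ^ q * z     ≈⟨ solve 3 (λ a b z → a :* b :- a :* z := a :* (b :- z)) refl (c ^ q) (z ^ q) z ⟩
      c ^ q * (z ^ q - z)           ∎
    zᵠ-z≉0 : z ^ q - z ≉ 0#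
    zᵠ-z≉0 e = Q≉0 (trans Q≈cᵠ[zᵠ-z] (trans (*-congˡ e) (zeroʳ _)))
    rescale : ∀ {a} → 𝔽 a → invPow (Y + a * c) ≈ u ⁻¹ * invPow (z + a)
    rescale {a} 𝔽a = begin
      invPow (Y + a * c)     ≈⟨ invPow-cong (λ e → *-≉0 c≉0 z+a≉0 (trans c[z+a]≈Y+ac e)) (sym c[z+a]≈Y+ac) ⟩
      invPow (c * (z + a))   ≈⟨ invPow-distrib-* c≉0 z+a≉0 ⟩
      u ⁻¹ * invPow (z + a)  ∎
      where
      c[z+a]≈Y+ac : c * (z + a) ≈ Y + a * c
      c[z+a]≈Y+ac = trans (distribˡ c z a) (+-cong cz≈Y (*-comm c a))
      z+a≉0 : z + a ≉ 0#
      z+a≉0 e = zᵠ-z≉0 (x≈y⇒x-y≈0 (𝔽-resp (sym z≈-a) (𝔽-neg 𝔽a)))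
        where
        z≈-a : z ≈ - a
        z≈-a = trans (solve 2 (λ z a → z := (z :+ a) :- a) refl z a) (trans (+-congʳ e) (+-identityˡ _))
    cᴺ·invPow[cᵠ]≈u⁻¹ : c ^ N * invPow (c ^ q) ≈ u ⁻¹
    cᴺ·invPow[cᵠ]≈u⁻¹ = begin
      c ^ N * invPow (c ^ q)        ≈⟨ *-cong (sym (^-assocʳ c (q ∸ 1) (q ∸ 1))) (invPow-cong (^-≉0 q c≉0) (x^q≈x*x^[q∸1] c)) ⟩
      u ^ (q ∸ 1) * invPow (c * u)  ≈⟨ *-congˡ (invPow-distrib-* c≉0 u≉0) ⟩
      u ^ (q ∸ 1) * (u ⁻¹ * invPow u) ≈⟨ solve 3 (λ a b w → a :* (b :* w) := b :* (a :* w)) refl _ _ _ ⟩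
      u ⁻¹ * (u ^ (q ∸ 1) * invPow u) ≈⟨ *-congˡ (⁻¹-inverse _ (^-≉0 (q ∸ 1) u≉0)) ⟩
      u ⁻¹ * 1#                     ≈⟨ *-identityʳ _ ⟩
      u ⁻¹                          ∎

module FiniteSums {c ℓ : Level} (K : FiniteField c ℓ) where

  open FieldArithmetic K
  open import Algebra.Properties.CommutativeMonoid.Sum +-commutativeMonoid using (sum; sum-cong-≋; sum-remove; ∑-distrib-+)
  open import Algebra.Properties.Semiring.Sum semiring using (*-distribˡ-sum)

  Σ[<_]_ : (k : ℕ) → (Fin k → Carrier) → Carrier
  Σ[<_]_ = Defs.Σ[<_]_ K

  Σ≡sum : ∀ k f → Σ[< k ] f ≡ sum f
  Σ≡sum zero    f = ≡.refl
  Σ≡sum (suc k) f = ≡.cong (f zero +_) (Σ≡sum k (f ∘ suc))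

  private
    via-sum : ∀ {a b a′ b′} → a ≡ a′ → b ≡ b′ → a′ ≈ b′ → a ≈ b
    via-sum ≡.refl ≡.refl a′≈b′ = a′≈b′

  Σ-cong : ∀ k {f g : Fin k → Carrier} → (∀ i → f i ≈ g i) → Σ[< k ] f ≈ Σ[< k ] g
  Σ-cong k {f} {g} f≈g = via-sum (Σ≡sum k f) (Σ≡sum k g) (sum-cong-≋ f≈g)

  Σ-distrib-+ : ∀ k (f g : Fin k → Carrier) → Σ[< k ] (λ i → f i + g i) ≈ Σ[< k ] f + Σ[< k ] g
  Σ-distrib-+ k f g = via-sum (Σ≡sum k _) (≡.cong₂ _+_ (Σ≡sum k f) (Σ≡sum k g)) (∑-distrib-+ f g)

  *-distribˡ-Σ : ∀ k a (f : Fin k → Carrier) → a * Σ[< k ] f ≈ Σ[< k ] (λ i → a * f i)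
  *-distribˡ-Σ k a f = via-sum (≡.cong (a *_) (Σ≡sum k f)) (Σ≡sum k _) (*-distribˡ-sum a f)

  Σ-remove : ∀ k (j : Fin (suc k)) (f : Fin (suc k) → Carrier) → Σ[< suc k ] f ≈ f j + Σ[< k ] (f ∘ punchIn j)
  Σ-remove k j f = via-sum (Σ≡sum (suc k) f) (≡.cong (f j +_) (Σ≡sum k (f ∘ punchIn j))) (sum-remove f)

  Σ-0# : ∀ k (f : Fin k → Carrier) → (∀ i → f i ≈ 0#) → Σ[< k ] f ≈ 0#
  Σ-0# zero    f f≈0 = refl
  Σ-0# (suc k) f f≈0 = trans (+-cong (f≈0 zero) (Σ-0# k (f ∘ suc) (f≈0 ∘ suc))) (+-identityˡ 0#)

module Spans {c ℓ : Level} (K : FiniteField c ℓ) (q n : ℕ)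
             (q-primePower : IsPrimePower q) (card≡qⁿ : Defs.card K ≡ q ℕ.^ n) where

  open FieldArithmetic K
  open Enumeration K
  open Sums K
  open FiniteSums K
  open PolynomialFunctions K
  open Subfield K q n q-primePower card≡qⁿ
  open SubfieldSums K q n q-primePower card≡qⁿ using (∏-𝔽-line)

  Span : (k : ℕ) → (Fin k → Carrier) → Pred Carrier (c ⊔ ℓ)
  Span zero    w x = Lift c (x ≈ 0#)
  Span (suc k) w x = Any (λ a → 𝔽 a × Span k (tail w) (x - a * head w)) elements

  Span? : ∀ k w → Decidable (Span k w)
  Span? zero    w x with x ≟ 0#
  ... | yes x≈0 = yes (lift x≈0)
  ... | no x≉0  = no (x≉0 ∘ lower)
  Span? (suc k) w x = Any.any? (λ a → 𝔽? a ×-dec Span? k (tail w) (x - a * head w)) elements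

  Span-resp : ∀ k w → Span k w Respects _≈_
  Span-resp zero    w x≈y (lift x≈0) = lift (trans (sym x≈y) x≈0)
  Span-resp (suc k) w x≈y x∈ = Any.map (λ (𝔽a , rest∈) → 𝔽a , Span-resp k (tail w) (+-congʳ x≈y) rest∈) x∈

  Span-intro : ∀ k w {x} a → 𝔽 a → Span k (tail w) (x - a * head w) → Span (suc k) w x
  Span-intro k w a 𝔽a rest∈ = Any.map (λ a≈b → 𝔽-resp a≈b 𝔽a , Span-resp k (tail w) (+-congˡ (-‿cong (*-congʳ a≈b))) rest∈) (complete a)

  Span-0# : ∀ k w → Span k w 0#
  Span-0# zero    w = lift refl
  Span-0# (suc k) w = Span-intro k w 0# 𝔽-0# (Span-resp k (tail w) 0≈0-0w (Span-0# k (tail w)))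
    where
    0≈0-0w : 0# ≈ 0# - 0# * head w
    0≈0-0w = sym (trans (+-congˡ (trans (-‿cong (zeroˡ _)) -0#≈0#)) (+-identityʳ 0#))

  Span-+ : ∀ k w {x y} → Span k w x → Span k w y → Span k w (x + y)
  Span-+ zero    w (lift x≈0) (lift y≈0) = lift (trans (+-cong x≈0 y≈0) (+-identityʳ 0#))
  Span-+ (suc k) w {x} {y} x∈ y∈ =
    let a , 𝔽a , x′∈ = Any.satisfied x∈
        b , 𝔽b , y′∈ = Any.satisfied y∈
    in Span-intro k w (a + b) (𝔽-+ 𝔽a 𝔽b) (Span-resp k (tail w)
         (solve 5 (λ x y a b w → (x :- a :* w) :+ (y :- b :* w) := (x :+ y) :- (a :+ b) :* w) refl x y a b (head w))
         (Span-+ k (tail w) x′∈ y′∈))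

  Span-scale : ∀ k w {a x} → 𝔽 a → Span k w x → Span k w (a * x)
  Span-scale zero    w {a} 𝔽a (lift x≈0) = lift (trans (*-congˡ x≈0) (zeroʳ a))
  Span-scale (suc k) w {a} {x} 𝔽a x∈ =
    let b , 𝔽b , x′∈ = Any.satisfied x∈
    in Span-intro k w (a * b) (𝔽-* 𝔽a 𝔽b) (Span-resp k (tail w)
         (solve 4 (λ a x b w → a :* (x :- b :* w) := a :* x :- (a :* b) :* w) refl a x b (head w))
         (Span-scale k (tail w) 𝔽a x′∈))

  Span-neg : ∀ k w {x} → Span k w x → Span k w (- x)
  Span-neg k w {x} x∈ = Span-resp k w (-1*x≈-x x) (Span-scale k w (𝔽-neg 𝔽-1#) x∈)

  Span-generator : ∀ k w (i : Fin k) → Span k w (w i)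
  Span-generator (suc k) w zero    = Span-intro k w 1# 𝔽-1# (Span-resp k (tail w) 0≈w-1w (Span-0# k (tail w)))
    where
    0≈w-1w : 0# ≈ head w - 1# * head w
    0≈w-1w = sym (trans (+-congˡ (-‿cong (*-identityˡ _))) (-‿inverseʳ _))
  Span-generator (suc k) w (suc i) = Span-intro k w 0# 𝔽-0# (Span-resp k (tail w) wᵢ≈wᵢ-0w (Span-generator k (tail w) i))
    where
    wᵢ≈wᵢ-0w : w (suc i) ≈ w (suc i) - 0# * head w
    wᵢ≈wᵢ-0w = sym (trans (+-congˡ (trans (-‿cong (zeroˡ _)) -0#≈0#)) (+-identityʳ _))

  Span-combination⁺ : ∀ k w (a : Fin k → Carrier) → (∀ i → 𝔽 (a i)) → Span k w (Σ[< k ] λ i → a i * w i)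
  Span-combination⁺ zero    w a 𝔽a = lift refl
  Span-combination⁺ (suc k) w a 𝔽a = Span-intro k w (a zero) (𝔽a zero)
    (Span-resp k (tail w) (solve 2 (λ u v → v := (u :+ v) :- u) refl _ _) (Span-combination⁺ k (tail w) (tail a) (𝔽a ∘ suc)))

  Span-combination⁻ : ∀ k w {x} → Span k w x → Σ (Fin k → Carrier) λ a → (∀ i → 𝔽 (a i)) × x ≈ (Σ[< k ] λ i → a i * w i)
  Span-combination⁻ zero    w (lift x≈0) = (λ ()) , (λ ()) , x≈0
  Span-combination⁻ (suc k) w {x} x∈ =
    let b , 𝔽b , x′∈    = Any.satisfied x∈
        a , 𝔽a , x′≈Σ  = Span-combination⁻ k (tail w) x′∈
    in b ∷ᵥ a , 𝔽-∷ 𝔽b 𝔽a , trans (solve 3 (λ x b w → x := b :* w :+ (x :- b :* w)) refl x b (head w)) (+-congˡ x′≈Σ)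
    where
    𝔽-∷ : ∀ {b} {a : Fin k → Carrier} → 𝔽 b → (∀ i → 𝔽 (a i)) → ∀ i → 𝔽 ((b ∷ᵥ a) i)
    𝔽-∷ 𝔽b 𝔽a zero    = 𝔽b
    𝔽-∷ 𝔽b 𝔽a (suc i) = 𝔽a i

  linear-vanishes-on-Span : ∀ k w (f : Carrier → Carrier) → Congruent _≈_ _≈_ f → (∀ x y → f (x + y) ≈ f x + f y) →
                            (∀ {a} x → 𝔽 a → f (a * x) ≈ a * f x) → (∀ i → f (w i) ≈ 0#) → ∀ {x} → Span k w x → f x ≈ 0#
  linear-vanishes-on-Span k w f f-cong f-+ f-scale f[w]≈0 x∈ =
    let a , 𝔽a , x≈Σ = Span-combination⁻ k w x∈ in trans (f-cong x≈Σ) (f[Σ]≈0 k w a 𝔽a f[w]≈0)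
    where
    f[Σ]≈0 : ∀ k (w a : Fin k → Carrier) → (∀ i → 𝔽 (a i)) → (∀ i → f (w i) ≈ 0#) → f (Σ[< k ] λ i → a i * w i) ≈ 0#
    f[Σ]≈0 zero    w a 𝔽a f[w]≈0 = trans (f-cong (sym (zeroˡ 0#))) (trans (f-scale 0# 𝔽-0#) (zeroˡ _))
    f[Σ]≈0 (suc k) w a 𝔽a f[w]≈0 = trans (f-+ _ _) (trans (+-cong
      (trans (f-scale (w zero) (𝔽a zero)) (trans (*-congˡ (f[w]≈0 zero)) (zeroʳ _)))
      (f[Σ]≈0 k (tail w) (tail a) (𝔽a ∘ suc) (f[w]≈0 ∘ suc))) (+-identityʳ 0#))

  LinearlyIndependent : (k : ℕ) → (Fin k → Carrier) → Set (c ⊔ ℓ)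
  LinearlyIndependent k w = ∀ (a : Fin k → Carrier) → (∀ i → 𝔽 (a i)) → (Σ[< k ] λ i → a i * w i) ≈ 0# → ∀ i → a i ≈ 0#

  independent-removeAt : ∀ {k w} → LinearlyIndependent (suc k) w → ∀ j → LinearlyIndependent k (w ∘ punchIn j)
  independent-removeAt {k} {w} independent j b 𝔽b Σ≈0 l =
    trans (reflexive (≡.sym (insertAt-punchIn b j 0# l))) (independent a 𝔽a Σa≈0 (punchIn j l))
    where
    a : Fin (suc k) → Carrier
    a = insertAt b j 0#
    𝔽a : ∀ i → 𝔽 (a i)
    𝔽a i with j ≟ᶠ i
    ... | yes ≡.refl = 𝔽-resp (reflexive (≡.sym (insertAt-lookup b j 0#))) 𝔽-0#
    ... | no j≢i     = 𝔽-resp (reflexive (≡.trans (≡.sym (insertAt-punchIn b j 0# (punchOut j≢i))) (≡.cong a (punchIn-punchOut j≢i))))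
                              (𝔽b (punchOut j≢i))
    Σa≈0 : (Σ[< suc k ] λ i → a i * w i) ≈ 0#
    Σa≈0 = begin
      (Σ[< suc k ] λ i → a i * w i)                             ≈⟨ Σ-remove k j (λ i → a i * w i) ⟩
      a j * w j + (Σ[< k ] λ l → a (punchIn j l) * w (punchIn j l)) ≈⟨ +-cong (trans (*-congʳ (reflexive (insertAt-lookup b j 0#))) (zeroˡ _))
                                                                             (Σ-cong k (λ l → *-congʳ (reflexive (insertAt-punchIn b j 0# l)))) ⟩
      0# + (Σ[< k ] λ l → b l * w (punchIn j l))                 ≈⟨ trans (+-identityˡ _) Σ≈0 ⟩
      0#                                                        ∎

  independent-tail : ∀ {k w} → LinearlyIndependent (suc k) w → LinearlyIndependent k (tail w)
  independent-tail {k} {w} independent = independent-removeAt {k} {w} independent zero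

  independent⇒head∉Span : ∀ {k w} → LinearlyIndependent (suc k) w → ¬ Span k (tail w) (head w)
  independent⇒head∉Span {k} {w} independent w₀∈ with b , 𝔽b , w₀≈Σ ← Span-combination⁻ k (tail w) w₀∈ =
    -1≉0 (independent (- 1# ∷ᵥ b) 𝔽a Σ≈0 zero)
    where
    𝔽a : ∀ i → 𝔽 ((- 1# ∷ᵥ b) i)
    𝔽a zero    = 𝔽-neg 𝔽-1#
    𝔽a (suc i) = 𝔽b i
    Σ≈0 : - 1# * head w + (Σ[< k ] λ i → b i * w (suc i)) ≈ 0#
    Σ≈0 = trans (+-cong (-1*x≈-x _) (sym w₀≈Σ)) (-‿inverseˡ _)

  independent-unique : ∀ {k w} → LinearlyIndependent (suc k) w → ∀ {e a e′ b} → Span k (tail w) e → 𝔽 a →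
                       Span k (tail w) e′ → 𝔽 b → e + a * head w ≈ e′ + b * head w → e ≈ e′ × a ≈ b
  independent-unique {k} {w} independent {e} {a} {e′} {b} e∈ 𝔽a e′∈ 𝔽b e+aw≈e′+bw with (a - b) ≟ 0#
  ... | yes a-b≈0 = e≈e′ , x-y≈0⇒x≈y a-b≈0
    where
    e≈e′ : e ≈ e′
    e≈e′ = begin
      e                           ≈⟨ solve 3 (λ e a w → e := (e :+ a :* w) :- a :* w) refl e a (head w) ⟩
      (e + a * head w) - a * head w ≈⟨ +-cong e+aw≈e′+bw (-‿cong (*-congʳ (x-y≈0⇒x≈y a-b≈0))) ⟩
      (e′ + b * head w) - b * head w ≈⟨ solve 3 (λ e a w → (e :+ a :* w) :- a :* w := e) refl e′ b (head w) ⟩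
      e′                          ∎
  ... | no a-b≉0  = ⊥-elim (independent⇒head∉Span {k} {w} independent (Span-resp k (tail w) [a-b]⁻¹[e′-e]≈w₀
                      (Span-scale k (tail w) (𝔽-⁻¹ a-b≉0 (𝔽-+ 𝔽a (𝔽-neg 𝔽b))) (Span-+ k (tail w) e′∈ (Span-neg k (tail w) e∈)))))
    where
    d : Carrier
    d = a - b
    dw≈e′-e : d * head w ≈ e′ - e
    dw≈e′-e = begin
      d * head w                                       ≈⟨ solve 5 (λ a b w e e′ → (a :- b) :* w := ((e :+ a :* w) :- (e′ :+ b :* w)) :+ (e′ :- e)) refl a b (head w) e e′ ⟩
      ((e + a * head w) - (e′ + b * head w)) + (e′ - e) ≈⟨ trans (+-congʳ (x≈y⇒x-y≈0 e+aw≈e′+bw)) (+-identityˡ _) ⟩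
      e′ - e                                           ∎
    [a-b]⁻¹[e′-e]≈w₀ : d ⁻¹ * (e′ - e) ≈ head w
    [a-b]⁻¹[e′-e]≈w₀ = begin
      d ⁻¹ * (e′ - e)     ≈⟨ *-congˡ (sym dw≈e′-e) ⟩
      d ⁻¹ * (d * head w) ≈⟨ sym (*-assoc _ _ _) ⟩
      (d ⁻¹ * d) * head w ≈⟨ *-congʳ (⁻¹-inverseˡ a-b≉0) ⟩
      1# * head w         ≈⟨ *-identityˡ _ ⟩
      head w              ∎

  spanElements : (k : ℕ) → (Fin k → Carrier) → List Carrier
  spanElements k w = enum (Span? k w)

  L : (k : ℕ) → (Fin k → Carrier) → Carrier → Carrier
  L k w y = ∏ (spanElements k w) (λ u → y + u)

  L-cong : ∀ k w {x y} → x ≈ y → L k w x ≈ L k w y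
  L-cong k w x≈y = ∏.fold-cong (spanElements k w) (λ u → +-congʳ x≈y)

  L-vanishes : ∀ k w {x} → Span k w x → L k w x ≈ 0#
  L-vanishes k w {x} x∈ = ∏-≈0 (spanElements k w) (λ u → x + u) +-congˡ (∈-enum⁺ (Span? k w) (Span-resp k w) (Span-neg k w x∈)) (-‿inverseʳ x)

  L-≉0 : ∀ k w {x} → ¬ Span k w x → L k w x ≉ 0#
  L-≉0 k w {x} x∉ = ∏-≉0 (spanElements k w) (λ u → x + u) λ {u} u∈ x+u≈0 →
    x∉ (Span-resp k w (-u≈x x+u≈0) (Span-neg k w (∈-enum⁻ (Span? k w) (Span-resp k w) u∈)))
    where
    -u≈x : ∀ {u} → x + u ≈ 0# → - u ≈ x
    -u≈x {u} x+u≈0 = sym (trans (solve 2 (λ x u → x := (x :+ u) :- u) refl x u) (trans (+-congʳ x+u≈0) (+-identityˡ _)))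

  Span₀≐≈0 : ∀ w → enum (Span? 0 w) ≡ enum (_≟ 0#)
  Span₀≐≈0 w = enum-≐ (Span? 0 w) (_≟ 0#) lower lift

  L₀≈id : ∀ w y → L 0 w y ≈ y
  L₀≈id w y = begin
    L 0 w y                          ≡⟨ ≡.cong (λ xs → ∏ xs (λ u → y + u)) (Span₀≐≈0 w) ⟩
    ∏ (enum (_≟ 0#)) (λ u → y + u)   ≈⟨ ∏.fold-enum-≈ 0# (λ u → y + u) +-congˡ ⟩
    y + 0#                           ≈⟨ +-identityʳ y ⟩
    y                                ∎

  |Span₀|≡1 : ∀ w → length (spanElements 0 w) ≡ 1
  |Span₀|≡1 w = ≡.trans (≡.sym (#≡length (spanElements 0 w))) (≡.trans (≡.cong # (Span₀≐≈0 w)) (#.fold-enum-≈ 0# (λ _ → 1) (λ _ → ≡.refl)))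

  Span-decomposition : ∀ {k w} → LinearlyIndependent (suc k) w →
                       ProductDecomposition (Span k (tail w)) 𝔽 (Span (suc k) w) (λ e a → e + a * head w)
  Span-decomposition {k} {w} independent = record
    { cong       = λ e≈e′ a≈a′ → +-cong e≈e′ (*-congʳ a≈a′)
    ; maps       = λ {e} {a} e∈ 𝔽a → Span-intro k w a 𝔽a (Span-resp k (tail w) (solve 3 (λ e a w → e := (e :+ a :* w) :- a :* w) refl e a (head w)) e∈)
    ; injective  = independent-unique {k} {w} independent
    ; surjective = λ {z} z∈ → let a , 𝔽a , z′∈ = Any.satisfied z∈ in
                     z - a * head w , a , z′∈ , 𝔽a , solve 3 (λ z a w → z := (z :- a :* w) :+ a :* w) refl z a (head w)
    }

  L-step : ∀ {k w} → LinearlyIndependent (suc k) w →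
           (∀ x y → L k (tail w) (x + y) ≈ L k (tail w) x + L k (tail w) y) →
           (∀ {a} x → 𝔽 a → L k (tail w) (a * x) ≈ a * L k (tail w) x) →
           ∀ y → L (suc k) w y ≈ L k (tail w) y ^ q - L k (tail w) (head w) ^ (q ∸ 1) * L k (tail w) y
  L-step {k} {w} independent L′-+ L′-scale y = begin
    L (suc k) w y                                                           ≈⟨ ∏.fold-decomposition (Span? k (tail w)) 𝔽? (Span? (suc k) w)
                                                                                 (Span-resp k (tail w)) 𝔽-resp (Span-resp (suc k) w)
                                                                                 (Span-decomposition {k} {w} independent) (λ u → y + u) +-congˡ ⟩
    ∏ 𝔽-elements (λ a → ∏ (spanElements k (tail w)) (λ e → y + (e + a * head w))) ≈⟨ ∏.fold-cong-∈ 𝔽-elements (λ a∈ → line (∈-enum⁻ 𝔽? 𝔽-resp a∈)) ⟩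
    ∏ 𝔽-elements (λ a → L′ y + a * L′ (head w))                              ≈⟨ ∏-𝔽-line (L-≉0 k (tail w) (independent⇒head∉Span {k} {w} independent)) (L′ y) ⟩
    L′ y ^ q - L′ (head w) ^ (q ∸ 1) * L′ y                                  ∎
    where
    L′ : Carrier → Carrier
    L′ = L k (tail w)
    line : ∀ {a} → 𝔽 a → ∏ (spanElements k (tail w)) (λ e → y + (e + a * head w)) ≈ L′ y + a * L′ (head w)
    line {a} 𝔽a = begin
      ∏ (spanElements k (tail w)) (λ e → y + (e + a * head w))
        ≈⟨ ∏.fold-cong (spanElements k (tail w)) (λ e → solve 4 (λ y e a w → y :+ (e :+ a :* w) := (y :+ a :* w) :+ e) refl y e a (head w)) ⟩
      L′ (y + a * head w)                                        ≈⟨ L′-+ y (a * head w) ⟩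
      L′ y + L′ (a * head w)                                     ≈⟨ +-congˡ (L′-scale (head w) 𝔽a) ⟩
      L′ y + a * L′ (head w)                                     ∎

  record SubspacePolynomial (k : ℕ) (w : Fin k → Carrier) : Set (c ⊔ ℓ) where
    field
      L-+       : ∀ x y → L k w (x + y) ≈ L k w x + L k w y
      L-scale   : ∀ {a} x → 𝔽 a → L k w (a * x) ≈ a * L k w x
      L-monic   : LeadingTerm 1# (q ℕ.^ k) (L k w)
      |Span|≡qᵏ : length (spanElements k w) ≡ q ℕ.^ k

  subspacePolynomial : ∀ k w → LinearlyIndependent k w → SubspacePolynomial k w
  subspacePolynomial zero    w _ = record
    { L-+       = λ x y → trans (L₀≈id w (x + y)) (sym (+-cong (L₀≈id w x) (L₀≈id w y)))
    ; L-scale   = λ {a} x _ → trans (L₀≈id w (a * x)) (sym (*-congˡ (L₀≈id w x)))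
    ; L-monic   = leadingTerm-cong refl (λ x → trans (x^1≈x x) (sym (L₀≈id w x))) (leadingTerm-X^ 1)
    ; |Span|≡qᵏ = |Span₀|≡1 w
    }
  subspacePolynomial (suc k) w independent = record
    { L-+       = λ x y → begin
        L (suc k) w (x + y)                                   ≈⟨ step (x + y) ⟩
        F (L′ (x + y))                                        ≈⟨ F-cong (L′-+ x y) ⟩
        F (L′ x + L′ y)                                       ≈⟨ +-congʳ (frobenius _ _) ⟩
        (L′ x ^ q + L′ y ^ q) - L′w₀ ^ (q ∸ 1) * (L′ x + L′ y)   ≈⟨ solve 5 (λ A B u X Y → (A :+ B) :- u :* (X :+ Y) := (A :- u :* X) :+ (B :- u :* Y)) refl _ _ _ _ _ ⟩
        F (L′ x) + F (L′ y)                                   ≈⟨ sym (+-cong (step x) (step y)) ⟩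
        L (suc k) w x + L (suc k) w y                         ∎
    ; L-scale   = λ {a} x 𝔽a → begin
        L (suc k) w (a * x)                                   ≈⟨ step (a * x) ⟩
        F (L′ (a * x))                                        ≈⟨ F-cong (L′-scale x 𝔽a) ⟩
        F (a * L′ x)                                          ≈⟨ +-congʳ (trans (^-distrib-* a _ q) (*-congʳ 𝔽a)) ⟩
        a * L′ x ^ q - L′w₀ ^ (q ∸ 1) * (a * L′ x)               ≈⟨ solve 4 (λ a A u X → a :* A :- u :* (a :* X) := a :* (A :- u :* X)) refl _ _ _ _ ⟩
        a * F (L′ x)                                          ≈⟨ *-congˡ (sym (step x)) ⟩
        a * L (suc k) w x                                     ∎
    ; L-monic   = leadingTerm-cong refl (λ y → sym (step y))
        (leadingTerm-+degreeBelow (leadingTerm-≡ (ℕ.*-comm (q ℕ.^ k) q) (leadingTerm-cong (1^n≈1 q) (λ _ → refl) (leadingTerm-^ L′-monic q)))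
          (degreeBelow-neg (degreeBelow-scale (L′w₀ ^ (q ∸ 1)) (degreeBelow-mono qᵏ<qᵏ⁺¹ (leadingTerm⇒degreeBelow L′-monic)))))
    ; |Span|≡qᵏ = ≡.trans (≡.sym (#≡length (spanElements (suc k) w)))
        (≡.trans (#.fold-decomposition (Span? k (tail w)) 𝔽? (Span? (suc k) w) (Span-resp k (tail w)) 𝔽-resp (Span-resp (suc k) w)
                                       (Span-decomposition {k} {w} independent) (λ _ → 1) (λ _ → ≡.refl))
        (≡.trans (#.fold-cong 𝔽-elements (λ _ → ≡.trans (#≡length (spanElements k (tail w))) |Span′|≡qᵏ))
        (≡.trans (#-const 𝔽-elements (q ℕ.^ k)) (≡.cong (ℕ._* q ℕ.^ k) |𝔽|≡q))))
    }
    where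
    open SubspacePolynomial (subspacePolynomial k (tail w) (independent-tail {k} {w} independent))
      renaming (L-+ to L′-+; L-scale to L′-scale; L-monic to L′-monic; |Span|≡qᵏ to |Span′|≡qᵏ)
    L′ : Carrier → Carrier
    L′ = L k (tail w)
    L′w₀ : Carrier
    L′w₀ = L′ (head w)
    F : Carrier → Carrier
    F Y = Y ^ q - L′w₀ ^ (q ∸ 1) * Y
    F-cong : ∀ {X Y} → X ≈ Y → F X ≈ F Y
    F-cong X≈Y = +-cong (^-congˡ q X≈Y) (-‿cong (*-congˡ X≈Y))
    step : ∀ y → L (suc k) w y ≈ F (L′ y)
    step = L-step {k} {w} independent L′-+ L′-scale
    qᵏ<qᵏ⁺¹ : suc (q ℕ.^ k) ≤ q ℕ.^ suc k
    qᵏ<qᵏ⁺¹ = ℕ.^-monoʳ-< q q≥2 (ℕ.n<1+n k)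
    #-const : ∀ xs N → #.fold xs (λ _ → N) ≡ length xs ℕ.* N
    #-const []       N = ≡.refl
    #-const (x ∷ xs) N = ≡.cong (N ℕ.+_) (#-const xs N)

module Determinant {c ℓ : Level} (K : FiniteField c ℓ) where

  open FieldArithmetic K
  open FiniteSums K

  det : (k : ℕ) → (Fin k → Fin k → Carrier) → Carrier
  det = Defs.det K

  -- Defs.det keeps its cofactor signs in a where-clause; they are recovered by unification
  -- from the unfolded determinant of size k + 1.
  sign : (k : ℕ) → Fin k → Carrier
  sign k = signs-of (≡.refl {x = det (suc k) (λ _ _ → 0#)})
    where
    signs-of : ∀ {a : Carrier} {s x : Fin k → Carrier} →
               a + (Σ[< k ] λ j → (- s j) * x j) ≡ a + (Σ[< k ] λ j → (- s j) * x j) → Fin k → Carrier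
    signs-of {s = s} _ = s

  minor : ∀ {k} → (Fin (suc k) → Fin (suc k) → Carrier) → Fin (suc k) → Fin k → Fin k → Carrier
  minor M j i l = M (suc i) (punchIn j l)

  cofactorTerm : ∀ {k} → (Fin (suc k) → Fin (suc k) → Carrier) → Fin (suc k) → Carrier
  cofactorTerm {k} M j = sign (suc k) j * (M zero j * det k (minor M j))

  det-cong : ∀ k {M N : Fin k → Fin k → Carrier} → (∀ i j → M i j ≈ N i j) → det k M ≈ det k N
  det-cong zero    M≈N = refl
  det-cong (suc k) {M} {N} M≈N = Σ-cong (suc k) {cofactorTerm M} {cofactorTerm N} λ j → *-congˡ (*-cong (M≈N zero j) (det-cong k λ i l → M≈N (suc i) (punchIn j l)))


module MooreDeterminant {c ℓ : Level} (K : FiniteField c ℓ) (q n : ℕ)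
                        (q-primePower : IsPrimePower q) (card≡qⁿ : Defs.card K ≡ q ℕ.^ n) where

  open FieldArithmetic K
  open Enumeration K
  open FiniteSums K
  open PolynomialFunctions K
  open Determinant K
  open Subfield K q n q-primePower card≡qⁿ
  open Spans K q n q-primePower card≡qⁿ

  Δ : (k : ℕ) → (Fin k → Carrier) → Carrier
  Δ k w = Defs.moore K q k w

  Δ-cong : ∀ k {v w : Fin k → Carrier} → (∀ i → v i ≈ w i) → Δ k v ≈ Δ k w
  Δ-cong k v≈w = det-cong k (λ i j → ^-congˡ (q ℕ.^ toℕ i) (v≈w j))

  sign-𝔽 : ∀ k (j : Fin k) → 𝔽 (sign k j)
  sign-𝔽 (suc k) zero    = 𝔽-1#
  sign-𝔽 (suc k) (suc j) = 𝔽-neg (sign-𝔽 k j)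

  Σ-frobenius : ∀ k (f : Fin k → Carrier) → (Σ[< k ] f) ^ q ≈ (Σ[< k ] λ j → f j ^ q)
  Σ-frobenius zero    f = 0^q≈0
  Σ-frobenius (suc k) f = trans (frobenius _ _) (+-congˡ (Σ-frobenius k (f ∘ suc)))

  det-frobenius : ∀ k (M : Fin k → Fin k → Carrier) → det k (λ i j → M i j ^ q) ≈ det k M ^ q
  det-frobenius zero    M = sym (1^n≈1 q)
  det-frobenius (suc k) M = sym (begin
    det (suc k) M ^ q                                                              ≈⟨ Σ-frobenius (suc k) (cofactorTerm M) ⟩
    (Σ[< suc k ] λ j → cofactorTerm M j ^ q)                                       ≈⟨ Σ-cong (suc k) {λ j → cofactorTerm M j ^ q} {cofactorTerm (λ i j → M i j ^ q)} (λ j → trans (^-distrib-* _ _ q)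
                                                                                         (*-cong (sign-𝔽 (suc k) j) (trans (^-distrib-* _ _ q) (*-congˡ (sym (det-frobenius k (minor M j))))))) ⟩
    det (suc k) (λ i j → M i j ^ q)                                                ∎)

  -- The rows below the first are the q-th powers of the rows of a Moore matrix of size k.
  Δ-expand : ∀ k (w : Fin (suc k) → Carrier) → Δ (suc k) w ≈ (Σ[< suc k ] λ j → sign (suc k) j * (w j * Δ k (removeAt w j) ^ q))
  Δ-expand k w = Σ-cong (suc k) {cofactorTerm (λ i j → w j ^ (q ℕ.^ toℕ i))} {λ j → sign (suc k) j * (w j * Δ k (removeAt w j) ^ q)} λ j → *-congˡ (*-cong (x^1≈x (w j))
    (trans (det-cong k (λ i l → trans (^-congʳ (w (punchIn j l)) (ℕ.*-comm q (q ℕ.^ toℕ i))) (sym (^-assocʳ (w (punchIn j l)) (q ℕ.^ toℕ i) q))))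
           (det-frobenius k (λ i l → w (punchIn j l) ^ (q ℕ.^ toℕ i)))))

  -- the position of column i among the columns left after removing column punchIn i j
  remainingIndex : ∀ {k} (i : Fin (suc (suc k))) (j : Fin (suc k)) → Fin (suc k)
  remainingIndex         zero    j       = zero
  remainingIndex         (suc i) zero    = i
  remainingIndex {suc k} (suc i) (suc j) = suc (remainingIndex i j)

  punchIn-remainingIndex : ∀ {k} (i : Fin (suc (suc k))) (j : Fin (suc k)) → punchIn (punchIn i j) (remainingIndex i j) ≡ i
  punchIn-remainingIndex         zero    j       = ≡.refl
  punchIn-remainingIndex         (suc i) zero    = ≡.refl
  punchIn-remainingIndex {suc k} (suc i) (suc j) = ≡.cong suc (punchIn-remainingIndex i j)

  punchIn-punchIn-remainingIndex : ∀ {k} (i : Fin (suc (suc k))) (j : Fin (suc k)) (l : Fin k) →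
                                   punchIn (punchIn i j) (punchIn (remainingIndex i j) l) ≡ punchIn i (punchIn j l)
  punchIn-punchIn-remainingIndex         zero    j       l       = ≡.refl
  punchIn-punchIn-remainingIndex         (suc i) zero    l       = ≡.refl
  punchIn-punchIn-remainingIndex {suc k} (suc i) (suc j) zero    = ≡.refl
  punchIn-punchIn-remainingIndex {suc k} (suc i) (suc j) (suc l) = ≡.cong suc (punchIn-punchIn-remainingIndex i j l)

  sign-remainingIndex : ∀ {k} (i : Fin (suc (suc k))) (j : Fin (suc k)) →
                        sign (suc (suc k)) (punchIn i j) * sign (suc k) (remainingIndex i j) ≈ sign (suc (suc k)) i * sign (suc (suc k)) (suc j)
  sign-remainingIndex         zero    j       = trans (*-identityʳ _) (sym (*-identityˡ _))
  sign-remainingIndex         (suc i) zero    = trans (*-identityˡ _) (sym (trans (-x*-y≈x*y _ _) (*-identityʳ _)))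
  sign-remainingIndex {suc k} (suc i) (suc j) = trans (-x*-y≈x*y _ _) (trans (sign-remainingIndex i j) (sym (-x*-y≈x*y _ _)))

  Δ-move-to-front : ∀ k (w : Fin (suc k) → Carrier) (i : Fin (suc k)) → Δ (suc k) w ≈ sign (suc k) i * Δ (suc k) (w i ∷ᵥ removeAt w i)
  Δ-move-to-front k       w zero = sym (trans (*-identityˡ _) (Δ-cong (suc k) {w zero ∷ᵥ removeAt w zero} {w} λ { zero → refl ; (suc l) → refl }))
  Δ-move-to-front (suc k) w i    = begin
    Δ (suc (suc k)) w                                                   ≈⟨ Δ-expand (suc k) w ⟩
    Σ[< suc (suc k) ] term w                                            ≈⟨ Σ-remove (suc k) i (term w) ⟩
    term w i + Σ[< suc k ] (term w ∘ punchIn i)                         ≈⟨ +-cong (*-congˡ (sym (*-identityˡ _))) (trans (Σ-cong (suc k) {term w ∘ punchIn i} {λ j → sᵢ * term v (suc j)} moved)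
                                                                             (sym (*-distribˡ-Σ (suc k) sᵢ (λ j → term v (suc j))))) ⟩
    sᵢ * term v zero + sᵢ * Σ[< suc k ] (λ j → term v (suc j))          ≈⟨ sym (distribˡ sᵢ _ _) ⟩
    sᵢ * Σ[< suc (suc k) ] term v                                       ≈⟨ *-congˡ (sym (Δ-expand (suc k) v)) ⟩
    sᵢ * Δ (suc (suc k)) v                                              ∎
    where
    term : (Fin (suc (suc k)) → Carrier) → Fin (suc (suc k)) → Carrier
    term u j = sign (suc (suc k)) j * (u j * Δ (suc k) (removeAt u j) ^ q)
    sᵢ : Carrier
    sᵢ = sign (suc (suc k)) i
    v : Fin (suc (suc k)) → Carrier
    v = w i ∷ᵥ removeAt w i
    moved : ∀ j → term w (punchIn i j) ≈ sᵢ * term v (suc j)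
    moved j = begin
      sⱼ * (w J * Δ (suc k) u ^ q)                                          ≈⟨ *-congˡ (*-congˡ (^-congˡ q (Δ-move-to-front k u (remainingIndex i j)))) ⟩
      sⱼ * (w J * (sₚ * Δ (suc k) (u p ∷ᵥ removeAt u p)) ^ q)              ≈⟨ *-congˡ (*-congˡ (^-congˡ q (*-congˡ (Δ-cong (suc k) columns)))) ⟩
      sⱼ * (w J * (sₚ * X) ^ q)                                             ≈⟨ *-congˡ (*-congˡ (trans (^-distrib-* sₚ X q) (*-congʳ (sign-𝔽 (suc k) p)))) ⟩
      sⱼ * (w J * (sₚ * X ^ q))                                             ≈⟨ solve 4 (λ a b c d → a :* (b :* (c :* d)) := (a :* c) :* (b :* d)) refl sⱼ (w J) sₚ (X ^ q) ⟩
      (sⱼ * sₚ) * (w J * X ^ q)                                             ≈⟨ *-congʳ (sign-remainingIndex i j) ⟩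
      (sᵢ * sign (suc (suc k)) (suc j)) * (w J * X ^ q)                     ≈⟨ *-assoc _ _ _ ⟩
      sᵢ * (sign (suc (suc k)) (suc j) * (w J * X ^ q))
        ≈⟨ *-congˡ (*-congˡ (*-congˡ (^-congˡ q (Δ-cong (suc k) {w i ∷ᵥ (removeAt w i ∘ punchIn j)} {removeAt v (suc j)} λ { zero → refl ; (suc l) → refl })))) ⟩
      sᵢ * term v (suc j)                                                   ∎
      where
      J : Fin (suc (suc k))
      J = punchIn i j
      sⱼ : Carrier
      sⱼ = sign (suc (suc k)) J
      p : Fin (suc k)
      p = remainingIndex i j
      sₚ : Carrier
      sₚ = sign (suc k) p
      u : Fin (suc k) → Carrier
      u = removeAt w J
      X : Carrier
      X = Δ (suc k) (w i ∷ᵥ (removeAt w i ∘ punchIn j))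
      columns : ∀ l → (u p ∷ᵥ removeAt u p) l ≈ (w i ∷ᵥ (removeAt w i ∘ punchIn j)) l
      columns zero    = reflexive (≡.cong w (punchIn-remainingIndex i j))
      columns (suc l) = reflexive (≡.cong w (punchIn-punchIn-remainingIndex i j l))

  ε : ℕ → Carrier
  ε k = (- 1#) ^ k

  ε-𝔽 : ∀ k → 𝔽 (ε k)
  ε-𝔽 zero    = 𝔽-1#
  ε-𝔽 (suc k) = 𝔽-* (𝔽-neg 𝔽-1#) (ε-𝔽 k)

  ε-≉0 : ∀ k → ε k ≉ 0#
  ε-≉0 k = ^-≉0 k -1≉0

  leadingTerm-Σ : ∀ {d} k (a : Fin k → Carrier) (F : Fin k → Carrier → Carrier) → (∀ j → LeadingTerm (a j) d (F j)) →
                  LeadingTerm (Σ[< k ] a) d (λ x → Σ[< k ] λ j → F j x)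
  leadingTerm-Σ zero    a F F~ = degreeBelow⇒leadingTerm-0# degreeBelow-0#
  leadingTerm-Σ (suc k) a F F~ = leadingTerm-+ (F~ zero) (leadingTerm-Σ k (a ∘ suc) (F ∘ suc) (F~ ∘ suc))

  -- Expanded along its first row, Δ (x ∷ w) is 𝔽-linear in x with leading term
  -- ε (k + 1) · Δ w · x ^ (q ^ (k + 1)) and vanishes on the span of w, so it is that multiple of L (k + 1) w.
  module MooreStep (k : ℕ) (w : Fin (suc k) → Carrier) (independent : LinearlyIndependent (suc k) w)
                   (Δ-∷′ : ∀ j x → Δ (suc k) (x ∷ᵥ removeAt w j) ≈ ε k * Δ k (removeAt w j) * L k (removeAt w j) x) where

    Lⱼ : Fin (suc k) → Carrier → Carrier
    Lⱼ j = L k (removeAt w j)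
    Dⱼ : Fin (suc k) → Carrier
    Dⱼ j = Δ k (removeAt w j)
    D : Carrier
    D = Δ (suc k) w
    B : Fin (suc k) → Carrier
    B j = sign (suc (suc k)) (suc j) * (w j * (ε k * Dⱼ j) ^ q)
    T : Carrier → Fin (suc k) → Carrier
    T x j = B j * Lⱼ j x ^ q
    Ψ : Carrier → Carrier
    Ψ x = x * D ^ q + Σ[< suc k ] T x

    Lⱼ-props : ∀ j → SubspacePolynomial k (removeAt w j)
    Lⱼ-props j = subspacePolynomial k (removeAt w j) (independent-removeAt {k} {w} independent j)
    open SubspacePolynomial (subspacePolynomial (suc k) w independent)

    Δ≈Ψ : ∀ x → Δ (suc (suc k)) (x ∷ᵥ w) ≈ Ψ x
    Δ≈Ψ x = trans (Δ-expand (suc k) (x ∷ᵥ w)) (+-cong (*-identityˡ _) (Σ-cong (suc k) {λ j → _} {T x} term))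
      where
      term : ∀ j → sign (suc (suc k)) (suc j) * (w j * Δ (suc k) (removeAt (x ∷ᵥ w) (suc j)) ^ q) ≈ T x j
      term j = begin
        sign (suc (suc k)) (suc j) * (w j * Δ (suc k) (removeAt (x ∷ᵥ w) (suc j)) ^ q)
          ≈⟨ *-congˡ (*-congˡ (^-congˡ q (trans (Δ-cong (suc k) {removeAt (x ∷ᵥ w) (suc j)} {x ∷ᵥ removeAt w j} λ { zero → refl ; (suc l) → refl }) (Δ-∷′ j x)))) ⟩
        sign (suc (suc k)) (suc j) * (w j * (ε k * Dⱼ j * Lⱼ j x) ^ q)
          ≈⟨ *-congˡ (*-congˡ (^-distrib-* _ _ q)) ⟩
        sign (suc (suc k)) (suc j) * (w j * ((ε k * Dⱼ j) ^ q * Lⱼ j x ^ q))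
          ≈⟨ solve 4 (λ a b c d → a :* (b :* (c :* d)) := (a :* (b :* c)) :* d) refl _ _ _ _ ⟩
        T x j ∎

    ΣB≈εD : Σ[< suc k ] B ≈ ε (suc k) * D
    ΣB≈εD = begin
      Σ[< suc k ] B                                                           ≈⟨ Σ-cong (suc k) {B} {λ j → - ε k * (sign (suc k) j * (w j * Dⱼ j ^ q))} Bⱼ≈ ⟩
      (Σ[< suc k ] λ j → - ε k * (sign (suc k) j * (w j * Dⱼ j ^ q)))         ≈⟨ sym (*-distribˡ-Σ (suc k) (- ε k) (λ j → sign (suc k) j * (w j * Dⱼ j ^ q))) ⟩
      - ε k * (Σ[< suc k ] λ j → sign (suc k) j * (w j * Dⱼ j ^ q))           ≈⟨ *-cong (sym (-1*x≈-x (ε k))) (sym (Δ-expand k w)) ⟩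
      ε (suc k) * D                                                           ∎
      where
      Bⱼ≈ : ∀ j → B j ≈ - ε k * (sign (suc k) j * (w j * Dⱼ j ^ q))
      Bⱼ≈ j = begin
        - sign (suc k) j * (w j * (ε k * Dⱼ j) ^ q)       ≈⟨ *-congˡ (*-congˡ (trans (^-distrib-* _ _ q) (*-congʳ (ε-𝔽 k)))) ⟩
        - sign (suc k) j * (w j * (ε k * Dⱼ j ^ q))       ≈⟨ solve 4 (λ s a e d → :- s :* (a :* (e :* d)) := :- e :* (s :* (a :* d))) refl _ _ _ _ ⟩
        - ε k * (sign (suc k) j * (w j * Dⱼ j ^ q))       ∎

    Ψ-monic : LeadingTerm (ε (suc k) * D) (q ℕ.^ suc k) Ψ
    Ψ-monic = leadingTerm-cong ΣB≈εD (λ x → +-comm _ _)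
      (leadingTerm-+degreeBelow (leadingTerm-Σ (suc k) B (λ j x → T x j) λ j → leadingTerm-cong (*-identityʳ _) (λ _ → refl)
                                   (leadingTerm-scale (B j) (leadingTerm-≡ (ℕ.*-comm (q ℕ.^ k) q) (leadingTerm-cong (1^n≈1 q) (λ _ → refl)
                                     (leadingTerm-^ (SubspacePolynomial.L-monic (Lⱼ-props j)) q)))))
                                (degreeBelow-mono q^[1+k]≥2 (degreeBelow-cong (λ x → *-comm _ _) (degreeBelow-scale (D ^ q) (degreeBelow-cong x^1≈x (degreeBelow-X^ 1))))))
      where
      q^[1+k]≥2 : 2 ≤ q ℕ.^ suc k
      q^[1+k]≥2 = ℕ.≤-trans q≥2 (ℕ.≤-trans (ℕ.≤-reflexive (≡.sym (ℕ.*-identityʳ q))) (ℕ.*-monoʳ-≤ q (qᵏ≥1 k)))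

    Ψ-cong : ∀ {x y} → x ≈ y → Ψ x ≈ Ψ y
    Ψ-cong {x} {y} x≈y = +-cong (*-congʳ x≈y) (Σ-cong (suc k) {T x} {T y} λ j → *-congˡ (^-congˡ q (L-cong k (removeAt w j) x≈y)))

    Ψ-+ : ∀ x y → Ψ (x + y) ≈ Ψ x + Ψ y
    Ψ-+ x y = begin
      (x + y) * D ^ q + Σ[< suc k ] T (x + y)
        ≈⟨ +-cong (distribʳ _ x y) (trans (Σ-cong (suc k) {T (x + y)} {λ j → T x j + T y j} T-+) (Σ-distrib-+ (suc k) (T x) (T y))) ⟩
      (x * D ^ q + y * D ^ q) + (Σ[< suc k ] T x + Σ[< suc k ] T y) ≈⟨ solve 4 (λ a b c d → (a :+ b) :+ (c :+ d) := (a :+ c) :+ (b :+ d)) refl _ _ _ _ ⟩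
      Ψ x + Ψ y                                                     ∎
      where
      T-+ : ∀ j → T (x + y) j ≈ T x j + T y j
      T-+ j = trans (*-congˡ (trans (^-congˡ q (SubspacePolynomial.L-+ (Lⱼ-props j) x y)) (frobenius _ _))) (distribˡ _ _ _)

    Ψ-scale : ∀ {a} x → 𝔽 a → Ψ (a * x) ≈ a * Ψ x
    Ψ-scale {a} x 𝔽a = begin
      (a * x) * D ^ q + Σ[< suc k ] T (a * x)
        ≈⟨ +-cong (*-assoc _ _ _) (trans (Σ-cong (suc k) {T (a * x)} {λ j → a * T x j} T-scale) (sym (*-distribˡ-Σ (suc k) a (T x)))) ⟩
      a * (x * D ^ q) + a * Σ[< suc k ] T x                       ≈⟨ sym (distribˡ a _ _) ⟩
      a * Ψ x                                                     ∎
      where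
      T-scale : ∀ j → T (a * x) j ≈ a * T x j
      T-scale j = trans (*-congˡ (trans (^-congˡ q (SubspacePolynomial.L-scale (Lⱼ-props j) x 𝔽a)) (trans (^-distrib-* _ _ q) (*-congʳ 𝔽a))))
                        (solve 3 (λ b a l → b :* (a :* l) := a :* (b :* l)) refl _ _ _)

    Ψ-vanishes : ∀ i → Ψ (w i) ≈ 0#
    Ψ-vanishes i = begin
      w i * D ^ q + Σ[< suc k ] T (w i)                                 ≈⟨ +-cong (*-congˡ (trans (^-congˡ q (Δ-move-to-front k w i)) (trans (^-distrib-* _ _ q) (*-congʳ (sign-𝔽 (suc k) i)))))
                                                                             (Σ-remove k i (T (w i))) ⟩
      w i * (sᵢ * Z ^ q) + (T (w i) i + Σ[< k ] (T (w i) ∘ punchIn i))   ≈⟨ +-congˡ (+-cong Tᵢ≈ (Σ-0# k (T (w i) ∘ punchIn i) Tₗ≈0)) ⟩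
      w i * (sᵢ * Z ^ q) + (- sᵢ * (w i * Z ^ q) + 0#)                   ≈⟨ +-congˡ (+-identityʳ _) ⟩
      w i * (sᵢ * Z ^ q) + - sᵢ * (w i * Z ^ q)
        ≈⟨ solve 3 (λ a s z → a :* (s :* z) :+ :- s :* (a :* z) := (a :* s :* z) :- (a :* s :* z)) refl (w i) sᵢ (Z ^ q) ⟩
      (w i * sᵢ * Z ^ q) - (w i * sᵢ * Z ^ q)                            ≈⟨ -‿inverseʳ _ ⟩
      0#                                                                 ∎
      where
      sᵢ : Carrier
      sᵢ = sign (suc k) i
      Z : Carrier
      Z = Δ (suc k) (w i ∷ᵥ removeAt w i)
      Tᵢ≈ : T (w i) i ≈ - sᵢ * (w i * Z ^ q)
      Tᵢ≈ = begin
        B i * Lⱼ i (w i) ^ q                                     ≈⟨ solve 4 (λ s a e l → (s :* (a :* e)) :* l := s :* (a :* (e :* l))) refl _ _ _ _ ⟩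
        - sᵢ * (w i * ((ε k * Dⱼ i) ^ q * Lⱼ i (w i) ^ q))       ≈⟨ *-congˡ (*-congˡ (trans (sym (^-distrib-* _ _ q)) (^-congˡ q (sym (Δ-∷′ i (w i)))))) ⟩
        - sᵢ * (w i * Z ^ q)                                     ∎
      wᵢ∈ : ∀ {k} (i : Fin (suc k)) (l : Fin k) (w : Fin (suc k) → Carrier) → Span k (removeAt w (punchIn i l)) (w i)
      wᵢ∈ {suc k} i l w = Span-resp (suc k) (removeAt w (punchIn i l)) (reflexive (≡.cong w (punchIn-remainingIndex i l)))
                            (Span-generator (suc k) (removeAt w (punchIn i l)) (remainingIndex i l))
      Tₗ≈0 : ∀ l → T (w i) (punchIn i l) ≈ 0#
      Tₗ≈0 l = trans (*-congˡ (trans (^-congˡ q (L-vanishes k (removeAt w (punchIn i l)) (wᵢ∈ i l w))) 0^q≈0)) (zeroʳ _)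

    Δ-∷-step : ∀ x → Δ (suc (suc k)) (x ∷ᵥ w) ≈ ε (suc k) * D * L (suc k) w x
    Δ-∷-step x = trans (Δ≈Ψ x) (x-y≈0⇒x≈y (degreeBelow-vanishes Ψ-cL<qᵏ⁺¹ (spanElements (suc k) w)
      (ℕ.≤-reflexive (≡.sym |Span|≡qᵏ)) (enum-unique (Span? (suc k) w)) (Ψ-cL-vanishes ∘ ∈-enum⁻ (Span? (suc k) w) (Span-resp (suc k) w)) x))
      where
      cD : Carrier
      cD = ε (suc k) * D
      Ψ-cL : Carrier → Carrier
      Ψ-cL x = Ψ x - cD * L (suc k) w x
      Ψ-cL<qᵏ⁺¹ : DegreeBelow (q ℕ.^ suc k) Ψ-cL
      Ψ-cL<qᵏ⁺¹ = leadingTerm-0#⇒degreeBelow (leadingTerm-cong (trans (+-congˡ (-‿cong (*-identityʳ cD))) (-‿inverseʳ cD)) (λ _ → refl)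
                    (leadingTerm-+ Ψ-monic (leadingTerm-neg (leadingTerm-scale cD L-monic))))
      Ψ-cL-vanishes : ∀ {r} → Span (suc k) w r → Ψ-cL r ≈ 0#
      Ψ-cL-vanishes = linear-vanishes-on-Span (suc k) w Ψ-cL
        (λ x≈y → +-cong (Ψ-cong x≈y) (-‿cong (*-congˡ (L-cong (suc k) w x≈y))))
        (λ x y → trans (+-cong (Ψ-+ x y) (-‿cong (*-congˡ (L-+ x y))))
                       (solve 5 (λ a b c u v → (a :+ b) :- c :* (u :+ v) := (a :- c :* u) :+ (b :- c :* v)) refl _ _ _ _ _))
        (λ {a} x 𝔽a → trans (+-cong (Ψ-scale x 𝔽a) (-‿cong (*-congˡ (L-scale x 𝔽a))))
                            (solve 4 (λ a p c u → a :* p :- c :* (a :* u) := a :* (p :- c :* u)) refl _ _ _ _))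
        (λ i → trans (+-cong (Ψ-vanishes i) (-‿cong (trans (*-congˡ (L-vanishes (suc k) w (Span-generator (suc k) w i))) (zeroʳ _))))
                     (trans (+-identityˡ _) -0#≈0#))

  Δ-∷ : ∀ k (w : Fin k → Carrier) → LinearlyIndependent k w → ∀ x → Δ (suc k) (x ∷ᵥ w) ≈ ε k * Δ k w * L k w x
  Δ-∷ zero    w _ x = begin
    Δ 1 (x ∷ᵥ w)               ≈⟨ Δ-expand 0 (x ∷ᵥ w) ⟩
    1# * (x * 1# ^ q) + 0#     ≈⟨ trans (+-identityʳ _) (trans (*-identityˡ _) (trans (*-congˡ (1^n≈1 q)) (*-identityʳ x))) ⟩
    x                          ≈⟨ sym (trans (*-congʳ (*-identityˡ 1#)) (trans (*-identityˡ _) (L₀≈id w x))) ⟩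
    ε 0 * Δ 0 w * L 0 w x      ∎
  Δ-∷ (suc k) w independent =
    MooreStep.Δ-∷-step k w independent (λ j → Δ-∷ k (removeAt w j) (independent-removeAt {k} {w} independent j))

  Δ-≉0 : ∀ k (w : Fin k → Carrier) → LinearlyIndependent k w → Δ k w ≉ 0#
  Δ-≉0 zero    w _           = 1≉0
  Δ-≉0 (suc k) w independent Δ≈0 =
    *-≉0 (*-≉0 (ε-≉0 k) (Δ-≉0 k (tail w) (independent-tail {k} {w} independent))) (L-≉0 k (tail w) (independent⇒head∉Span {k} {w} independent))
      (trans (sym (Δ-∷ k (tail w) (independent-tail {k} {w} independent) (head w))) (trans (Δ-cong (suc k) {head w ∷ᵥ tail w} {w} λ { zero → refl ; (suc l) → refl }) Δ≈0))

module SpanSums {c ℓ : Level} (K : FiniteField c ℓ) (q n : ℕ)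
                (q-primePower : IsPrimePower q) (card≡qⁿ : Defs.card K ≡ q ℕ.^ n) where

  open FieldArithmetic K
  open Enumeration K
  open Sums K
  open Subfield K q n q-primePower card≡qⁿ
  open SubfieldSums K q n q-primePower card≡qⁿ
  open Spans K q n q-primePower card≡qⁿ
  open MooreDeterminant K q n q-primePower card≡qⁿ

  -- invPow is only known to respect ≈ away from 0 (_⁻¹ is arbitrary at 0); setting it to 0 there
  -- gives a congruent summand, which the reindexing lemmas require.
  invPow′ : Carrier → Carrier
  invPow′ x with x ≟ 0#
  ... | yes _ = 0#
  ... | no _  = invPow x

  invPow′≈invPow : ∀ {x} → x ≉ 0# → invPow′ x ≈ invPow x
  invPow′≈invPow {x} x≉0 with x ≟ 0#
  ... | yes x≈0 = ⊥-elim (x≉0 x≈0)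
  ... | no _    = refl

  invPow′-cong : ∀ {x y} → x ≈ y → invPow′ x ≈ invPow′ y
  invPow′-cong {x} {y} x≈y with x ≟ 0# | y ≟ 0#
  ... | yes _   | yes _   = refl
  ... | yes x≈0 | no y≉0  = ⊥-elim (y≉0 (trans (sym x≈y) x≈0))
  ... | no x≉0  | yes y≈0 = ⊥-elim (x≉0 (trans x≈y y≈0))
  ... | no x≉0  | no _    = invPow-cong x≉0 x≈y

  N : ℕ
  N = (q ∸ 1) ℕ.* (q ∸ 1)

  ε^N≈1 : ∀ k → ε k ^ N ≈ 1#
  ε^N≈1 k = trans (sym (^-assocʳ (ε k) (q ∸ 1) (q ∸ 1))) (trans (^-congˡ (q ∸ 1) (𝔽-^[q∸1] (ε-≉0 k) (ε-𝔽 k))) (1^n≈1 (q ∸ 1)))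

  ∑-coset-invPow : ∀ k w → LinearlyIndependent k w → ∀ f → ¬ Span k w f →
                   ∑ (spanElements k w) (λ e → invPow′ (f + e)) ≈ Δ k w ^ N * invPow (L k w f)
  ∑-coset-invPow zero    w _ f f∉ = begin
    ∑ (spanElements 0 w) (λ e → invPow′ (f + e))   ≡⟨ ≡.cong (λ xs → ∑ xs (λ e → invPow′ (f + e))) (Span₀≐≈0 w) ⟩
    ∑ (enum (_≟ 0#)) (λ e → invPow′ (f + e))       ≈⟨ ∑.fold-enum-≈ 0# (λ e → invPow′ (f + e)) (invPow′-cong ∘ +-congˡ) ⟩
    invPow′ (f + 0#)                               ≈⟨ trans (invPow′-cong (+-identityʳ f)) (invPow′≈invPow (f∉ ∘ lift)) ⟩
    invPow f                                       ≈⟨ sym (trans (*-congʳ (1^n≈1 N)) (trans (*-identityˡ _) (invPow-cong (L-≉0 0 w f∉) (L₀≈id w f)))) ⟩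
    1# ^ N * invPow (L 0 w f)                      ∎
  ∑-coset-invPow (suc k) w independent f f∉ = begin
    ∑ (spanElements (suc k) w) (λ e → invPow′ (f + e))
      ≈⟨ ∑.fold-decomposition (Span? k (tail w)) 𝔽? (Span? (suc k) w) (Span-resp k (tail w)) 𝔽-resp (Span-resp (suc k) w)
                              (Span-decomposition {k} {w} independent) (λ e → invPow′ (f + e)) (invPow′-cong ∘ +-congˡ) ⟩
    ∑ 𝔽-elements (λ a → ∑ (spanElements k (tail w)) (λ e → invPow′ (f + (e + a * head w))))
      ≈⟨ ∑.fold-cong-∈ 𝔽-elements (λ a∈ → coset (∈-enum⁻ 𝔽? 𝔽-resp a∈)) ⟩
    ∑ 𝔽-elements (λ a → D′ * invPow (Y + a * Lw₀))      ≈⟨ sym (*-distribˡ-∑ 𝔽-elements D′ _) ⟩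
    D′ * ∑ 𝔽-elements (λ a → invPow (Y + a * Lw₀))      ≈⟨ *-congˡ (∑-𝔽-line-invPow Y Lw₀≉0 Q≉0) ⟩
    D′ * (Lw₀ ^ N * invPow (Y ^ q - Lw₀ ^ (q ∸ 1) * Y))   ≈⟨ *-congˡ (*-congˡ (invPow-cong Q≉0 (sym (step f)))) ⟩
    D′ * (Lw₀ ^ N * invPow (L (suc k) w f))             ≈⟨ sym (*-assoc _ _ _) ⟩
    (D′ * Lw₀ ^ N) * invPow (L (suc k) w f)             ≈⟨ *-congʳ (sym Δᴺ≈D′Lw₀ᴺ) ⟩
    Δ (suc k) w ^ N * invPow (L (suc k) w f)          ∎
    where
    independent′ : LinearlyIndependent k (tail w)
    independent′ = independent-tail {k} {w} independent
    open SubspacePolynomial (subspacePolynomial k (tail w) independent′)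
    D′ : Carrier
    D′ = Δ k (tail w) ^ N
    Lw₀ : Carrier
    Lw₀ = L k (tail w) (head w)
    Lw₀≉0 : Lw₀ ≉ 0#
    Lw₀≉0 = L-≉0 k (tail w) (independent⇒head∉Span {k} {w} independent)
    Y : Carrier
    Y = L k (tail w) f
    step : ∀ y → L (suc k) w y ≈ L k (tail w) y ^ q - Lw₀ ^ (q ∸ 1) * L k (tail w) y
    step = L-step {k} {w} independent L-+ L-scale
    Q≉0 : Y ^ q - Lw₀ ^ (q ∸ 1) * Y ≉ 0#
    Q≉0 Q≈0 = L-≉0 (suc k) w f∉ (trans (step f) Q≈0)
    Δᴺ≈D′Lw₀ᴺ : Δ (suc k) w ^ N ≈ D′ * Lw₀ ^ N
    Δᴺ≈D′Lw₀ᴺ = begin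
      Δ (suc k) w ^ N                  ≈⟨ ^-congˡ N (trans (Δ-cong (suc k) {w} {head w ∷ᵥ tail w} λ { zero → refl ; (suc l) → refl }) (Δ-∷ k (tail w) independent′ (head w))) ⟩
      (ε k * Δ k (tail w) * Lw₀) ^ N     ≈⟨ trans (^-distrib-* _ _ N) (*-congʳ (^-distrib-* _ _ N)) ⟩
      (ε k ^ N * D′) * Lw₀ ^ N           ≈⟨ *-congʳ (trans (*-congʳ (ε^N≈1 k)) (*-identityˡ _)) ⟩
      D′ * Lw₀ ^ N                       ∎
    coset : ∀ {a} → 𝔽 a → ∑ (spanElements k (tail w)) (λ e → invPow′ (f + (e + a * head w))) ≈ D′ * invPow (Y + a * Lw₀)
    coset {a} 𝔽a = begin
      ∑ (spanElements k (tail w)) (λ e → invPow′ (f + (e + a * head w)))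
        ≈⟨ ∑.fold-cong (spanElements k (tail w)) (λ e → invPow′-cong (solve 4 (λ f e a w → f :+ (e :+ a :* w) := (f :+ a :* w) :+ e) refl f e a (head w))) ⟩
      ∑ (spanElements k (tail w)) (λ e → invPow′ ((f + a * head w) + e))
        ≈⟨ ∑-coset-invPow k (tail w) independent′ (f + a * head w) f+aw∉ ⟩
      D′ * invPow (L k (tail w) (f + a * head w))
        ≈⟨ *-congˡ (invPow-cong (L-≉0 k (tail w) f+aw∉) (trans (L-+ f (a * head w)) (+-congˡ (L-scale (head w) 𝔽a)))) ⟩
      D′ * invPow (Y + a * Lw₀) ∎
      where
      f+aw∉ : ¬ Span k (tail w) (f + a * head w)
      f+aw∉ f+aw∈ = f∉ (Span-intro k w (- a) (𝔽-neg 𝔽a)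
        (Span-resp k (tail w) (solve 3 (λ f a w → f :+ a :* w := f :- (:- a) :* w) refl f a (head w)) f+aw∈))

module DirectSum {c ℓ : Level} (K : FiniteField c ℓ) (q n : ℕ)
                 (q-primePower : IsPrimePower q) (card≡qⁿ : Defs.card K ≡ q ℕ.^ n)
                 (E F : Subspace K q) (E∩F≈0 : ∀ x → mem E x → mem F x → FiniteField._≈_ K x (FiniteField.0# K))
                 (k : ℕ) (v : Fin k → FiniteField.Carrier K) (basis : IsBasis K q k E v) where

  open FieldArithmetic K
  open Enumeration K
  open Sums K
  open FiniteSums K
  open Subfield K q n q-primePower card≡qⁿ
  open Spans K q n q-primePower card≡qⁿ
  open MooreDeterminant K q n q-primePower card≡qⁿ using (Δ)
  open SpanSums K q n q-primePower card≡qⁿ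
  open SubfieldSums K q n q-primePower card≡qⁿ using (invPow; invPow-cong)

  private
    v∈E : ∀ i → mem E (v i)
    v∈E = proj₁ basis
    independent : LinearlyIndependent k v
    independent = proj₁ (proj₂ basis)
    spanning : ∀ x → mem E x → Σ (Fin k → Carrier) λ a → (∀ i → 𝔽 (a i)) × x ≈ (Σ[< k ] λ i → a i * v i)
    spanning = proj₂ (proj₂ basis)

  combination∈ : ∀ (G : Subspace K q) j (a u : Fin j → Carrier) → (∀ i → 𝔽 (a i)) → (∀ i → mem G (u i)) →
                 mem G (Σ[< j ] λ i → a i * u i)
  combination∈ G zero    a u 𝔽a u∈ = mem-0 G
  combination∈ G (suc j) a u 𝔽a u∈ = mem-+ G (mem-smul G (𝔽a zero) (u∈ zero)) (combination∈ G j (a ∘ suc) (u ∘ suc) (𝔽a ∘ suc) (u∈ ∘ suc))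

  -∈ : ∀ (G : Subspace K q) {x y} → mem G x → mem G y → mem G (x - y)
  -∈ G x∈ y∈ = mem-+ G x∈ (resp G (-1*x≈-x _) (mem-smul G (𝔽-neg 𝔽-1#) y∈))

  E⊆Span : ∀ {x} → mem E x → Span k v x
  E⊆Span {x} x∈E = let a , 𝔽a , x≈Σ = spanning x x∈E in Span-resp k v (sym x≈Σ) (Span-combination⁺ k v a 𝔽a)

  Span⊆E : ∀ {x} → Span k v x → mem E x
  Span⊆E x∈ = let a , 𝔽a , x≈Σ = Span-combination⁻ k v x∈ in resp E (sym x≈Σ) (combination∈ E k a v 𝔽a v∈E)

  L_E : Carrier → Carrier
  L_E = Defs.L K E

  L_E≈L : ∀ x → L_E x ≈ L k v x
  L_E≈L x = trans (reflexive (prodList≡∏ (enum (mem? E)) (λ u → x + u))) (∏.fold-enum-≐ (mem? E) (Span? k v) E⊆Span Span⊆E (λ u → x + u))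

  open SubspacePolynomial (subspacePolynomial k v independent)

  L_E-cong : ∀ {x y} → x ≈ y → L_E x ≈ L_E y
  L_E-cong {x} {y} x≈y = trans (L_E≈L x) (trans (L-cong k v x≈y) (sym (L_E≈L y)))

  L_E-≉0 : ∀ {x} → ¬ mem E x → L_E x ≉ 0#
  L_E-≉0 {x} x∉E L_Ex≈0 = L-≉0 k v (x∉E ∘ Span⊆E) (trans (sym (L_E≈L x)) L_Ex≈0)

  L_E[x-y]≈L_Ex-L_Ey : ∀ x y → L_E (x - y) ≈ L_E x - L_E y
  L_E[x-y]≈L_Ex-L_Ey x y = begin
    L_E (x - y)              ≈⟨ L_E≈L _ ⟩
    L k v (x - y)            ≈⟨ L-+ x (- y) ⟩
    L k v x + L k v (- y)    ≈⟨ +-congˡ (trans (L-cong k v (sym (-1*x≈-x y))) (trans (L-scale y (𝔽-neg 𝔽-1#)) (-1*x≈-x _))) ⟩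
    L k v x - L k v y        ≈⟨ sym (+-cong (L_E≈L x) (-‿cong (L_E≈L y))) ⟩
    L_E x - L_E y            ∎

  L_E-injective-on-F : ∀ {x y} → mem F x → mem F y → L_E x ≈ L_E y → x ≈ y
  L_E-injective-on-F {x} {y} x∈F y∈F L_Ex≈L_Ey with mem? E (x - y)
  ... | yes x-y∈E = x-y≈0⇒x≈y (E∩F≈0 (x - y) x-y∈E (-∈ F x∈F y∈F))
  ... | no x-y∉E  = ⊥-elim (L_E-≉0 x-y∉E (trans (L_E[x-y]≈L_Ex-L_Ey x y) (x≈y⇒x-y≈0 L_Ex≈L_Ey)))

  invPowSum′ : ∀ {p} {P : Pred Carrier p} → Decidable P → Carrier
  invPowSum′ P? = ∑ (enum (nonzeroIn? K P?)) invPow′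

  nonzero-resp : ∀ {p} {P : Pred Carrier p} → P Respects _≈_ → NonzeroIn K P Respects _≈_
  nonzero-resp P-resp x≈y (x≉0 , Px) = (λ y≈0 → x≉0 (trans x≈y y≈0)) , P-resp x≈y Px

  invPowSum≈invPowSum′ : ∀ {p} {P : Pred Carrier p} (P? : Decidable P) → P Respects _≈_ → invPowSum K q P? ≈ invPowSum′ P?
  invPowSum≈invPowSum′ P? P-resp = trans (reflexive (sumList≡∑ (enum (nonzeroIn? K P?)) _))
    (∑.fold-cong-∈ (enum (nonzeroIn? K P?)) λ x∈ → sym (invPow′≈invPow (proj₁ (∈-enum⁻ (nonzeroIn? K P?) (nonzero-resp P-resp) x∈))))

  InSum-resp : InSum K E F Respects _≈_
  InSum-resp x≈y = Any.map λ (e∈E , x-e∈F) → e∈E , resp F (+-congʳ x≈y) x-e∈F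

  InImage-resp : InImage K E F Respects _≈_
  InImage-resp x≈y = Any.map λ (f∈F , x≈L_Ef) → f∈F , trans (sym x≈y) x≈L_Ef

  e+f∈E⊕F : ∀ {e f} → mem E e → mem F f → InSum K E F (e + f)
  e+f∈E⊕F {e} {f} e∈E f∈F = Any.map (λ e≈e′ → resp E e≈e′ e∈E , resp F (e+f-e′≈f e≈e′) f∈F) (complete e)
    where
    e+f-e′≈f : ∀ {e′} → e ≈ e′ → f ≈ (e + f) - e′
    e+f-e′≈f e≈e′ = trans (solve 2 (λ e f → f := (e :+ f) :- e) refl e f) (+-congˡ (-‿cong e≈e′))

  L_E[f]∈L_E[F] : ∀ {f} → mem F f → InImage K E F (L_E f)
  L_E[f]∈L_E[F] {f} f∈F = Any.map (λ f≈f′ → resp F f≈f′ f∈F , L_E-cong f≈f′) (complete f)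

  F* : Decidable (NonzeroIn K (mem F))
  F* = nonzeroIn? K (mem? F)

  E⊕F∖E : Decidable (InSum K E F ∩ ∁ (mem E))
  E⊕F∖E = inSum? K E F ∩? ∁? (mem? E)

  invPowSum′-E⊕F-split : invPowSum′ (inSum? K E F) ≈ invPowSum′ (mem? E) + ∑ (enum E⊕F∖E) invPow′
  invPowSum′-E⊕F-split = trans (∑.fold-split (nonzeroIn? K (inSum? K E F)) (mem? E) elements invPow′)
    (+-cong (∑.fold-enum-≐ _ (nonzeroIn? K (mem? E)) (λ ((x≉0 , _) , x∈E) → x≉0 , x∈E)
                                                    (λ (x≉0 , x∈E) → (x≉0 , E⊆E⊕F x∈E) , x∈E) invPow′)
            (∑.fold-enum-≐ _ E⊕F∖E (λ ((_ , x∈E⊕F) , x∉E) → x∈E⊕F , x∉E)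
                                   (λ (x∈E⊕F , x∉E) → ((λ x≈0 → x∉E (resp E (sym x≈0) (mem-0 E))) , x∈E⊕F) , x∉E) invPow′))
    where
    E⊆E⊕F : ∀ {x} → mem E x → InSum K E F x
    E⊆E⊕F {x} x∈E = InSum-resp (+-identityʳ x) (e+f∈E⊕F x∈E (mem-0 F))

  E⊕F∖E-decomposition : ProductDecomposition (mem E) (NonzeroIn K (mem F)) (InSum K E F ∩ ∁ (mem E)) _+_
  E⊕F∖E-decomposition = record
    { cong       = +-cong
    ; maps       = λ {e} {f} e∈E (f≉0 , f∈F) → e+f∈E⊕F e∈E f∈F , λ e+f∈E →
                     f≉0 (E∩F≈0 f (resp E (solve 2 (λ e f → (e :+ f) :- e := f) refl e f) (-∈ E e+f∈E e∈E)) f∈F)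
    ; injective  = unique
    ; surjective = λ {z} (z∈E⊕F , z∉E) → let e , e∈E , z-e∈F = Any.satisfied z∈E⊕F in
                     e , z - e , e∈E , ((λ z-e≈0 → z∉E (resp E (sym (x-y≈0⇒x≈y z-e≈0)) e∈E)) , z-e∈F) ,
                     solve 2 (λ z e → z := e :+ (z :- e)) refl z e
    }
    where
    unique : ∀ {e f e′ f′} → mem E e → NonzeroIn K (mem F) f → mem E e′ → NonzeroIn K (mem F) f′ → e + f ≈ e′ + f′ → e ≈ e′ × f ≈ f′
    unique {e} {f} {e′} {f′} e∈E (_ , f∈F) e′∈E (_ , f′∈F) e+f≈e′+f′ = e≈e′ , f≈f′
      where
      f′-f≈e-e′ : f′ - f ≈ e - e′
      f′-f≈e-e′ = begin
        f′ - f                              ≈⟨ solve 4 (λ e f e′ f′ → f′ :- f := ((e′ :+ f′) :- (e :+ f)) :+ (e :- e′)) refl e f e′ f′ ⟩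
        ((e′ + f′) - (e + f)) + (e - e′)    ≈⟨ +-congʳ (x≈y⇒x-y≈0 (sym e+f≈e′+f′)) ⟩
        0# + (e - e′)                       ≈⟨ +-identityˡ _ ⟩
        e - e′                              ∎
      e≈e′ : e ≈ e′
      e≈e′ = x-y≈0⇒x≈y (E∩F≈0 (e - e′) (-∈ E e∈E e′∈E) (resp F f′-f≈e-e′ (-∈ F f′∈F f∈F)))
      f≈f′ : f ≈ f′
      f≈f′ = begin
        f               ≈⟨ solve 2 (λ e f → f := (e :+ f) :- e) refl e f ⟩
        (e + f) - e     ≈⟨ +-cong e+f≈e′+f′ (-‿cong e≈e′) ⟩
        (e′ + f′) - e′  ≈⟨ solve 2 (λ e f → (e :+ f) :- e := f) refl e′ f′ ⟩
        f′              ∎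

  ∑-coset-E : ∀ {f} → NonzeroIn K (mem F) f → ∑ (enum (mem? E)) (λ e → invPow′ (e + f)) ≈ Δ k v ^ N * invPow′ (L_E f)
  ∑-coset-E {f} (f≉0 , f∈F) = begin
    ∑ (enum (mem? E)) (λ e → invPow′ (e + f))   ≈⟨ ∑.fold-enum-≐ (mem? E) (Span? k v) E⊆Span Span⊆E _ ⟩
    ∑ (spanElements k v) (λ e → invPow′ (e + f)) ≈⟨ ∑.fold-cong (spanElements k v) (λ e → invPow′-cong (+-comm e f)) ⟩
    ∑ (spanElements k v) (λ e → invPow′ (f + e)) ≈⟨ ∑-coset-invPow k v independent f (f∉E ∘ Span⊆E) ⟩
    Δ k v ^ N * invPow (L k v f)                 ≈⟨ *-congˡ (trans (invPow-cong (L-≉0 k v (f∉E ∘ Span⊆E)) (sym (L_E≈L f))) (sym (invPow′≈invPow (L_E-≉0 f∉E)))) ⟩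
    Δ k v ^ N * invPow′ (L_E f)                  ∎
    where
    f∉E : ¬ mem E f
    f∉E f∈E = f≉0 (E∩F≈0 f f∈E f∈F)

  L_E-bijection : BijectionOn (NonzeroIn K (mem F)) (NonzeroIn K (InImage K E F)) L_E
  L_E-bijection = record
    { cong       = L_E-cong
    ; maps       = λ (f≉0 , f∈F) → L_E-≉0 (λ f∈E → f≉0 (E∩F≈0 _ f∈E f∈F)) , L_E[f]∈L_E[F] f∈F
    ; injective  = λ (_ , x∈F) (_ , y∈F) → L_E-injective-on-F x∈F y∈F
    ; surjective = λ {y} (y≉0 , y∈L_E[F]) → let f , f∈F , y≈L_Ef = Any.satisfied y∈L_E[F] in
                     f , ((λ f≈0 → y≉0 (trans y≈L_Ef (trans (L_E-cong f≈0) L_E[0]≈0))) , f∈F) , y≈L_Ef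
    }
    where
    L_E[0]≈0 : L_E 0# ≈ 0#
    L_E[0]≈0 = trans (L_E≈L 0#) (L-vanishes k v (Span-0# k v))

  invPowSum′-direct-sum : invPowSum′ (inSum? K E F) ≈ invPowSum′ (mem? E) + Δ k v ^ N * invPowSum′ (inImage? K E F)
  invPowSum′-direct-sum = begin
    invPowSum′ (inSum? K E F)                                                               ≈⟨ invPowSum′-E⊕F-split ⟩
    invPowSum′ (mem? E) + ∑ (enum E⊕F∖E) invPow′                                            ≈⟨ +-congˡ (∑.fold-decomposition (mem? E) F* E⊕F∖E (resp E) (nonzero-resp (resp F))
                                                                                           (λ x≈y (x∈ , x∉) → InSum-resp x≈y x∈ , λ y∈ → x∉ (resp E (sym x≈y) y∈))
                                                                                           E⊕F∖E-decomposition invPow′ invPow′-cong) ⟩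
    invPowSum′ (mem? E) + ∑ (enum F*) (λ f → ∑ (enum (mem? E)) (λ e → invPow′ (e + f)))     ≈⟨ +-congˡ (∑.fold-cong-∈ (enum F*) (∑-coset-E ∘ ∈-enum⁻ F* (nonzero-resp (resp F)))) ⟩
    invPowSum′ (mem? E) + ∑ (enum F*) (λ f → Δ k v ^ N * invPow′ (L_E f))                   ≈⟨ +-congˡ (sym (*-distribˡ-∑ (enum F*) (Δ k v ^ N) _)) ⟩
    invPowSum′ (mem? E) + Δ k v ^ N * ∑ (enum F*) (invPow′ ∘ L_E)                           ≈⟨ +-congˡ (*-congˡ (∑.fold-bijection F* (nonzeroIn? K (inImage? K E F))
                                                                                           (nonzero-resp (resp F)) (nonzero-resp InImage-resp) L_E-bijection invPow′ invPow′-cong)) ⟩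
    invPowSum′ (mem? E) + Δ k v ^ N * invPowSum′ (inImage? K E F)                                   ∎

  invPowSum-E⊕F : invPowSum K q (inSum? K E F) ≈ invPowSum K q (mem? E) + Δ k v ^ N * invPowSum K q (inImage? K E F)
  invPowSum-E⊕F = trans (invPowSum≈invPowSum′ (inSum? K E F) InSum-resp) (trans invPowSum′-direct-sum
    (sym (+-cong (invPowSum≈invPowSum′ (mem? E) (resp E)) (*-congˡ (invPowSum≈invPowSum′ (inImage? K E F) InImage-resp)))))

open Defs using (card; _^_; moore)

lemma4p9 : {c ℓ : Level} (q n : ℕ) → IsPrimePower q →
    (K : FiniteField c ℓ) → card K ≡ q ^ℕ n →
    (E F : Subspace K q) →
    (∀ x → mem E x → mem F x → FiniteField._≈_ K x (FiniteField.0# K)) →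
    (k : ℕ) (v : Fin k → FiniteField.Carrier K) → IsBasis K q k E v →
    FiniteField._≈_ K
      (invPowSum K q (inSum? K E F))
      (FiniteField._+_ K
        (invPowSum K q (mem? E))
        (FiniteField._*_ K
          (_^_ K (moore K q k v) ((q ∸ 1) *ℕ (q ∸ 1)))
          (invPowSum K q (inImage? K E F))))
lemma4p9 q n q-primePower K card≡qⁿ E F E∩F≈0 k v basis =
  DirectSum.invPowSum-E⊕F K q n q-primePower card≡qⁿ E F E∩F≈0 k v basis
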